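{- Let $\alpha,\beta$ be parameters and $x,y$ variables. Let $T^*(x)$ be the row with horizontal labels in $\{0,1\}$, right boundary value $1$, free left boundary, and weights $W^*(a,b;c,d)=1$ if $(a,b,c,d)=(1,0,1,0)$, $=\frac{1-\beta x}{1+\alpha x}$ if $a=1$ and $(b,c,d)\ne(0,1,0)$, $=\frac{x}{1+\alpha x}$ if $a=0$; and let $t(y)$ be the row with nonnegative integer horizontal labels, right boundary value $0$, free left boundary, and weights $w(a,b;c,d)=(\alpha+\beta)^{a-d-1}(y+\alpha)\beta^{d}$ if $a>d$, $\beta^{a-1}y$ if $0<a\le d$, $1$ if $a=0$. Then for all finitely supported sequences $v$ (bottom) and $u$ (top) of nonnegative integers, $$Z_{v\to u}\big[t(y)\text{ below},\,T^*(x)\text{ above}\big]=\frac{1}{1-xy}\,Z_{v\to u}\big[T^*(x)\text{ below},\,t(y)\text{ above}\big],$$ i.e. $t(y)T^*(x)=\frac{1}{1-xy}T^*(x)t(y)$, as formal power series in $x,y$.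
   Context: A vertex has left label $a$, bottom label $b$, right label $c$, top label $d$; its weight is $0$ unless $a+b=c+d$. A row is a sequence of vertices at sites $j=1,2,\dots$, the right label at site $j$ being the left label at site $j+1$; vertical labels are nonnegative integers; the left label at site 1 is free (summed over) and the right labels must be eventually equal to the prescribed right boundary value. $Z_{v\to u}[A\text{ below}, B\text{ above}]$ denotes the partition function of the two-row lattice with the row $A$ at the bottom, having bottom labels $v$, the row $B$ on top, having top labels $u$, the intermediate vertical labels summed over, i.e. the sum over all labelings of non-prescribed edges of the product of vertex weights. $T^*(x)$ is the dual row transfer matrix of the row model for $G^{(-\alpha,-\beta)}_\lambda$ and $t(y)$ the row transfer matrix of the row model for $g^{(\alpha,\beta)}_\lambda$. -}

module Defs where

open import Level using (Level; _⊔_)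
open import Algebra.Bundles using (CommutativeRing)
open import Data.Nat using (ℕ; zero; suc; _+_; _∸_; _≤_; _<?_)
open import Data.Nat.Properties using (_≟_)
open import Data.List using (List; []; _∷_)
open import Data.Nat.ListAction using (sum)
open import Data.Product using (_×_; ∃-syntax)
open import Relation.Nullary using (yes; no)

-- value of a finitely supported sequence (given as a list, padded by zeros)
-- at site j (sites indexed from 0 here, i.e. site j+1 of the paper)
at : List ℕ → ℕ → ℕ
at []       _       = 0
at (x ∷ _)  zero    = x
at (_ ∷ xs) (suc j) = at xs j

module Model {c ℓ : Level} (R : CommutativeRing c ℓ)
             (α β : CommutativeRing.Carrier R) where
  open CommutativeRing R
    renaming (_+_ to _⊕_; _*_ to _⊗_; -_ to ⊖_)

  -- a formal power series in x, y with coefficients in R: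
  -- PS f, coefficient of x^i y^j is f i j
  PS : Set c
  PS = ℕ → ℕ → Carrier

  pow : Carrier → ℕ → Carrier
  pow r zero    = 1#
  pow r (suc n) = r ⊗ pow r n

  Σ≤ : ℕ → (ℕ → Carrier) → Carrier
  Σ≤ zero    f = f 0
  Σ≤ (suc n) f = Σ≤ n f ⊕ f (suc n)

  0ₛ : PS
  0ₛ _ _ = 0#

  const : Carrier → PS
  const r zero zero = r
  const r _    _    = 0#

  1ₛ : PS
  1ₛ = const 1#

  X : PS
  X 1 0 = 1#
  X _ _ = 0#

  Y : PS
  Y 0 1 = 1#
  Y _ _ = 0#

  _+ₛ_ : PS → PS → PS
  (f +ₛ g) i j = f i j ⊕ g i j

  -ₛ_ : PS → PS
  (-ₛ f) i j = ⊖ (f i j)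

  _*ₛ_ : PS → PS → PS
  (f *ₛ g) i j = Σ≤ i λ k → Σ≤ j λ l → f k l ⊗ g (i ∸ k) (j ∸ l)

  Σₛ : ℕ → (ℕ → PS) → PS
  Σₛ n F i j = Σ≤ n λ k → F k i j

  -- 1/(1 + α x) = Σ_k (-α)^k x^k
  inv1+αx : PS
  inv1+αx i zero    = pow (⊖ α) i
  inv1+αx i (suc _) = 0#

  -- 1/(1 - x y) = Σ_k x^k y^k
  inv1-xy : PS
  inv1-xy i j with i ≟ j
  ... | yes _ = 1#
  ... | no  _ = 0#

  -- Vertex weights: arguments (a, b, c, d) = (left, bottom, right, top)
  VertexWeight : Set c
  VertexWeight = ℕ → ℕ → ℕ → ℕ → PS

  private
    Wst' : VertexWeight
    Wst' 0 b 0 d = X *ₛ inv1+αx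
    Wst' 0 b 1 d = X *ₛ inv1+αx
    Wst' 1 0 1 0 = 1ₛ
    Wst' 1 b 0 d = (1ₛ +ₛ (-ₛ (const β *ₛ X))) *ₛ inv1+αx
    Wst' 1 b 1 d = (1ₛ +ₛ (-ₛ (const β *ₛ X))) *ₛ inv1+αx
    Wst' _ _ _ _ = 0ₛ

    w' : VertexWeight
    w' zero b c d = 1ₛ
    w' (suc a) b c d with d <? suc a
    ... | yes _ = const (pow (α ⊕ β) (a ∸ d)) *ₛ ((Y +ₛ const α) *ₛ const (pow β d))
    ... | no  _ = const (pow β a) *ₛ Y

  Wst : VertexWeight
  Wst a b c d with a + b ≟ c + d
  ... | yes _ = Wst' a b c d
  ... | no  _ = 0ₛ

  wt : VertexWeight
  wt a b c d with a + b ≟ c + d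
  ... | yes _ = w' a b c d
  ... | no  _ = 0ₛ

  -- Two-row lattice on sites j, j+1, ..., j+n-1 (0-indexed), row A (weights WA,
  -- right boundary rA) below with bottom labels v, row B (WB, rB) above with
  -- top labels u; a, b are the incoming left labels of row A and row B.
  -- The intermediate label w and the right labels c, c' are summed over all
  -- values for which the conservation law can hold (other terms vanish).
  go : VertexWeight → ℕ → VertexWeight → ℕ → List ℕ → List ℕ →
       ℕ → ℕ → ℕ → ℕ → PS
  go WA rA WB rB v u zero j a b with a ≟ rA | b ≟ rB
  ... | yes _ | yes _ = 1ₛ
  ... | _     | _     = 0ₛ
  go WA rA WB rB v u (suc n) j a b =
    Σₛ (a + at v j) λ w → Σₛ (a + at v j) λ c → Σₛ (b + w) λ c' →
      (WA a (at v j) c w *ₛ WB b w c' (at u j)) *ₛ go WA rA WB rB v u n (suc j) c c'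

  -- Partition function of the configurations which are trivial (horizontal
  -- labels = boundary values, vertical labels 0) beyond site N.  Left labels
  -- are summed over 0..1+Σv+Σu, which contains every left label of nonzero weight.
  Ztrunc : ℕ → VertexWeight → ℕ → VertexWeight → ℕ → List ℕ → List ℕ → PS
  Ztrunc N WA rA WB rB v u =
    Σₛ B λ lA → Σₛ B λ lB → go WA rA WB rB v u N 0 lA lB
    where B = suc (sum v + sum u)

  Converges : (ℕ → PS) → PS → Set ℓ
  Converges F L = ∀ i j → ∃[ N₀ ] (∀ N → N₀ ≤ N → F N i j ≈ L i j)

  PropStatement : List ℕ → List ℕ → Set (c ⊔ ℓ)
  PropStatement v u =
    ∃[ ZL ] ∃[ ZR ]
      ( Converges (λ N → Ztrunc N wt 0 Wst 1 v u) ZL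
      × Converges (λ N → Ztrunc N Wst 1 wt 0 v u) ZR
      × (∀ i j → ZL i j ≈ (inv1-xy *ₛ ZR) i j))

{-# OPTIONS --safe #-}
module Submission where

-- An R-matrix ℛ, whose weights are rational in x and y, satisfies a
-- local relation with a single column: it carries t(y) below T*(x) into T*(x) below t(y).
-- Pushing ℛ from the right boundary through all columns and evaluating it at the two
-- boundaries gives, on every truncation of the lattice,
--   (1 - xy) Z[t(y) below] + xy Z′ = Z[T*(x) below],
-- where Z′ has the right boundary values of the two rows exchanged.  Beyond the support of
-- u every vertex of T*(x) in Z′ carries a factor x, so Z′ tends to 0 x-adically, while
-- Z[T*(x) below] is eventually constant; dividing by 1 - xy gives the statement.

open import Defs
open import Level using (Level; 0ℓ)
open import Algebra.Bundles using (CommutativeRing; RawRing)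
open import Data.List using (List)
open import Data.Nat as ℕ using (ℕ; zero; suc; _∸_; _≤_; _<_; z≤n; s≤s)
import Data.Nat.Properties as ℕₚ
open import Data.Product using (Σ; _×_; _,_; proj₁; proj₂)
open import Data.Maybe using (just; nothing)
open import Data.Empty using (⊥-elim)
open import Function using (id; _∘_)
open import Relation.Binary.PropositionalEquality as ≡ using (_≡_; _≢_)
open import Relation.Binary.Structures using (IsEquivalence)
open import Relation.Nullary using (Dec; yes; no; WeaklyDecidable)

module FiniteSums {c ℓ : Level} (A : CommutativeRing c ℓ) where
  open CommutativeRing A
  open import Relation.Binary.Reasoning.Setoid setoid

  Σ≤ : ℕ → (ℕ → Carrier) → Carrier
  Σ≤ zero    f = f 0
  Σ≤ (suc n) f = Σ≤ n f + f (suc n)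

  Σ-cong : ∀ n {f g : ℕ → Carrier} → (∀ k → k ≤ n → f k ≈ g k) → Σ≤ n f ≈ Σ≤ n g
  Σ-cong zero    f≈g = f≈g 0 z≤n
  Σ-cong (suc n) f≈g = +-cong (Σ-cong n (λ k k≤n → f≈g k (ℕₚ.m≤n⇒m≤1+n k≤n))) (f≈g (suc n) ℕₚ.≤-refl)

  Σ-cong′ : ∀ n {f g : ℕ → Carrier} → (∀ k → f k ≈ g k) → Σ≤ n f ≈ Σ≤ n g
  Σ-cong′ n f≈g = Σ-cong n (λ k _ → f≈g k)

  Σ-distrib-+ : ∀ n (f g : ℕ → Carrier) → Σ≤ n (λ k → f k + g k) ≈ Σ≤ n f + Σ≤ n g
  Σ-distrib-+ zero    f g = refl
  Σ-distrib-+ (suc n) f g = begin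
    Σ≤ n (λ k → f k + g k) + (f (suc n) + g (suc n)) ≈⟨ +-congʳ (Σ-distrib-+ n f g) ⟩
    (Σ≤ n f + Σ≤ n g) + (f (suc n) + g (suc n))      ≈⟨ interchange _ _ _ _ ⟩
    (Σ≤ n f + f (suc n)) + (Σ≤ n g + g (suc n))      ∎
    where open import Algebra.Properties.CommutativeSemigroup +-commutativeSemigroup using (interchange)

  *-distribˡ-Σ : ∀ n r (f : ℕ → Carrier) → r * Σ≤ n f ≈ Σ≤ n (λ k → r * f k)
  *-distribˡ-Σ zero    r f = refl
  *-distribˡ-Σ (suc n) r f = trans (distribˡ _ _ _) (+-congʳ (*-distribˡ-Σ n r f))

  *-distribʳ-Σ : ∀ n r (f : ℕ → Carrier) → Σ≤ n f * r ≈ Σ≤ n (λ k → f k * r)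
  *-distribʳ-Σ zero    r f = refl
  *-distribʳ-Σ (suc n) r f = trans (distribʳ _ _ _) (+-congʳ (*-distribʳ-Σ n r f))

  Σ-zero : ∀ n (f : ℕ → Carrier) → (∀ k → k ≤ n → f k ≈ 0#) → Σ≤ n f ≈ 0#
  Σ-zero zero    f f≈0 = f≈0 0 z≤n
  Σ-zero (suc n) f f≈0 =
    trans (+-cong (Σ-zero n f (λ k k≤n → f≈0 k (ℕₚ.m≤n⇒m≤1+n k≤n))) (f≈0 (suc n) ℕₚ.≤-refl)) (+-identityˡ _)

  Σ-single : ∀ n k (f : ℕ → Carrier) → k ≤ n → (∀ m → m ≤ n → m ≢ k → f m ≈ 0#) → Σ≤ n f ≈ f k
  Σ-single zero    zero    f _   f≈0 = refl
  Σ-single (suc n) k       f k≤n f≈0 with k ℕₚ.≟ suc n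
  ... | yes ≡.refl = trans (+-congʳ (Σ-zero n f (λ m m≤n → f≈0 m (ℕₚ.m≤n⇒m≤1+n m≤n) (λ { ≡.refl → ℕₚ.1+n≰n m≤n }))))
                           (+-identityˡ _)
  ... | no k≢n = trans (+-congˡ (f≈0 (suc n) ℕₚ.≤-refl (k≢n ∘ ≡.sym)))
                       (trans (+-identityʳ _)
                              (Σ-single n k f (ℕₚ.≤-pred (ℕₚ.≤∧≢⇒< k≤n k≢n)) (λ m m≤n → f≈0 m (ℕₚ.m≤n⇒m≤1+n m≤n))))

  Σ-pair : ∀ n k (f : ℕ → Carrier) → (∀ m → m ≢ k → m ≢ suc k → f m ≈ 0#) → (∀ m → n < m → f m ≈ 0#) →
           Σ≤ n f ≈ f k + f (suc k)
  Σ-pair n k f off-pair beyond = trans (extend (suc k)) (pair (n ℕ.+ suc k) (ℕₚ.m≤n+m (suc k) n))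
    where
    extend : ∀ d → Σ≤ n f ≈ Σ≤ (n ℕ.+ d) f
    extend zero    = reflexive (≡.cong (λ m → Σ≤ m f) (≡.sym (ℕₚ.+-identityʳ n)))
    extend (suc d) = begin
      Σ≤ n f                          ≈⟨ extend d ⟩
      Σ≤ (n ℕ.+ d) f                  ≈⟨ +-identityʳ _ ⟨
      Σ≤ (n ℕ.+ d) f + 0#             ≈⟨ +-congˡ (beyond (suc (n ℕ.+ d)) (s≤s (ℕₚ.m≤m+n n d))) ⟨
      Σ≤ (suc (n ℕ.+ d)) f            ≡⟨ ≡.cong (λ m → Σ≤ m f) (≡.sym (ℕₚ.+-suc n d)) ⟩
      Σ≤ (n ℕ.+ suc d) f              ∎
    pair : ∀ m → suc k ≤ m → Σ≤ m f ≈ f k + f (suc k)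
    pair zero    ()
    pair (suc m) (s≤s k≤m) with k ℕₚ.≟ m
    ... | yes ≡.refl = +-congʳ (Σ-single k k f k≤m (λ j j≤k j≢k → off-pair j j≢k (λ e → ℕₚ.1+n≰n (≡.subst (_≤ k) e j≤k))))
    ... | no k≢m = trans (+-congʳ (pair m (ℕₚ.≤∧≢⇒< k≤m k≢m)))
                         (trans (+-congˡ (off-pair (suc m) (λ e → ℕₚ.1+n≰n (≡.subst (_≤ m) (≡.sym e) k≤m))
                                                          (λ e → k≢m (≡.sym (ℕₚ.suc-injective e)))))
                                (+-identityʳ _))

  Σ-unconsˡ : ∀ n (f : ℕ → Carrier) → Σ≤ (suc n) f ≈ f 0 + Σ≤ n (λ k → f (suc k))
  Σ-unconsˡ zero    f = refl
  Σ-unconsˡ (suc n) f = trans (+-congʳ (Σ-unconsˡ n f)) (+-assoc _ _ _)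

  Σ-reverse : ∀ n (f : ℕ → Carrier) → Σ≤ n f ≈ Σ≤ n (λ k → f (n ∸ k))
  Σ-reverse zero    f = refl
  Σ-reverse (suc n) f = begin
    Σ≤ n f + f (suc n)                         ≈⟨ +-comm _ _ ⟩
    f (suc n) + Σ≤ n f                         ≈⟨ +-congˡ (Σ-reverse n f) ⟩
    f (suc n) + Σ≤ n (λ k → f (suc n ∸ suc k)) ≈⟨ Σ-unconsˡ n (λ k → f (suc n ∸ k)) ⟨
    Σ≤ (suc n) (λ k → f (suc n ∸ k))           ∎

  Σ-triangle : ∀ n (F : ℕ → ℕ → Carrier) →
               Σ≤ n (λ k → Σ≤ k (λ m → F m (k ∸ m))) ≈ Σ≤ n (λ m → Σ≤ (n ∸ m) (F m))
  Σ-triangle zero    F = refl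
  Σ-triangle (suc n) F = begin
    Σ≤ n (λ k → Σ≤ k (λ m → F m (k ∸ m))) + Σ≤ (suc n) (λ m → F m (suc n ∸ m))
      ≈⟨ +-cong (Σ-triangle n F) (+-congˡ (reflexive (≡.cong (F (suc n)) (ℕₚ.n∸n≡0 n)))) ⟩
    Σ≤ n (λ m → Σ≤ (n ∸ m) (F m)) + (Σ≤ n (λ m → F m (suc n ∸ m)) + F (suc n) 0)
      ≈⟨ +-assoc _ _ _ ⟨
    (Σ≤ n (λ m → Σ≤ (n ∸ m) (F m)) + Σ≤ n (λ m → F m (suc n ∸ m))) + F (suc n) 0
      ≈⟨ +-congʳ (Σ-distrib-+ n _ _) ⟨
    Σ≤ n (λ m → Σ≤ (n ∸ m) (F m) + F m (suc n ∸ m)) + F (suc n) 0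
      ≈⟨ +-congʳ (Σ-cong n (λ m m≤n → Σ-snoc (F m) (ℕₚ.+-∸-assoc 1 m≤n))) ⟩
    Σ≤ n (λ m → Σ≤ (suc n ∸ m) (F m)) + F (suc n) 0
      ≡⟨ ≡.cong (λ d → Σ≤ n (λ m → Σ≤ (suc n ∸ m) (F m)) + Σ≤ d (F (suc n))) (≡.sym (ℕₚ.n∸n≡0 n)) ⟩
    Σ≤ (suc n) (λ m → Σ≤ (suc n ∸ m) (F m)) ∎
    where
    Σ-snoc : ∀ {d e} g → e ≡ suc d → Σ≤ d g + g e ≈ Σ≤ e g
    Σ-snoc g ≡.refl = refl

module CauchyProduct {c ℓ : Level} (A : CommutativeRing c ℓ) where
  open CommutativeRing A
  open FiniteSums A
  open import Relation.Binary.Reasoning.Setoid setoid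

  Series : Set c
  Series = ℕ → Carrier

  infix  4 _≋_
  infixl 6 _⊞_
  infixl 7 _⊠_

  _≋_ : Series → Series → Set ℓ
  f ≋ g = ∀ n → f n ≈ g n

  _⊞_ : Series → Series → Series
  (f ⊞ g) n = f n + g n

  ⊟_ : Series → Series
  (⊟ f) n = - f n

  𝟘 𝟙 : Series
  𝟘 _       = 0#
  𝟙 zero    = 1#
  𝟙 (suc _) = 0#

  _⊠_ : Series → Series → Series
  (f ⊠ g) n = Σ≤ n (λ k → f k * g (n ∸ k))

  ⊠-cong : ∀ {f f′ g g′} → f ≋ f′ → g ≋ g′ → f ⊠ g ≋ f′ ⊠ g′
  ⊠-cong f≋f′ g≋g′ n = Σ-cong′ n (λ k → *-cong (f≋f′ k) (g≋g′ (n ∸ k)))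

  ⊠-comm : ∀ f g → f ⊠ g ≋ g ⊠ f
  ⊠-comm f g n = begin
    Σ≤ n (λ k → f k * g (n ∸ k))             ≈⟨ Σ-reverse n _ ⟩
    Σ≤ n (λ k → f (n ∸ k) * g (n ∸ (n ∸ k))) ≈⟨ Σ-cong n (λ k k≤n → trans (*-comm _ _) (*-congʳ (reflexive (≡.cong g (ℕₚ.m∸[m∸n]≡n k≤n))))) ⟩
    Σ≤ n (λ k → g k * f (n ∸ k))             ∎

  ⊠-identityˡ : ∀ f → 𝟙 ⊠ f ≋ f
  ⊠-identityˡ f n = trans (Σ-single n 0 _ z≤n (λ { zero _ 0≢0 → ⊥-elim (0≢0 ≡.refl) ; (suc m) _ _ → zeroˡ _ }))
                          (*-identityˡ _)

  ⊠-distribˡ : ∀ f g h → f ⊠ (g ⊞ h) ≋ f ⊠ g ⊞ f ⊠ h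
  ⊠-distribˡ f g h n = trans (Σ-cong′ n (λ k → distribˡ _ _ _)) (Σ-distrib-+ n _ _)

  ⊠-assoc : ∀ f g h → (f ⊠ g) ⊠ h ≋ f ⊠ (g ⊠ h)
  ⊠-assoc f g h n = begin
    Σ≤ n (λ k → Σ≤ k (λ m → f m * g (k ∸ m)) * h (n ∸ k))
      ≈⟨ Σ-cong′ n (λ k → *-distribʳ-Σ k _ _) ⟩
    Σ≤ n (λ k → Σ≤ k (λ m → f m * g (k ∸ m) * h (n ∸ k)))
      ≈⟨ Σ-cong n (λ k k≤n → Σ-cong k (λ m m≤k → *-congˡ (reflexive (≡.cong h (∸-split k≤n m≤k))))) ⟩
    Σ≤ n (λ k → Σ≤ k (λ m → F m (k ∸ m)))
      ≈⟨ Σ-triangle n F ⟩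
    Σ≤ n (λ m → Σ≤ (n ∸ m) (F m))
      ≈⟨ Σ-cong′ n (λ m → trans (Σ-cong′ (n ∸ m) (λ l → *-assoc _ _ _)) (sym (*-distribˡ-Σ (n ∸ m) _ _))) ⟩
    Σ≤ n (λ m → f m * (g ⊠ h) (n ∸ m)) ∎
    where
    F : ℕ → ℕ → Carrier
    F m l = f m * g l * h ((n ∸ m) ∸ l)
    ∸-split : ∀ {k m} → k ≤ n → m ≤ k → n ∸ k ≡ (n ∸ m) ∸ (k ∸ m)
    ∸-split {k} {m} _ m≤k =
      ≡.trans (≡.cong (n ∸_) (≡.sym (ℕₚ.m+[n∸m]≡n m≤k))) (≡.sym (ℕₚ.∸-+-assoc n m (k ∸ m)))

  seriesRing : CommutativeRing c ℓ
  seriesRing = record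
    { Carrier = Series ; _≈_ = _≋_ ; _+_ = _⊞_ ; _*_ = _⊠_ ; -_ = ⊟_ ; 0# = 𝟘 ; 1# = 𝟙
    ; isCommutativeRing = record
      { isRing = record
        { +-isAbelianGroup = record
          { isGroup = record
            { isMonoid = record
              { isSemigroup = record
                { isMagma = record { isEquivalence = ≋-isEquivalence ; ∙-cong = λ p q n → +-cong (p n) (q n) }
                ; assoc = λ _ _ _ n → +-assoc _ _ _ }
              ; identity = (λ _ n → +-identityˡ _) , (λ _ n → +-identityʳ _) }
            ; inverse = (λ _ n → -‿inverseˡ _) , (λ _ n → -‿inverseʳ _)
            ; ⁻¹-cong = λ p n → -‿cong (p n) }
          ; comm = λ _ _ n → +-comm _ _ }
        ; *-cong = ⊠-cong
        ; *-assoc = ⊠-assoc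
        ; *-identity = ⊠-identityˡ , (λ f n → trans (⊠-comm f 𝟙 n) (⊠-identityˡ f n))
        ; distrib = ⊠-distribˡ
                  , (λ f g h n → trans (⊠-comm (g ⊞ h) f n)
                                       (trans (⊠-distribˡ f g h n) (+-cong (⊠-comm f g n) (⊠-comm f h n)))) }
      ; *-comm = ⊠-comm } }
    where
    ≋-isEquivalence : IsEquivalence _≋_
    ≋-isEquivalence = record { refl = λ n → refl ; sym = λ p n → sym (p n) ; trans = λ p q n → trans (p n) (q n) }

-- A copy of A whose equality is wrapped in a record.  Equality of power series is a
-- function type, which defeats the inference of implicit arguments; a record type does not.
module Boxed {c ℓ : Level} (A : CommutativeRing c ℓ) where
  open CommutativeRing A

  infix 4 _≈ᵇ_
  record _≈ᵇ_ (x y : Carrier) : Set ℓ where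
    constructor box
    field unbox : x ≈ y
  open _≈ᵇ_ public

  boxedRing : CommutativeRing c ℓ
  boxedRing = record
    { Carrier = Carrier ; _≈_ = _≈ᵇ_ ; _+_ = _+_ ; _*_ = _*_ ; -_ = -_ ; 0# = 0# ; 1# = 1#
    ; isCommutativeRing = record
      { isRing = record
        { +-isAbelianGroup = record
          { isGroup = record
            { isMonoid = record
              { isSemigroup = record
                { isMagma = record
                  { isEquivalence = record
                    { refl = box refl ; sym = λ p → box (sym (unbox p)) ; trans = λ p q → box (trans (unbox p) (unbox q)) }
                  ; ∙-cong = λ p q → box (+-cong (unbox p) (unbox q)) }
                ; assoc = λ x y z → box (+-assoc x y z) }
              ; identity = (λ x → box (+-identityˡ x)) , (λ x → box (+-identityʳ x)) }
            ; inverse = (λ x → box (-‿inverseˡ x)) , (λ x → box (-‿inverseʳ x))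
            ; ⁻¹-cong = λ p → box (-‿cong (unbox p)) }
          ; comm = λ x y → box (+-comm x y) }
        ; *-cong = λ p q → box (*-cong (unbox p) (unbox q))
        ; *-assoc = λ x y z → box (*-assoc x y z)
        ; *-identity = (λ x → box (*-identityˡ x)) , (λ x → box (*-identityʳ x))
        ; distrib = (λ x y z → box (distribˡ x y z)) , (λ x y z → box (distribʳ x y z)) }
      ; *-comm = λ x y → box (*-comm x y) } }

-- An integer is a pair (a , b) standing for a - b; keeping the pairs
-- reduced lets the solver cancel opposite monomials, and the constants 0 and 1 are
-- interpreted as 0# and 1# on the nose, so that they may occur in the equations solved.
module IntegerCoefficientSolver {c ℓ : Level} (A : CommutativeRing c ℓ) where
  open CommutativeRing A hiding (zero)
  open import Relation.Binary.Reasoning.Setoid setoid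
  import Algebra.Properties.Semiring.Mult semiring as Mult
  open import Algebra.Properties.Ring ring using (-‿distribˡ-*; -‿distribʳ-*; -0#≈0#)
  open import Algebra.Properties.AbelianGroup +-abelianGroup using (⁻¹-∙-comm; ⁻¹-anti-homo‿-)
  open import Algebra.Properties.Group +-group using (⁻¹-involutive)
  open import Algebra.Properties.CommutativeSemigroup +-commutativeSemigroup using (interchange)
  import Algebra.Solver.Ring.AlmostCommutativeRing as ACR
  import Algebra.Solver.Ring

  private
    -+- : ∀ a b c d → (a - b) + (c - d) ≈ (a + c) - (b + d)
    -+- a b c d = trans (interchange _ _ _ _) (+-congˡ (⁻¹-∙-comm _ _))

    -*- : ∀ a b c d → (a - b) * (c - d) ≈ (a * c + b * d) - (a * d + b * c)
    -*- a b c d = begin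
      (a - b) * (c - d)                          ≈⟨ distribʳ _ _ _ ⟩
      a * (c - d) + - b * (c - d)                ≈⟨ +-cong (distribˡ _ _ _) (distribˡ _ _ _) ⟩
      (a * c + a * - d) + (- b * c + - b * - d)  ≈⟨ +-cong (+-congˡ (sym (-‿distribʳ-* _ _))) (+-cong (sym (-‿distribˡ-* _ _)) neg*neg) ⟩
      (a * c - a * d) + (- (b * c) + b * d)      ≈⟨ +-congˡ (+-comm _ _) ⟩
      (a * c - a * d) + (b * d - b * c)          ≈⟨ -+- _ _ _ _ ⟩
      (a * c + b * d) - (a * d + b * c)          ∎
      where
      neg*neg : - b * - d ≈ b * d
      neg*neg = trans (sym (-‿distribˡ-* _ _)) (trans (-‿cong (sym (-‿distribʳ-* _ _))) (⁻¹-involutive _))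

    -≈- : ∀ a b c d → a + d ≈ c + b → a - b ≈ c - d
    -≈- a b c d a+d≈c+b = begin
      a - b                ≈⟨ +-identityʳ _ ⟨
      (a - b) + 0#         ≈⟨ +-congˡ (-‿inverseʳ d) ⟨
      (a - b) + (d - d)    ≈⟨ -+- _ _ _ _ ⟩
      (a + d) - (b + d)    ≈⟨ +-cong a+d≈c+b (-‿cong (+-comm _ _)) ⟩
      (c + b) - (d + b)    ≈⟨ -+- _ _ _ _ ⟨
      (c - d) + (b - b)    ≈⟨ +-congˡ (-‿inverseʳ b) ⟩
      (c - d) + 0#         ≈⟨ +-identityʳ _ ⟩
      c - d                ∎

    ι : ℕ → Carrier
    ι n = n Mult.× 1#

    reduce : ℕ → ℕ → ℕ × ℕ
    reduce (suc a) (suc b) = reduce a b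
    reduce a       b       = a , b

    ℤ-coefficients : RawRing 0ℓ 0ℓ
    ℤ-coefficients = record
      { Carrier = ℕ × ℕ ; _≈_ = _≡_
      ; _+_ = λ { (a , b) (c , d) → reduce (a ℕ.+ c) (b ℕ.+ d) }
      ; _*_ = λ { (a , b) (c , d) → reduce (a ℕ.* c ℕ.+ b ℕ.* d) (a ℕ.* d ℕ.+ b ℕ.* c) }
      ; -_ = λ { (a , b) → b , a }
      ; 0# = 0 , 0 ; 1# = 1 , 0 }

    ⟦_⟧ : ℕ × ℕ → Carrier
    ⟦ 0 , 0 ⟧ = 0#
    ⟦ 1 , 0 ⟧ = 1#
    ⟦ a , b ⟧ = ι a - ι b

    ⟦⟧-sound : ∀ a b → ⟦ a , b ⟧ ≈ ι a - ι b
    ⟦⟧-sound 0             0       = sym (-‿inverseʳ 0#)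
    ⟦⟧-sound 1             0       = sym (trans (+-cong (+-identityʳ 1#) -0#≈0#) (+-identityʳ 1#))
    ⟦⟧-sound 0             (suc b) = refl
    ⟦⟧-sound 1             (suc b) = refl
    ⟦⟧-sound (suc (suc a)) b       = refl

    reduce-sound : ∀ a b → ⟦ reduce a b ⟧ ≈ ι a - ι b
    reduce-sound (suc a) (suc b) = trans (reduce-sound a b) (-≈- _ _ _ _ (begin
      ι a + (1# + ι b)   ≈⟨ +-congˡ (+-comm _ _) ⟩
      ι a + (ι b + 1#)   ≈⟨ +-assoc _ _ _ ⟨
      (ι a + ι b) + 1#   ≈⟨ +-comm _ _ ⟩
      1# + (ι a + ι b)   ≈⟨ +-assoc _ _ _ ⟨
      (1# + ι a) + ι b   ∎))
    reduce-sound zero    b       = ⟦⟧-sound zero b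
    reduce-sound (suc a) zero    = ⟦⟧-sound (suc a) zero

    ι-+ : ∀ m n → ι (m ℕ.+ n) ≈ ι m + ι n
    ι-+ = Mult.×-homo-+ 1#

    ι-*+* : ∀ a b c d → ι (a ℕ.* c ℕ.+ b ℕ.* d) ≈ ι a * ι c + ι b * ι d
    ι-*+* a b c d = trans (ι-+ (a ℕ.* c) (b ℕ.* d)) (+-cong (Mult.×1-homo-* a c) (Mult.×1-homo-* b d))

    homomorphism : ℤ-coefficients ACR.-Raw-AlmostCommutative⟶ ACR.fromCommutativeRing A
    homomorphism = record
      { ⟦_⟧ = ⟦_⟧
      ; +-homo = λ { (a , b) (c , d) → trans (reduce-sound (a ℕ.+ c) (b ℕ.+ d))
                                             (trans (trans (+-cong (ι-+ a c) (-‿cong (ι-+ b d))) (sym (-+- _ _ _ _)))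
                                                    (sym (+-cong (⟦⟧-sound a b) (⟦⟧-sound c d)))) }
      ; *-homo = λ { (a , b) (c , d) → trans (reduce-sound (a ℕ.* c ℕ.+ b ℕ.* d) (a ℕ.* d ℕ.+ b ℕ.* c))
                                             (trans (trans (+-cong (ι-*+* a b c d) (-‿cong (ι-*+* a b d c))) (sym (-*- _ _ _ _)))
                                                    (sym (*-cong (⟦⟧-sound a b) (⟦⟧-sound c d)))) }
      ; -‿homo = λ { (a , b) → trans (⟦⟧-sound b a) (trans (sym (⁻¹-anti-homo‿- _ _)) (-‿cong (sym (⟦⟧-sound a b)))) }
      ; 0-homo = refl
      ; 1-homo = refl }

    coefficient≟ : ∀ x y → WeaklyDecidable (⟦ x ⟧ ≈ ⟦ y ⟧)
    coefficient≟ (a , b) (c , d) with a ℕ.+ d ℕₚ.≟ c ℕ.+ b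
    ... | yes a+d≡c+b = just (trans (⟦⟧-sound a b) (trans (-≈- _ _ _ _ (trans (sym (ι-+ a d))
                                (trans (reflexive (≡.cong ι a+d≡c+b)) (ι-+ c b)))) (sym (⟦⟧-sound c d))))
    ... | no  _       = nothing

  open Algebra.Solver.Ring ℤ-coefficients (ACR.fromCommutativeRing A) homomorphism coefficient≟ public

module LabelArithmetic where
  open import Data.Nat using (_+_)
  open import Data.Nat.Properties

  two-vertex-conservation : ∀ a b v c c′ w u → a + v ≡ c + w → b + w ≡ c′ + u → a + b + v ≡ c + c′ + u
  two-vertex-conservation a b v c c′ w u lower upper = begin
    a + b + v      ≡⟨ +-assoc a b v ⟩
    a + (b + v)    ≡⟨ ≡.cong (a +_) (+-comm b v) ⟩
    a + (v + b)    ≡⟨ +-assoc a v b ⟨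
    a + v + b      ≡⟨ ≡.cong (_+ b) lower ⟩
    c + w + b      ≡⟨ +-assoc c w b ⟩
    c + (w + b)    ≡⟨ ≡.cong (c +_) (+-comm w b) ⟩
    c + (b + w)    ≡⟨ ≡.cong (c +_) upper ⟩
    c + (c′ + u)   ≡⟨ +-assoc c c′ u ⟨
    c + c′ + u     ∎
    where open ≡.≡-Reasoning

  bound-through-column : ∀ K uⱼ vⱼ a b c c′ w → K + uⱼ < a + b → a + vⱼ ≡ c + w → b + w ≡ c′ + uⱼ → K < c + c′
  bound-through-column K uⱼ vⱼ a b c c′ w K+uⱼ<a+b lower upper = +-cancelʳ-< uⱼ K (c + c′) (begin-strict
    K + uⱼ         <⟨ K+uⱼ<a+b ⟩
    a + b          ≤⟨ m≤m+n (a + b) vⱼ ⟩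
    a + b + vⱼ     ≡⟨ two-vertex-conservation a b vⱼ c c′ w uⱼ lower upper ⟩
    c + c′ + uⱼ    ∎)
    where open ≤-Reasoning

  ∸-<-pred : ∀ {i p k} → suc p ≤ i → i < suc k → i ∸ suc p < k
  ∸-<-pred {suc i} {p} (s≤s _) (s≤s i<k) = ≤-<-trans (m∸n≤m i p) i<k

  m≡u+k⇒1+m≡u+1+k : ∀ {m u k} → m ≡ u + k → suc m ≡ u + suc k
  m≡u+k⇒1+m≡u+1+k {m} {u} {k} e = ≡.trans (≡.cong suc e) (≡.sym (+-suc u k))

  u≡1+m+k⇒m<u : ∀ {m u k} → u ≡ suc (m + k) → m < u
  u≡1+m+k⇒m<u {m} {u} {k} e = ≡.subst (m <_) (≡.sym e) (s≤s (m≤m+n m k))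

  u≡1+m+0⇒1+m≡u+0 : ∀ {m u} → u ≡ suc (m + 0) → suc m ≡ u + 0
  u≡1+m+0⇒1+m≡u+0 {m} {u} e = ≡.trans (≡.cong suc (≡.sym (+-identityʳ m))) (≡.trans (≡.sym e) (≡.sym (+-identityʳ u)))

  u≡1+m+1+k⇒1+m<u : ∀ {m u k} → u ≡ suc (m + suc k) → suc m < u
  u≡1+m+1+k⇒1+m<u {m} {u} {k} e = ≡.subst (suc m <_) (≡.sym e) (s≤s (≡.subst (suc m ≤_) (≡.sym (+-suc m k)) (s≤s (m≤m+n m k))))

  1+m≡u+0⇒0<u : ∀ {m u} → suc m ≡ u + 0 → 0 < u
  1+m≡u+0⇒0<u {m} {u} e = ≡.subst (0 <_) (≡.trans e (+-identityʳ u)) (s≤s z≤n)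

  u≡1+m+k⇒0<u : ∀ {m u k} → u ≡ suc (m + k) → 0 < u
  u≡1+m+k⇒0<u e = ≡.subst (0 <_) (≡.sym e) (s≤s z≤n)

  1+a+0≡u+0⇒u≡1+a : ∀ {a u} → suc (a + 0) ≡ u + 0 → u ≡ suc a
  1+a+0≡u+0⇒u≡1+a {a} {u} e = ≡.trans (≡.sym (+-identityʳ u)) (≡.trans (≡.sym e) (≡.cong suc (+-identityʳ a)))

  1+a+0≡u+1+k⇒u≤a : ∀ {a u k} → suc (a + 0) ≡ u + suc k → u ≤ a
  1+a+0≡u+1+k⇒u≤a {a} {u} {k} e =
    ≡.subst (u ≤_) (+-identityʳ a) (≡.subst (u ≤_) (≡.sym (suc-injective (≡.trans e (+-suc u k)))) (m≤m+n u k))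

  u≡2+a+0+0⇒1+a<u : ∀ {a u} → u ≡ suc (suc (a + 0) + 0) → suc a < u
  u≡2+a+0+0⇒1+a<u {a} {u} e =
    ≡.subst (suc a <_) (≡.sym e) (s≤s (s≤s (≤-reflexive (≡.sym (≡.trans (+-identityʳ (a + 0)) (+-identityʳ a))))))

  1+a<1+a+1+w : ∀ a w → suc a < suc (a + suc w)
  1+a<1+a+1+w a w = s≤s (≡.subst (suc a ≤_) (≡.sym (+-suc a w)) (s≤s (m≤m+n a w)))

  1+a+1+v≡u+0⇒1+a<u : ∀ {a v u} → suc (a + suc v) ≡ u + 0 → suc a < u
  1+a+1+v≡u+0⇒1+a<u {a} {v} {u} e = ≡.subst (suc a <_) (≡.trans e (+-identityʳ u)) (1+a<1+a+1+w a v)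

  u≡2+a+1+v+0⇒1+a<u : ∀ {a v u} → u ≡ suc (suc (a + suc v) + 0) → suc a < u
  u≡2+a+1+v+0⇒1+a<u {a} {v} {u} e =
    ≡.subst (suc a <_) (≡.sym e) (<-trans (1+a<1+a+1+w a v) (s≤s (s≤s (≤-reflexive (≡.sym (+-identityʳ _))))))

  1+a<u⇒a<u : ∀ {a u} → suc a < u → a < u
  1+a<u⇒a<u = <-trans (n<1+n _)

  a+0≡u+0⇒u≡a : ∀ {a u} → a + 0 ≡ u + 0 → u ≡ a
  a+0≡u+0⇒u≡a {a} {u} e = ≡.trans (≡.sym (+-identityʳ u)) (≡.trans (≡.sym e) (+-identityʳ a))

  u≡1+a+w+k⇒a<u : ∀ {a w u k} → u ≡ suc (a + w + k) → a < u
  u≡1+a+w+k⇒a<u {a} {w} {u} {k} e = ≡.subst (a <_) (≡.sym e) (s≤s (≤-trans (m≤m+n a w) (m≤m+n (a + w) k)))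

  a+1+v≡u+0⇒a<u : ∀ {a v u} → a + suc v ≡ u + 0 → a < u
  a+1+v≡u+0⇒a<u {a} {v} {u} e = ≡.subst (a <_) (≡.trans e (+-identityʳ u)) (≡.subst (a <_) (≡.sym (+-suc a v)) (s≤s (m≤m+n a v)))

  u≡a⇒a<1+u : ∀ {a u} → u ≡ a → a < suc u
  u≡a⇒a<1+u e = s≤s (≤-reflexive (≡.sym e))

  0+0≢u+1+k : ∀ {u k} → 0 + 0 ≢ u + suc k
  0+0≢u+1+k {u} {k} e with ≡.trans e (+-suc u k)
  ... | ()

module Intertwining {c ℓ : Level} (R : CommutativeRing c ℓ) (α β : CommutativeRing.Carrier R) where
  open import Data.Nat using (_+_; _≤?_; _<?_)
  open import Data.Nat.Properties
  open import Data.List using ([]; _∷_; length; drop)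
  open import Data.Nat.ListAction using (sum)
  open import Data.Sum as Sum using (_⊎_; inj₁; inj₂; [_,_]′)
  open LabelArithmetic
  open Model R α β
  open CommutativeRing R using (Carrier; _≈_; 0#; 1#) renaming (_+_ to _+ᴿ_; _*_ to _*ᴿ_; -_ to -ᴿ_)
  module R = CommutativeRing R
  module ΣR = FiniteSums R
  open import Algebra.Properties.Ring R.ring using (-0#≈0#)

  Σ≤≡ : ∀ n f → Σ≤ n f ≡ ΣR.Σ≤ n f
  Σ≤≡ zero    f = ≡.refl
  Σ≤≡ (suc n) f = ≡.cong (_+ᴿ f (suc n)) (Σ≤≡ n f)

  -- Power series in x, y are series in x whose coefficients are series in y; the product *ₛ
  -- agrees with theirs coefficientwise, which transports the ring laws to PS.
  private
    S₁ S₂ : CommutativeRing c ℓ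
    S₁ = CauchyProduct.seriesRing R
    S₂ = CauchyProduct.seriesRing S₁
    module S₁ = CommutativeRing S₁
    module S₂ = CommutativeRing S₂

    infix 4 _≈ᵖ_
    _≈ᵖ_ : PS → PS → Set ℓ
    _≈ᵖ_ = S₂._≈_

    *ₛ≈* : ∀ f g → f *ₛ g ≈ᵖ f S₂.* g
    *ₛ≈* f g i j = R.trans (R.reflexive (Σ≤≡ i _))
                    (R.trans (ΣR.Σ-cong′ i (λ k → R.reflexive (Σ≤≡ j _)))
                             (R.reflexive (≡.sym (coefficient i (λ k → f k S₁.* g (i ∸ k))))))
      where
      coefficient : ∀ n (φ : ℕ → ℕ → Carrier) → FiniteSums.Σ≤ S₁ n φ j ≡ ΣR.Σ≤ n (λ k → φ k j)
      coefficient zero    φ = ≡.refl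
      coefficient (suc n) φ = ≡.cong (_+ᴿ φ (suc n) j) (coefficient n φ)

    1ₛ≈1 : 1ₛ ≈ᵖ S₂.1#
    1ₛ≈1 zero    zero    = R.refl
    1ₛ≈1 zero    (suc j) = R.refl
    1ₛ≈1 (suc i) j       = R.refl

    via : ∀ {f g f′ g′} → f ≈ᵖ f′ → f′ ≈ᵖ g′ → g ≈ᵖ g′ → f ≈ᵖ g
    via p q r = S₂.trans p (S₂.trans q (S₂.sym r))

    *ₛ-assoc : ∀ f g h → (f *ₛ g) *ₛ h ≈ᵖ f *ₛ (g *ₛ h)
    *ₛ-assoc f g h = begin
      (f *ₛ g) *ₛ h         ≈⟨ *ₛ≈* (f *ₛ g) h ⟩
      (f *ₛ g) S₂.* h       ≈⟨ S₂.*-congʳ {h} (*ₛ≈* f g) ⟩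
      (f S₂.* g) S₂.* h     ≈⟨ S₂.*-assoc f g h ⟩
      f S₂.* (g S₂.* h)     ≈⟨ S₂.*-congˡ {f} (*ₛ≈* g h) ⟨
      f S₂.* (g *ₛ h)       ≈⟨ *ₛ≈* f (g *ₛ h) ⟨
      f *ₛ (g *ₛ h)         ∎
      where open import Relation.Binary.Reasoning.Setoid S₂.setoid

    PS-ring : CommutativeRing c ℓ
    PS-ring = record
      { Carrier = PS ; _≈_ = _≈ᵖ_ ; _+_ = _+ₛ_ ; _*_ = _*ₛ_ ; -_ = -ₛ_ ; 0# = 0ₛ ; 1# = 1ₛ
      ; isCommutativeRing = record
        { isRing = record
          { +-isAbelianGroup = S₂.+-isAbelianGroup
          ; *-cong = λ {f} {f′} {g} {g′} p q → via (*ₛ≈* f g) (S₂.*-cong p q) (*ₛ≈* f′ g′)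
          ; *-assoc = *ₛ-assoc
          ; *-identity = (λ f → S₂.trans (*ₛ≈* 1ₛ f) (S₂.trans (S₂.*-congʳ {f} 1ₛ≈1) (S₂.*-identityˡ f)))
                       , (λ f → S₂.trans (*ₛ≈* f 1ₛ) (S₂.trans (S₂.*-congˡ {f} 1ₛ≈1) (S₂.*-identityʳ f)))
          ; distrib = (λ f g h → via {f′ = f S₂.* (g +ₛ h)} {g′ = (f S₂.* g) +ₛ (f S₂.* h)}
                                     (*ₛ≈* f (g +ₛ h)) (S₂.distribˡ f g h) (S₂.+-cong (*ₛ≈* f g) (*ₛ≈* f h)))
                    , (λ f g h → via {f′ = (g +ₛ h) S₂.* f} {g′ = (g S₂.* f) +ₛ (h S₂.* f)}
                                     (*ₛ≈* (g +ₛ h) f) (S₂.distribʳ f g h) (S₂.+-cong (*ₛ≈* g f) (*ₛ≈* h f))) }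
        ; *-comm = λ f g → via (*ₛ≈* f g) (S₂.*-comm f g) (*ₛ≈* g f) } }

  open Boxed PS-ring public using (box; unbox) renaming (boxedRing to ℙ)
  module ℙ = CommutativeRing ℙ
  module Σℙ = FiniteSums ℙ
  open ℙ using () renaming (_≈_ to _≈ₛ_; _+_ to _⊞_; _*_ to _⊠_; -_ to ⊟_)
  open IntegerCoefficientSolver ℙ using (solve; _:=_; _:+_; _:*_; _:-_; :-_; con; Polynomial)
  open import Relation.Binary.Reasoning.Setoid ℙ.setoid

  -- The fixed factor is explicit: it cannot be recovered from a product, which reduces to
  -- a function.
  ⊠-congˡ : ∀ a {b b′} → b ≈ₛ b′ → a ⊠ b ≈ₛ a ⊠ b′
  ⊠-congˡ a = ℙ.*-congˡ {a}

  ⊠-congʳ : ∀ {a a′} b → a ≈ₛ a′ → a ⊠ b ≈ₛ a′ ⊠ b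
  ⊠-congʳ b = ℙ.*-congʳ {b}

  ⊞-congˡ : ∀ a {b b′} → b ≈ₛ b′ → a ⊞ b ≈ₛ a ⊞ b′
  ⊞-congˡ a = ℙ.+-congˡ {a}

  ⊞-congʳ : ∀ {a a′} b → a ≈ₛ a′ → a ⊞ b ≈ₛ a′ ⊞ b
  ⊞-congʳ b = ℙ.+-congʳ {b}


  Supported-at : PS → ℕ → ℕ → Set ℓ
  Supported-at g a b = (∀ k l → k ≢ a → g k l ≈ 0#) × (∀ k l → l ≢ b → g k l ≈ 0#)

  module _ {g : PS} {a b : ℕ} (supported : Supported-at g a b) (f : PS) where
    open Σ supported renaming (proj₁ to off-a; proj₂ to off-b)

    ⊠-supported : ∀ i j → (g ⊠ f) (a + i) (b + j) ≈ g a b *ᴿ f i j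
    ⊠-supported i j = R.trans (R.reflexive (Σ≤≡ (a + i) _))
      (R.trans (ΣR.Σ-single (a + i) a _ (m≤m+n a i)
                 (λ k _ k≢a → R.trans (R.reflexive (Σ≤≡ (b + j) _))
                                       (ΣR.Σ-zero (b + j) _ (λ l _ → R.trans (R.*-congʳ (off-a k l k≢a)) (R.zeroˡ _)))))
      (R.trans (R.reflexive (Σ≤≡ (b + j) _))
      (R.trans (ΣR.Σ-single (b + j) b _ (m≤m+n b j) (λ l _ l≢b → R.trans (R.*-congʳ (off-b a l l≢b)) (R.zeroˡ _)))
               (R.reflexive (≡.cong₂ (λ i′ j′ → g a b *ᴿ f i′ j′) (m+n∸m≡n a i) (m+n∸m≡n b j))))))

    ⊠-supported-below : ∀ i j → i < a → (g ⊠ f) i j ≈ 0#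
    ⊠-supported-below i j i<a = R.trans (R.reflexive (Σ≤≡ i _)) (ΣR.Σ-zero i _ (λ k k≤i →
      R.trans (R.reflexive (Σ≤≡ j _)) (ΣR.Σ-zero j _ (λ l _ →
        R.trans (R.*-congʳ (off-a k l (λ { ≡.refl → <⇒≱ i<a k≤i }))) (R.zeroˡ _)))))

    ⊠-supported-left : ∀ i j → j < b → (g ⊠ f) i j ≈ 0#
    ⊠-supported-left i j j<b = R.trans (R.reflexive (Σ≤≡ i _)) (ΣR.Σ-zero i _ (λ k _ →
      R.trans (R.reflexive (Σ≤≡ j _)) (ΣR.Σ-zero j _ (λ l l≤j →
        R.trans (R.*-congʳ (off-b k l (λ { ≡.refl → <⇒≱ j<b l≤j }))) (R.zeroˡ _)))))

  const-supported : ∀ r → Supported-at (const r) 0 0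
  const-supported r = off-0 , off-0′
    where
    off-0 : ∀ k l → k ≢ 0 → const r k l ≈ 0#
    off-0 zero    l 0≢0 = ⊥-elim (0≢0 ≡.refl)
    off-0 (suc k) l _   = R.refl
    off-0′ : ∀ k l → l ≢ 0 → const r k l ≈ 0#
    off-0′ zero    zero    0≢0 = ⊥-elim (0≢0 ≡.refl)
    off-0′ zero    (suc l) _   = R.refl
    off-0′ (suc k) l       _   = R.refl

  X-supported : Supported-at X 1 0
  X-supported = off-1 , off-0
    where
    off-1 : ∀ k l → k ≢ 1 → X k l ≈ 0#
    off-1 1 zero    1≢1 = ⊥-elim (1≢1 ≡.refl)
    off-1 1 (suc l) _   = R.refl
    off-1 0 l _ = R.refl
    off-1 (suc (suc k)) l _ = R.refl
    off-0 : ∀ k l → l ≢ 0 → X k l ≈ 0#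
    off-0 1 zero    0≢0 = ⊥-elim (0≢0 ≡.refl)
    off-0 1 (suc l) _   = R.refl
    off-0 0 l _ = R.refl
    off-0 (suc (suc k)) l _ = R.refl

  Y-supported : Supported-at Y 0 1
  Y-supported = off-0 , off-1
    where
    off-0 : ∀ k l → k ≢ 0 → Y k l ≈ 0#
    off-0 0 l 0≢0 = ⊥-elim (0≢0 ≡.refl)
    off-0 (suc k) l _ = R.refl
    off-1 : ∀ k l → l ≢ 1 → Y k l ≈ 0#
    off-1 0 1 1≢1 = ⊥-elim (1≢1 ≡.refl)
    off-1 0 0 _ = R.refl
    off-1 0 (suc (suc l)) _ = R.refl
    off-1 (suc k) l _ = R.refl

  const-⊠ : ∀ r f i j → (const r ⊠ f) i j ≈ r *ᴿ f i j
  const-⊠ r = ⊠-supported (const-supported r)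

  const-* : ∀ r s → const (r *ᴿ s) ≈ₛ const r ⊠ const s
  const-* r s = box (λ i j → R.sym (R.trans (const-⊠ r (const s) i j) (coefficient i j)))
    where
    coefficient : ∀ i j → r *ᴿ const s i j ≈ const (r *ᴿ s) i j
    coefficient zero    zero    = R.refl
    coefficient zero    (suc j) = R.zeroʳ _
    coefficient (suc i) j       = R.zeroʳ _

  const-+ : ∀ r s → const (r +ᴿ s) ≈ₛ const r ⊞ const s
  const-+ r s = box coefficient
    where
    coefficient : ∀ i j → const (r +ᴿ s) i j ≈ (const r ⊞ const s) i j
    coefficient zero    zero    = R.refl
    coefficient zero    (suc j) = R.sym (R.+-identityˡ _)
    coefficient (suc i) j       = R.sym (R.+-identityˡ _)

  α̂ β̂ : PS
  α̂ = const α
  β̂ = const β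

  𝟎 𝟏 : ∀ {n} → Polynomial n
  𝟎 = con (0 , 0)
  𝟏 = con (1 , 0)

  inv1+αx-inverse : (1ₛ ⊞ α̂ ⊠ X) ⊠ inv1+αx ≈ₛ 1ₛ
  inv1+αx-inverse = begin
    (1ₛ ⊞ α̂ ⊠ X) ⊠ inv1+αx          ≈⟨ solve 3 (λ i a x → (𝟏 :+ a :* x) :* i := i :+ a :* (x :* i)) ℙ.refl inv1+αx α̂ X ⟩
    inv1+αx ⊞ α̂ ⊠ (X ⊠ inv1+αx)     ≈⟨ box (λ i j → R.trans (R.+-congˡ (const-⊠ α (X ⊠ inv1+αx) i j)) (coefficient i j)) ⟩
    1ₛ                              ∎
    where
    open import Algebra.Properties.Ring R.ring using (-‿distribˡ-*)
    x-shift : ∀ i j → (X ⊠ inv1+αx) (suc i) j ≈ inv1+αx i j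
    x-shift i j = R.trans (⊠-supported X-supported inv1+αx i j) (R.*-identityˡ _)
    no-constant-term : ∀ j → α *ᴿ (X ⊠ inv1+αx) 0 j ≈ 0#
    no-constant-term j = R.trans (R.*-congˡ (⊠-supported-below X-supported inv1+αx 0 j (s≤s z≤n))) (R.zeroʳ _)
    coefficient : ∀ i j → inv1+αx i j +ᴿ α *ᴿ (X ⊠ inv1+αx) i j ≈ 1ₛ i j
    coefficient zero    zero    = R.trans (R.+-congˡ (no-constant-term 0)) (R.+-identityʳ _)
    coefficient zero    (suc j) = R.trans (R.+-congˡ (no-constant-term (suc j))) (R.+-identityʳ _)
    coefficient (suc i) zero    = R.trans (R.+-congˡ (R.*-congˡ (x-shift i 0)))
                                          (R.trans (R.+-congʳ (R.sym (-‿distribˡ-* α _))) (R.-‿inverseˡ _))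
    coefficient (suc i) (suc j) = R.trans (R.+-congˡ (R.trans (R.*-congˡ (x-shift i (suc j))) (R.zeroʳ _))) (R.+-identityʳ _)

  -- Since 1/(1+αx) = 1 - α ξ with ξ = x/(1+αx), every weight of T*(x) is a polynomial in ξ:
  -- Î = 1/(1+αx), B̂ = (1-βx)/(1+αx) and D̂ = (1-xy)/(1+αx).  Hence the local relations
  -- below are polynomial identities in ξ, α, β and y, which the ring solver verifies.
  ξ Î B̂ D̂ : PS
  ξ = X ⊠ inv1+αx
  Î = 1ₛ ⊞ ⊟ (α̂ ⊠ ξ)
  B̂ = Î ⊞ ⊟ (β̂ ⊠ ξ)
  D̂ = Î ⊞ ⊟ (ξ ⊠ Y)

  inv1+αx≈Î : inv1+αx ≈ₛ Î
  inv1+αx≈Î = begin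
    inv1+αx                                       ≈⟨ solve 3 (λ i a x → i := (𝟏 :+ a :* x) :* i :- a :* (x :* i)) ℙ.refl inv1+αx α̂ X ⟩
    (1ₛ ⊞ α̂ ⊠ X) ⊠ inv1+αx ⊞ ⊟ (α̂ ⊠ ξ)          ≈⟨ ℙ.+-congʳ inv1+αx-inverse ⟩
    Î                                             ∎

  1-βx/1+αx≈B̂ : (1ₛ ⊞ ⊟ (β̂ ⊠ X)) ⊠ inv1+αx ≈ₛ B̂
  1-βx/1+αx≈B̂ = begin
    (1ₛ ⊞ ⊟ (β̂ ⊠ X)) ⊠ inv1+αx     ≈⟨ solve 3 (λ i b x → (𝟏 :- b :* x) :* i := i :- b :* (x :* i)) ℙ.refl inv1+αx β̂ X ⟩
    inv1+αx ⊞ ⊟ (β̂ ⊠ ξ)            ≈⟨ ℙ.+-congʳ inv1+αx≈Î ⟩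
    B̂                              ∎

  -- Vertex weights

  Pβ Pγ : ℕ → PS
  Pβ a = const (pow β a)
  Pγ a = const (pow (α +ᴿ β) a)

  -- τ a d is the weight of a vertex of t(y) with left label a and top label d;
  -- τ₊ a d = τ (suc a) d is split off to mirror the definition of wt.
  τ₊ : ℕ → ℕ → PS
  τ₊ a d with d <? suc a
  ... | yes _ = const (pow (α +ᴿ β) (a ∸ d)) *ₛ ((Y +ₛ const α) *ₛ const (pow β d))
  ... | no  _ = const (pow β a) *ₛ Y

  τ : ℕ → ℕ → PS
  τ zero    d = 1ₛ
  τ (suc a) d = τ₊ a d

  τ₊-≤ : ∀ a d → d ≤ a → τ₊ a d ≈ₛ Pγ (a ∸ d) ⊠ ((Y ⊞ α̂) ⊠ Pβ d)
  τ₊-≤ a d d≤a with d <? suc a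
  ... | yes _   = ℙ.refl
  ... | no  d≮ = ⊥-elim (d≮ (s≤s d≤a))

  τ₊-> : ∀ a d → a < d → τ₊ a d ≈ₛ Pβ a ⊠ Y
  τ₊-> a d a<d with d <? suc a
  ... | yes (s≤s d≤a) = ⊥-elim (<⇒≱ a<d d≤a)
  ... | no  _         = ℙ.refl

  τ₊-diag : ∀ a → τ₊ a a ≈ₛ Pβ a ⊠ (Y ⊞ α̂)
  τ₊-diag a = begin
    τ₊ a a                              ≈⟨ τ₊-≤ a a ≤-refl ⟩
    Pγ (a ∸ a) ⊠ ((Y ⊞ α̂) ⊠ Pβ a)       ≡⟨ ≡.cong (λ n → Pγ n ⊠ ((Y ⊞ α̂) ⊠ Pβ a)) (n∸n≡0 a) ⟩
    1ₛ ⊠ ((Y ⊞ α̂) ⊠ Pβ a)               ≈⟨ solve 2 (λ y p → 𝟏 :* (y :* p) := p :* y) ℙ.refl (Y ⊞ α̂) (Pβ a) ⟩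
    Pβ a ⊠ (Y ⊞ α̂)                      ∎

  τ₊-suc-suc : ∀ a d → τ₊ (suc a) (suc d) ≈ₛ β̂ ⊠ τ₊ a d
  τ₊-suc-suc a d with d ≤? a
  ... | yes d≤a = begin
    τ₊ (suc a) (suc d)                       ≈⟨ τ₊-≤ (suc a) (suc d) (s≤s d≤a) ⟩
    Pγ (a ∸ d) ⊠ ((Y ⊞ α̂) ⊠ Pβ (suc d))      ≈⟨ ⊠-congˡ (Pγ (a ∸ d)) (⊠-congˡ (Y ⊞ α̂) (const-* β (pow β d))) ⟩
    Pγ (a ∸ d) ⊠ ((Y ⊞ α̂) ⊠ (β̂ ⊠ Pβ d))     ≈⟨ solve 4 (λ g y b p → g :* (y :* (b :* p)) := b :* (g :* (y :* p))) ℙ.refl (Pγ (a ∸ d)) (Y ⊞ α̂) β̂ (Pβ d) ⟩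
    β̂ ⊠ (Pγ (a ∸ d) ⊠ ((Y ⊞ α̂) ⊠ Pβ d))     ≈⟨ ⊠-congˡ β̂ (τ₊-≤ a d d≤a) ⟨
    β̂ ⊠ τ₊ a d                               ∎
  ... | no d≰a = begin
    τ₊ (suc a) (suc d)     ≈⟨ τ₊-> (suc a) (suc d) (s≤s (≰⇒> d≰a)) ⟩
    Pβ (suc a) ⊠ Y         ≈⟨ ⊠-congʳ Y (const-* β (pow β a)) ⟩
    (β̂ ⊠ Pβ a) ⊠ Y         ≈⟨ ℙ.*-assoc β̂ (Pβ a) Y ⟩
    β̂ ⊠ (Pβ a ⊠ Y)         ≈⟨ ⊠-congˡ β̂ (τ₊-> a d (≰⇒> d≰a)) ⟨
    β̂ ⊠ τ₊ a d             ∎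

  τ₊-suc-≤ : ∀ a d → d ≤ a → τ₊ (suc a) d ≈ₛ (α̂ ⊞ β̂) ⊠ τ₊ a d
  τ₊-suc-≤ a d d≤a = begin
    τ₊ (suc a) d                                          ≈⟨ τ₊-≤ (suc a) d (m≤n⇒m≤1+n d≤a) ⟩
    Pγ (suc a ∸ d) ⊠ ((Y ⊞ α̂) ⊠ Pβ d)                     ≡⟨ ≡.cong (λ n → Pγ n ⊠ ((Y ⊞ α̂) ⊠ Pβ d)) (+-∸-assoc 1 d≤a) ⟩
    Pγ (suc (a ∸ d)) ⊠ ((Y ⊞ α̂) ⊠ Pβ d)                   ≈⟨ ⊠-congʳ ((Y ⊞ α̂) ⊠ Pβ d) (ℙ.trans (const-* (α +ᴿ β) _) (⊠-congʳ (Pγ (a ∸ d)) (const-+ α β))) ⟩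
    ((α̂ ⊞ β̂) ⊠ Pγ (a ∸ d)) ⊠ ((Y ⊞ α̂) ⊠ Pβ d)            ≈⟨ ℙ.*-assoc (α̂ ⊞ β̂) (Pγ (a ∸ d)) ((Y ⊞ α̂) ⊠ Pβ d) ⟩
    (α̂ ⊞ β̂) ⊠ (Pγ (a ∸ d) ⊠ ((Y ⊞ α̂) ⊠ Pβ d))            ≈⟨ ⊠-congˡ (α̂ ⊞ β̂) (τ₊-≤ a d d≤a) ⟨
    (α̂ ⊞ β̂) ⊠ τ₊ a d                                      ∎

  τ₊-zero-zero : τ₊ 0 0 ≈ₛ Y ⊞ α̂
  τ₊-zero-zero = ℙ.trans (τ₊-diag 0) (ℙ.*-identityˡ (Y ⊞ α̂))

  τ₊-zero-> : ∀ d → 0 < d → τ₊ 0 d ≈ₛ Y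
  τ₊-zero-> d 0<d = ℙ.trans (τ₊-> 0 d 0<d) (ℙ.*-identityˡ Y)

  τ₊-zero-suc : ∀ d → τ₊ 0 (suc d) ≈ₛ Y
  τ₊-zero-suc d = τ₊-zero-> (suc d) (s≤s z≤n)

  τ₊-≡ : ∀ a d → d ≡ a → τ₊ a d ≈ₛ Pβ a ⊠ (Y ⊞ α̂)
  τ₊-≡ a .a ≡.refl = τ₊-diag a

  τ₊-≡suc : ∀ a d → d ≡ suc a → τ₊ a d ≈ₛ Pβ a ⊠ Y
  τ₊-≡suc a .(suc a) ≡.refl = τ₊-> a (suc a) ≤-refl

  τ₊-suc-diag : ∀ a d → d ≡ suc a → τ₊ (suc a) d ≈ₛ (β̂ ⊠ Pβ a) ⊠ (Y ⊞ α̂)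
  τ₊-suc-diag a .(suc a) ≡.refl = ℙ.trans (τ₊-diag (suc a)) (⊠-congʳ (Y ⊞ α̂) (const-* β (pow β a)))

  τ₊-suc-> : ∀ a d → suc a < d → τ₊ (suc a) d ≈ₛ (β̂ ⊠ Pβ a) ⊠ Y
  τ₊-suc-> a d sa<d = ℙ.trans (τ₊-> (suc a) d sa<d) (⊠-congʳ Y (const-* β (pow β a)))

  Conserving : VertexWeight → Set ℓ
  Conserving W = ∀ a b c d → a + b ≢ c + d → W a b c d ≈ₛ 0ₛ

  wt-conserving : Conserving wt
  wt-conserving a b c d a+b≢c+d with a + b ≟ c + d
  ... | yes a+b≡c+d = ⊥-elim (a+b≢c+d a+b≡c+d)
  ... | no  _       = ℙ.refl

  Wst-conserving : Conserving Wst
  Wst-conserving a b c d a+b≢c+d with a + b ≟ c + d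
  ... | yes a+b≡c+d = ⊥-elim (a+b≢c+d a+b≡c+d)
  ... | no  _       = ℙ.refl

  wt≈τ : ∀ a b c d → a + b ≡ c + d → wt a b c d ≈ₛ τ a d
  wt≈τ a b c d a+b≡c+d with a + b ≟ c + d
  ... | no a+b≢c+d = ⊥-elim (a+b≢c+d a+b≡c+d)
  wt≈τ zero    b c d _ | yes _ = ℙ.refl
  wt≈τ (suc a) b c d _ | yes _ with d <? suc a
  ... | yes _ = ℙ.refl
  ... | no  _ = ℙ.refl

  -- The weights of T*(x) where conservation holds, clause by clause as in the definition of Wst.
  W* : VertexWeight
  W* 0 b 0 d = X *ₛ inv1+αx
  W* 0 b 1 d = X *ₛ inv1+αx
  W* 1 0 1 0 = 1ₛ
  W* 1 b 0 d = (1ₛ +ₛ (-ₛ (const β *ₛ X))) *ₛ inv1+αx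
  W* 1 b 1 d = (1ₛ +ₛ (-ₛ (const β *ₛ X))) *ₛ inv1+αx
  W* _ _ _ _ = 0ₛ

  Wst≈W* : ∀ a b c d → a + b ≡ c + d → Wst a b c d ≈ₛ W* a b c d
  Wst≈W* a b c d a+b≡c+d with a + b ≟ c + d
  ... | no a+b≢c+d = ⊥-elim (a+b≢c+d a+b≡c+d)
  Wst≈W* 0 b 0 d _ | yes _ = ℙ.refl
  Wst≈W* 0 b 1 d _ | yes _ = ℙ.refl
  Wst≈W* 0 b (suc (suc c)) d _ | yes _ = ℙ.refl
  Wst≈W* 1 0 0 d _ | yes _ = ℙ.refl
  Wst≈W* 1 0 1 0 _ | yes _ = ℙ.refl
  Wst≈W* 1 0 1 (suc d) _ | yes _ = ℙ.refl
  Wst≈W* 1 0 (suc (suc c)) d _ | yes _ = ℙ.refl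
  Wst≈W* 1 (suc b) 0 d _ | yes _ = ℙ.refl
  Wst≈W* 1 (suc b) 1 d _ | yes _ = ℙ.refl
  Wst≈W* 1 (suc b) (suc (suc c)) d _ | yes _ = ℙ.refl
  Wst≈W* (suc (suc a)) b c d _ | yes _ = ℙ.refl

  W*-1-0 : ∀ b d → W* 1 b 0 d ≈ₛ B̂
  W*-1-0 zero    d = 1-βx/1+αx≈B̂
  W*-1-0 (suc b) d = 1-βx/1+αx≈B̂

  Wst-vanishes : ∀ a b c d → W* a b c d ≈ₛ 0ₛ → Wst a b c d ≈ₛ 0ₛ
  Wst-vanishes a b c d W*≈0 = by-conservation (a + b ≟ c + d)
    where
    by-conservation : Dec (a + b ≡ c + d) → Wst a b c d ≈ₛ 0ₛ
    by-conservation (yes a+b≡c+d) = ℙ.trans (Wst≈W* a b c d a+b≡c+d) W*≈0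
    by-conservation (no  a+b≢c+d) = Wst-conserving a b c d a+b≢c+d

  Wst-right≥2 : ∀ a b c d → 2 ≤ c → Wst a b c d ≈ₛ 0ₛ
  Wst-right≥2 a b c d 2≤c = Wst-vanishes a b c d (W*-right≥2 a b c d 2≤c)
    where
    W*-right≥2 : ∀ a b c d → 2 ≤ c → W* a b c d ≈ₛ 0ₛ
    W*-right≥2 0             b       (suc (suc c)) d _ = ℙ.refl
    W*-right≥2 1             0       (suc (suc c)) d _ = ℙ.refl
    W*-right≥2 1             (suc b) (suc (suc c)) d _ = ℙ.refl
    W*-right≥2 (suc (suc a)) b       (suc (suc c)) d _ = ℙ.refl
    W*-right≥2 a             b       1             d (s≤s ())

  Wst-left≥2 : ∀ a b c d → Wst (suc (suc a)) b c d ≈ₛ 0ₛ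
  Wst-left≥2 a b c d = Wst-vanishes (suc (suc a)) b c d ℙ.refl

  open import Algebra.Properties.CommutativeSemigroup ℙ.*-commutativeSemigroup using (xy∙z≈y∙xz)

  -- Columns

  Σₛ≈Σ : ∀ n F → Σₛ n F ≈ₛ Σℙ.Σ≤ n F
  Σₛ≈Σ n F = box (coefficientwise n)
    where
    coefficientwise : ∀ n i j → Σₛ n F i j ≈ Σℙ.Σ≤ n F i j
    coefficientwise zero    i j = R.refl
    coefficientwise (suc n) i j = R.+-congʳ (coefficientwise n i j)

  Σₛ-cong : ∀ n {F G : ℕ → PS} → (∀ k → k ≤ n → F k ≈ₛ G k) → Σₛ n F ≈ₛ Σₛ n G
  Σₛ-cong n F≈G = ℙ.trans (Σₛ≈Σ n _) (ℙ.trans (Σℙ.Σ-cong n F≈G) (ℙ.sym (Σₛ≈Σ n _)))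

  Σₛ-zero : ∀ n (F : ℕ → PS) → (∀ k → k ≤ n → F k ≈ₛ 0ₛ) → Σₛ n F ≈ₛ 0ₛ
  Σₛ-zero n F F≈0 = ℙ.trans (Σₛ≈Σ n F) (Σℙ.Σ-zero n F F≈0)

  Σₛ-single : ∀ n k (F : ℕ → PS) → k ≤ n → (∀ m → m ≤ n → m ≢ k → F m ≈ₛ 0ₛ) → Σₛ n F ≈ₛ F k
  Σₛ-single n k F k≤n F≈0 = ℙ.trans (Σₛ≈Σ n F) (Σℙ.Σ-single n k F k≤n F≈0)

  Σₛ-pair : ∀ n k (F : ℕ → PS) → (∀ m → m ≢ k → m ≢ suc k → F m ≈ₛ 0ₛ) → (∀ m → n < m → F m ≈ₛ 0ₛ) →
            Σₛ n F ≈ₛ F k ⊞ F (suc k)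
  Σₛ-pair n k F off-pair beyond = ℙ.trans (Σₛ≈Σ n F) (Σℙ.Σ-pair n k F off-pair beyond)

  Σₛ-linear : ∀ n P Q (f g : ℕ → PS) → Σₛ n (λ k → P ⊠ f k ⊞ Q ⊠ g k) ≈ₛ P ⊠ Σₛ n f ⊞ Q ⊠ Σₛ n g
  Σₛ-linear n P Q f g = begin
    Σₛ n (λ k → P ⊠ f k ⊞ Q ⊠ g k)                         ≈⟨ Σₛ≈Σ n _ ⟩
    Σℙ.Σ≤ n (λ k → P ⊠ f k ⊞ Q ⊠ g k)                      ≈⟨ Σℙ.Σ-distrib-+ n (λ k → P ⊠ f k) (λ k → Q ⊠ g k) ⟩
    Σℙ.Σ≤ n (λ k → P ⊠ f k) ⊞ Σℙ.Σ≤ n (λ k → Q ⊠ g k)      ≈⟨ ℙ.+-cong (Σℙ.*-distribˡ-Σ n P f) (Σℙ.*-distribˡ-Σ n Q g) ⟨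
    P ⊠ Σℙ.Σ≤ n f ⊞ Q ⊠ Σℙ.Σ≤ n g                          ≈⟨ ℙ.+-cong (⊠-congˡ P (Σₛ≈Σ n f)) (⊠-congˡ Q (Σₛ≈Σ n g)) ⟨
    P ⊠ Σₛ n f ⊞ Q ⊠ Σₛ n g                                ∎

  column : VertexWeight → VertexWeight → ℕ → ℕ → (ℕ → ℕ → PS) → ℕ → ℕ → PS
  column WA WB v u F a b =
    Σₛ (a + v) λ w → Σₛ (a + v) λ c → Σₛ (b + w) λ c′ →
      (WA a v c w *ₛ WB b w c′ u) *ₛ F c c′

  column-cong : ∀ WA WB v u {F F′ : ℕ → ℕ → PS} → (∀ c c′ → F c c′ ≈ₛ F′ c c′) → ∀ a b →
                column WA WB v u F a b ≈ₛ column WA WB v u F′ a b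
  column-cong WA WB v u F≈F′ a b = Σₛ-cong (a + v) (λ w _ → Σₛ-cong (a + v) (λ c _ → Σₛ-cong (b + w) (λ c′ _ →
    ⊠-congˡ (WA a v c w ⊠ WB b w c′ u) (F≈F′ c c′))))

  column-linear : ∀ WA WB v u P Q (F F′ : ℕ → ℕ → PS) a b →
                  column WA WB v u (λ c c′ → P ⊠ F c c′ ⊞ Q ⊠ F′ c c′) a b ≈ₛ
                  P ⊠ column WA WB v u F a b ⊞ Q ⊠ column WA WB v u F′ a b
  column-linear WA WB v u P Q F F′ a b =
    ℙ.trans (Σₛ-cong (a + v) (λ w _ →
      ℙ.trans (Σₛ-cong (a + v) (λ c _ →
        ℙ.trans (Σₛ-cong (b + w) (λ c′ _ → distribute (WA a v c w ⊠ WB b w c′ u) (F c c′) (F′ c c′)))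
                (Σₛ-linear (b + w) P Q (term F w c) (term F′ w c))))
      (Σₛ-linear (a + v) P Q (λ c → Σₛ (b + w) (term F w c)) (λ c → Σₛ (b + w) (term F′ w c)))))
    (Σₛ-linear (a + v) P Q (λ w → Σₛ (a + v) (λ c → Σₛ (b + w) (term F w c)))
                           (λ w → Σₛ (a + v) (λ c → Σₛ (b + w) (term F′ w c))))
    where
    term : (ℕ → ℕ → PS) → ℕ → ℕ → ℕ → PS
    term G w c c′ = (WA a v c w ⊠ WB b w c′ u) ⊠ G c c′
    distribute : ∀ W f f′ → W ⊠ (P ⊠ f ⊞ Q ⊠ f′) ≈ₛ P ⊠ (W ⊠ f) ⊞ Q ⊠ (W ⊠ f′)
    distribute = solve 5 (λ p q W f f′ → W :* (p :* f :+ q :* f′) := p :* (W :* f) :+ q :* (W :* f′)) ℙ.refl P Q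

  lower-vanishes : ∀ a b f → a ≈ₛ 0ₛ → (a ⊠ b) ⊠ f ≈ₛ 0ₛ
  lower-vanishes a b f a≈0 = ℙ.trans (⊠-congʳ f (ℙ.trans (⊠-congʳ b a≈0) (ℙ.zeroˡ b))) (ℙ.zeroˡ f)

  upper-vanishes : ∀ a b f → b ≈ₛ 0ₛ → (a ⊠ b) ⊠ f ≈ₛ 0ₛ
  upper-vanishes a b f b≈0 = ℙ.trans (⊠-congʳ f (ℙ.trans (⊠-congˡ a b≈0) (ℙ.zeroʳ a))) (ℙ.zeroˡ f)

  column-conserving : ∀ WA WB → Conserving WA → Conserving WB → ∀ v u F a b →
    column WA WB v u F a b ≈ₛ
    Σₛ (a + v) (λ w → (WA a v (a + v ∸ w) w ⊠ WB b w (b + w ∸ u) u) ⊠ F (a + v ∸ w) (b + w ∸ u))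
  column-conserving WA WB WA-cons WB-cons v u F a b = Σₛ-cong (a + v) (λ w w≤ →
      ℙ.trans (Σₛ-single (a + v) (a + v ∸ w) _ (m∸n≤m (a + v) w)
                 (λ c _ c≢ → Σₛ-zero (b + w) _ (λ c′ _ → lower-vanishes (WA a v c w) (WB b w c′ u) (F c c′)
                                                   (WA-cons a v c w (λ e → c≢ (≡.sym (right-label e)))))))
              (upper w))
    where
    right-label : ∀ {m c w} → m ≡ c + w → m ∸ w ≡ c
    right-label {m} {c} {w} e = ≡.trans (≡.cong (_∸ w) e) (m+n∸n≡m c w)
    upper : ∀ w → Σₛ (b + w) (λ c′ → (WA a v (a + v ∸ w) w ⊠ WB b w c′ u) ⊠ F (a + v ∸ w) c′)
                  ≈ₛ (WA a v (a + v ∸ w) w ⊠ WB b w (b + w ∸ u) u) ⊠ F (a + v ∸ w) (b + w ∸ u)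
    upper w with u ≤? b + w
    ... | yes u≤ = Σₛ-single (b + w) (b + w ∸ u) _ (m∸n≤m (b + w) u)
                     (λ c′ _ c′≢ → upper-vanishes (WA a v (a + v ∸ w) w) (WB b w c′ u) (F (a + v ∸ w) c′)
                                     (WB-cons b w c′ u (λ e → c′≢ (≡.sym (right-label e)))))
    ... | no u≰ = ℙ.trans (Σₛ-zero (b + w) _ (λ c′ _ → vanish c′)) (ℙ.sym (vanish (b + w ∸ u)))
      where
      vanish : ∀ c′ → (WA a v (a + v ∸ w) w ⊠ WB b w c′ u) ⊠ F (a + v ∸ w) c′ ≈ₛ 0ₛ
      vanish c′ = upper-vanishes (WA a v (a + v ∸ w) w) (WB b w c′ u) (F (a + v ∸ w) c′)
                    (WB-cons b w c′ u (λ e → u≰ (≡.subst (u ≤_) (≡.sym e) (m≤n+m u c′))))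

  2≤∸ : ∀ {d n} → d ≤ n → n ≢ d → n ≢ suc d → 2 ≤ n ∸ d
  2≤∸ {zero}  {zero}        _       n≢d _      = ⊥-elim (n≢d ≡.refl)
  2≤∸ {zero}  {suc zero}    _       _   n≢sd   = ⊥-elim (n≢sd ≡.refl)
  2≤∸ {zero}  {suc (suc n)} _       _   _      = s≤s (s≤s z≤n)
  2≤∸ {suc d} {suc n}       (s≤s p) n≢d n≢sd   = 2≤∸ p (n≢d ∘ ≡.cong suc) (n≢sd ∘ ≡.cong suc)

  Wst-off-diagonal : ∀ a b d → a + b ≢ d → a + b ≢ suc d → Wst a b (a + b ∸ d) d ≈ₛ 0ₛ
  Wst-off-diagonal a b d ≢d ≢sd with d ≤? a + b
  ... | yes d≤ = Wst-right≥2 a b (a + b ∸ d) d (2≤∸ d≤ ≢d ≢sd)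
  ... | no  d≰ = Wst-conserving a b (a + b ∸ d) d (λ e → d≰ (≡.subst (d ≤_) (≡.sym e) (m≤n+m d _)))

  wt-top-exceeds : ∀ a v w → a + v < w → wt a v (a + v ∸ w) w ≈ₛ 0ₛ
  wt-top-exceeds a v w a+v<w = wt-conserving a v (a + v ∸ w) w (λ e → <⇒≱ a+v<w (≡.subst (w ≤_) (≡.sym e) (m≤n+m w _)))

  -- f (m ∸ u), but 0 instead of the junk value f 0 when u > m: a vertex of t(y) whose top
  -- label u exceeds a + v has no conserving right label.
  at-minus : (ℕ → PS) → ℕ → ℕ → PS
  at-minus f m       zero    = f m
  at-minus f zero    (suc u) = 0ₛ
  at-minus f (suc m) (suc u) = at-minus f m u

  at-minus-≤ : ∀ f m u → u ≤ m → at-minus f m u ≡ f (m ∸ u)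
  at-minus-≤ f m       zero    _       = ≡.refl
  at-minus-≤ f (suc m) (suc u) (s≤s p) = at-minus-≤ f m u p

  at-minus-> : ∀ f m u → m < u → at-minus f m u ≡ 0ₛ
  at-minus-> f zero    (suc u) _       = ≡.refl
  at-minus-> f (suc m) (suc u) (s≤s p) = at-minus-> f m u p

  at-minus-+ : ∀ f {m} u k → m ≡ u + k → at-minus f m u ≡ f k
  at-minus-+ f {m} u k m≡u+k = ≡.trans (at-minus-≤ f m u (≡.subst (u ≤_) (≡.sym m≡u+k) (m≤m+n u k)))
                                        (≡.cong f (≡.trans (≡.cong (_∸ u) m≡u+k) (m+n∸m≡n u k)))

  wt-⊠-at-minus : ∀ a v u (f : ℕ → PS) → wt a v (a + v ∸ u) u ⊠ f (a + v ∸ u) ≈ₛ τ a u ⊠ at-minus f (a + v) u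
  wt-⊠-at-minus a v u f with u ≤? a + v
  ... | yes u≤ = ℙ.*-cong {wt a v (a + v ∸ u) u} {τ a u} {f (a + v ∸ u)}
                   (wt≈τ a v (a + v ∸ u) u (≡.sym (m∸n+n≡m u≤))) (ℙ.reflexive (≡.sym (at-minus-≤ f (a + v) u u≤)))
  ... | no u≰ = begin
    wt a v (a + v ∸ u) u ⊠ f (a + v ∸ u)  ≈⟨ wt-vanishes ⟩
    0ₛ                                    ≈⟨ ℙ.zeroʳ (τ a u) ⟨
    τ a u ⊠ 0ₛ                            ≡⟨ ≡.cong (τ a u ⊠_) (≡.sym (at-minus-> f (a + v) u (≰⇒> u≰))) ⟩
    τ a u ⊠ at-minus f (a + v) u          ∎
    where
    wt-vanishes : wt a v (a + v ∸ u) u ⊠ f (a + v ∸ u) ≈ₛ 0ₛ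
    wt-vanishes = ℙ.trans (⊠-congʳ (f (a + v ∸ u)) (wt-top-exceeds a v u (≰⇒> u≰))) (ℙ.zeroˡ (f (a + v ∸ u)))

  summand-tT* : ℕ → ℕ → (ℕ → ℕ → PS) → ℕ → ℕ → ℕ → PS
  summand-tT* v u F a b w = (wt a v (a + v ∸ w) w ⊠ Wst b w (b + w ∸ u) u) ⊠ F (a + v ∸ w) (b + w ∸ u)

  summand-T*t : ℕ → ℕ → (ℕ → ℕ → PS) → ℕ → ℕ → ℕ → PS
  summand-T*t v u G e a w = (Wst e v (e + v ∸ w) w ⊠ wt a w (a + w ∸ u) u) ⊠ G (e + v ∸ w) (a + w ∸ u)

  summand-tT*-value : ∀ v u F a b w c′ → b + w ∸ u ≡ c′ → ∀ {K T} → Wst b w c′ u ≈ₛ K → τ a w ≈ₛ T →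
                      summand-tT* v u F a b w ≈ₛ K ⊠ (T ⊠ at-minus (λ c → F c c′) (a + v) w)
  summand-tT*-value v u F a b w c′ ≡.refl {K} {T} Wst≈K τ≈T = begin
    (lower ⊠ Wst b w (b + w ∸ u) u) ⊠ F (a + v ∸ w) (b + w ∸ u)   ≈⟨ ⊠-congʳ (F (a + v ∸ w) (b + w ∸ u)) (⊠-congˡ lower Wst≈K) ⟩
    (lower ⊠ K) ⊠ F (a + v ∸ w) (b + w ∸ u)                      ≈⟨ xy∙z≈y∙xz lower K (F (a + v ∸ w) (b + w ∸ u)) ⟩
    K ⊠ (lower ⊠ F (a + v ∸ w) (b + w ∸ u))                      ≈⟨ ⊠-congˡ K (wt-⊠-at-minus a v w (λ c → F c (b + w ∸ u))) ⟩
    K ⊠ (τ a w ⊠ at-minus (λ c → F c (b + w ∸ u)) (a + v) w)     ≈⟨ ⊠-congˡ K (⊠-congʳ (at-minus (λ c → F c (b + w ∸ u)) (a + v) w) τ≈T) ⟩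
    K ⊠ (T ⊠ at-minus (λ c → F c (b + w ∸ u)) (a + v) w)         ∎
    where lower = wt a v (a + v ∸ w) w

  summand-T*t-value : ∀ v u G e a w c → e + v ∸ w ≡ c → ∀ {K T} → Wst e v c w ≈ₛ K → τ a u ≈ₛ T →
                      summand-T*t v u G e a w ≈ₛ K ⊠ (T ⊠ at-minus (G c) (a + w) u)
  summand-T*t-value v u G e a w c ≡.refl {K} {T} Wst≈K τ≈T = begin
    (Wst e v (e + v ∸ w) w ⊠ upper) ⊠ G (e + v ∸ w) (a + w ∸ u)  ≈⟨ ⊠-congʳ (G (e + v ∸ w) (a + w ∸ u)) (⊠-congʳ upper Wst≈K) ⟩
    (K ⊠ upper) ⊠ G (e + v ∸ w) (a + w ∸ u)                      ≈⟨ ℙ.*-assoc K upper (G (e + v ∸ w) (a + w ∸ u)) ⟩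
    K ⊠ (upper ⊠ G (e + v ∸ w) (a + w ∸ u))                      ≈⟨ ⊠-congˡ K (wt-⊠-at-minus a w u (G (e + v ∸ w))) ⟩
    K ⊠ (τ a u ⊠ at-minus (G (e + v ∸ w)) (a + w) u)             ≈⟨ ⊠-congˡ K (⊠-congʳ (at-minus (G (e + v ∸ w)) (a + w) u) τ≈T) ⟩
    K ⊠ (T ⊠ at-minus (G (e + v ∸ w)) (a + w) u)                 ∎
    where upper = wt a w (a + w ∸ u) u

  module _ (v u : ℕ) (F : ℕ → ℕ → PS) (a b k : ℕ)
           (nonzero-in-pair : ∀ w → b + w ≡ u ⊎ b + w ≡ suc u → w ≡ k ⊎ w ≡ suc k) where

    column-tT*-pair : column wt Wst v u F a b ≈ₛ summand-tT* v u F a b k ⊞ summand-tT* v u F a b (suc k)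
    column-tT*-pair = ℙ.trans (column-conserving wt Wst wt-conserving Wst-conserving v u F a b)
      (Σₛ-pair (a + v) k (summand-tT* v u F a b)
        (λ w w≢k w≢sk → upper-vanishes (wt a v (a + v ∸ w) w) (Wst b w (b + w ∸ u) u) (F (a + v ∸ w) (b + w ∸ u))
                          (Wst-off-diagonal b w u (λ eq → [ w≢k , w≢sk ]′ (nonzero-in-pair w (inj₁ eq)))
                                                  (λ eq → [ w≢k , w≢sk ]′ (nonzero-in-pair w (inj₂ eq)))))
        (λ w a+v<w → lower-vanishes (wt a v (a + v ∸ w) w) (Wst b w (b + w ∸ u) u) (F (a + v ∸ w) (b + w ∸ u))
                       (wt-top-exceeds a v w a+v<w)))

  module _ (v u : ℕ) (G : ℕ → ℕ → PS) (e a k : ℕ)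
           (nonzero-in-pair : ∀ w → e + v ≡ w ⊎ e + v ≡ suc w → w ≡ k ⊎ w ≡ suc k) where

    column-T*t-pair : column Wst wt v u G e a ≈ₛ summand-T*t v u G e a k ⊞ summand-T*t v u G e a (suc k)
    column-T*t-pair = ℙ.trans (column-conserving Wst wt Wst-conserving wt-conserving v u G e a)
      (Σₛ-pair (e + v) k (summand-T*t v u G e a)
        (λ w w≢k w≢sk → lower-vanishes (Wst e v (e + v ∸ w) w) (wt a w (a + w ∸ u) u) (G (e + v ∸ w) (a + w ∸ u))
                          (Wst-off-diagonal e v w (λ eq → [ w≢k , w≢sk ]′ (nonzero-in-pair w (inj₁ eq)))
                                                  (λ eq → [ w≢k , w≢sk ]′ (nonzero-in-pair w (inj₂ eq)))))
        (λ w e+v<w → lower-vanishes (Wst e v (e + v ∸ w) w) (wt a w (a + w ∸ u) u) (G (e + v ∸ w) (a + w ∸ u))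
                       (Wst-off-diagonal e v w (<⇒≢ e+v<w) (<⇒≢ (m<n⇒m<1+n e+v<w)))))

  -- The values of at-minus and τ are hypotheses, so that callers can supply them evaluated.
  column-tT*-0 : ∀ v u F a {S₀ S₁ T₀ T₁} →
                 at-minus (λ c → F c 0) (a + v) u ≡ S₀ → at-minus (λ c → F c 1) (a + v) (suc u) ≡ S₁ →
                 τ a u ≈ₛ T₀ → τ a (suc u) ≈ₛ T₁ →
                 column wt Wst v u F a 0 ≈ₛ ξ ⊠ (T₀ ⊠ S₀) ⊞ ξ ⊠ (T₁ ⊠ S₁)
  column-tT*-0 v u F a ≡.refl ≡.refl τ≈T₀ τ≈T₁ = ℙ.trans (column-tT*-pair v u F a 0 u (λ w → id))
    (ℙ.+-cong (summand-tT*-value v u F a 0 u 0 (n∸n≡0 u) (Wst≈W* 0 u 0 u ≡.refl) τ≈T₀)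
              (summand-tT*-value v u F a 0 (suc u) 1 (m+n∸n≡m 1 u) (Wst≈W* 0 (suc u) 1 u ≡.refl) τ≈T₁))

  column-tT*-1-zero : ∀ v F a {S₁ T₀} → at-minus (λ c → F c 1) (a + v) 0 ≡ S₁ → τ a 0 ≈ₛ T₀ →
                      column wt Wst v 0 F a 1 ≈ₛ T₀ ⊠ S₁
  column-tT*-1-zero v F a {S₁} {T₀} ≡.refl τ≈T₀ = begin
    column wt Wst v 0 F a 1                                  ≈⟨ column-tT*-pair v 0 F a 1 0 nonzero-in-pair ⟩
    summand-tT* v 0 F a 1 0 ⊞ summand-tT* v 0 F a 1 1        ≈⟨ ℙ.+-cong (summand-tT*-value v 0 F a 1 0 1 ≡.refl (Wst≈W* 1 0 1 0 ≡.refl) τ≈T₀)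
                                                                          (upper-vanishes (wt a v (a + v ∸ 1) 1) (Wst 1 1 2 0) (F (a + v ∸ 1) 2) (Wst-right≥2 1 1 2 0 (s≤s (s≤s z≤n)))) ⟩
    1ₛ ⊠ (T₀ ⊠ S₁) ⊞ 0ₛ                                      ≈⟨ ℙ.trans (ℙ.+-identityʳ (1ₛ ⊠ (T₀ ⊠ S₁))) (ℙ.*-identityˡ (T₀ ⊠ S₁)) ⟩
    T₀ ⊠ S₁                                                  ∎
    where
    nonzero-in-pair : ∀ w → suc w ≡ 0 ⊎ suc w ≡ 1 → w ≡ 0 ⊎ w ≡ 1
    nonzero-in-pair w (inj₂ eq) = inj₁ (suc-injective eq)

  column-tT*-1-suc : ∀ v u F a {S₀ S₁ T₀ T₁} →
                     at-minus (λ c → F c 0) (a + v) u ≡ S₀ → at-minus (λ c → F c 1) (a + v) (suc u) ≡ S₁ →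
                     τ a u ≈ₛ T₀ → τ a (suc u) ≈ₛ T₁ →
                     column wt Wst v (suc u) F a 1 ≈ₛ B̂ ⊠ (T₀ ⊠ S₀) ⊞ B̂ ⊠ (T₁ ⊠ S₁)
  column-tT*-1-suc v u F a ≡.refl ≡.refl τ≈T₀ τ≈T₁ =
    ℙ.trans (column-tT*-pair v (suc u) F a 1 u (λ w → Sum.map suc-injective suc-injective))
      (ℙ.+-cong (summand-tT*-value v (suc u) F a 1 u 0 (n∸n≡0 u) (ℙ.trans (Wst≈W* 1 u 0 (suc u) ≡.refl) (W*-1-0 u (suc u))) τ≈T₀)
                (summand-tT*-value v (suc u) F a 1 (suc u) 1 (m+n∸n≡m 1 u) (ℙ.trans (Wst≈W* 1 (suc u) 1 (suc u) ≡.refl) 1-βx/1+αx≈B̂) τ≈T₁))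

  column-tT*-≥2 : ∀ v u F a b → column wt Wst v u F a (suc (suc b)) ≈ₛ 0ₛ
  column-tT*-≥2 v u F a b = Σₛ-zero (a + v) _ (λ w _ → Σₛ-zero (a + v) _ (λ c _ → Σₛ-zero (suc (suc b) + w) _ (λ c′ _ →
    upper-vanishes (wt a v c w) (Wst (suc (suc b)) w c′ u) (F c c′) (Wst-left≥2 b w c′ u))))

  column-T*t-0-zero : ∀ u G a {S₀ T} → at-minus (G 0) (a + 0) u ≡ S₀ → τ a u ≈ₛ T →
                      column Wst wt 0 u G 0 a ≈ₛ ξ ⊠ (T ⊠ S₀)
  column-T*t-0-zero u G a ≡.refl τ≈T = ℙ.trans (column-conserving Wst wt Wst-conserving wt-conserving 0 u G 0 a)
    (summand-T*t-value 0 u G 0 a 0 0 ≡.refl (Wst≈W* 0 0 0 0 ≡.refl) τ≈T)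

  column-T*t-0-suc : ∀ v u G a {S₀ S₁ T} →
                     at-minus (G 1) (a + v) u ≡ S₁ → at-minus (G 0) (a + suc v) u ≡ S₀ → τ a u ≈ₛ T →
                     column Wst wt (suc v) u G 0 a ≈ₛ ξ ⊠ (T ⊠ S₁) ⊞ ξ ⊠ (T ⊠ S₀)
  column-T*t-0-suc v u G a ≡.refl ≡.refl τ≈T =
    ℙ.trans (column-T*t-pair (suc v) u G 0 a v (λ w → [ inj₂ ∘ ≡.sym , inj₁ ∘ ≡.sym ∘ suc-injective ]′))
      (ℙ.+-cong (summand-T*t-value (suc v) u G 0 a v 1 (m+n∸n≡m 1 v) (Wst≈W* 0 (suc v) 1 v ≡.refl) τ≈T)
                (summand-T*t-value (suc v) u G 0 a (suc v) 0 (n∸n≡0 v) (Wst≈W* 0 (suc v) 0 (suc v) ≡.refl) τ≈T))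

  column-T*t-1-zero : ∀ u G a {S₀ S₁ T} →
                      at-minus (G 1) (a + 0) u ≡ S₁ → at-minus (G 0) (a + 1) u ≡ S₀ → τ a u ≈ₛ T →
                      column Wst wt 0 u G 1 a ≈ₛ 1ₛ ⊠ (T ⊠ S₁) ⊞ B̂ ⊠ (T ⊠ S₀)
  column-T*t-1-zero u G a ≡.refl ≡.refl τ≈T =
    ℙ.trans (column-T*t-pair 0 u G 1 a 0 (λ w → [ inj₂ ∘ ≡.sym , inj₁ ∘ ≡.sym ∘ suc-injective ]′))
      (ℙ.+-cong (summand-T*t-value 0 u G 1 a 0 1 ≡.refl (Wst≈W* 1 0 1 0 ≡.refl) τ≈T)
                (summand-T*t-value 0 u G 1 a 1 0 ≡.refl (ℙ.trans (Wst≈W* 1 0 0 1 ≡.refl) (W*-1-0 0 1)) τ≈T))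

  column-T*t-1-suc : ∀ v u G a {S₀ S₁ T} →
                     at-minus (G 1) (a + suc v) u ≡ S₁ → at-minus (G 0) (a + suc (suc v)) u ≡ S₀ → τ a u ≈ₛ T →
                     column Wst wt (suc v) u G 1 a ≈ₛ B̂ ⊠ (T ⊠ S₁) ⊞ B̂ ⊠ (T ⊠ S₀)
  column-T*t-1-suc v u G a ≡.refl ≡.refl τ≈T =
    ℙ.trans (column-T*t-pair (suc v) u G 1 a (suc v) (λ w → [ inj₂ ∘ ≡.sym , inj₁ ∘ ≡.sym ∘ suc-injective ]′))
      (ℙ.+-cong (summand-T*t-value (suc v) u G 1 a (suc v) 1 (m+n∸n≡m 1 (suc v)) (ℙ.trans (Wst≈W* 1 (suc v) 1 (suc v) ≡.refl) 1-βx/1+αx≈B̂) τ≈T)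
                (summand-T*t-value (suc v) u G 1 a (suc (suc v)) 0 (n∸n≡0 v) (ℙ.trans (Wst≈W* 1 (suc v) 0 (suc (suc v)) ≡.refl) (W*-1-0 (suc v) (suc (suc v)))) τ≈T))

  column-T*t-≥2 : ∀ v u G e a → column Wst wt v u G (suc (suc e)) a ≈ₛ 0ₛ
  column-T*t-≥2 v u G e a = Σₛ-zero (suc (suc e) + v) _ (λ w _ → Σₛ-zero (suc (suc e) + v) _ (λ c _ → Σₛ-zero (a + w) _ (λ c′ _ →
    lower-vanishes (Wst (suc (suc e)) v c w) (wt a w c′ u) (G c c′) (Wst-left≥2 e v c w))))

  -- The local relation

  -- The R-matrix of the train argument, rescaled by 1/(1+αx): ℛ G a b is the sum over the
  -- left labels (e, a′) of T*(x) below t(y), with e + a′ = a + b, of R(a, b; e, a′) G e a′,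
  -- where a and b are the left labels of t(y) below T*(x).
  ℛ₀ ℛ₁ : (ℕ → ℕ → PS) → ℕ → PS
  ℛ₀ G 0             = Î ⊠ G 0 0
  ℛ₀ G 1             = (ξ ⊠ Y) ⊠ G 1 0 ⊞ (β̂ ⊠ ξ) ⊠ G 0 1
  ℛ₀ G (suc (suc k)) = (β̂ ⊠ ξ) ⊠ (G 1 (suc k) ⊞ G 0 (suc (suc k)))
  ℛ₁ G 0             = D̂ ⊠ G 1 0 ⊞ B̂ ⊠ G 0 1
  ℛ₁ G (suc k)       = B̂ ⊠ (G 1 (suc k) ⊞ G 0 (suc (suc k)))

  ℛ : (ℕ → ℕ → PS) → ℕ → ℕ → PS
  ℛ G a 0             = ℛ₀ G a
  ℛ G a 1             = ℛ₁ G a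
  ℛ G a (suc (suc _)) = 0ₛ

  data Offset (m u : ℕ) : Set where
    ≥by : ∀ k → m ≡ u + k → Offset m u
    <by : ∀ k → u ≡ suc (m + k) → Offset m u

  offset : ∀ m u → Offset m u
  offset m       zero    = ≥by m ≡.refl
  offset zero    (suc u) = <by u ≡.refl
  offset (suc m) (suc u) with offset m u
  ... | ≥by k m≡u+k    = ≥by k (≡.cong suc m≡u+k)
  ... | <by k u≡1+m+k  = <by k (≡.cong suc u≡1+m+k)

  ⌜Î⌝ : ∀ {n} → Polynomial n → Polynomial n → Polynomial n
  ⌜Î⌝ x a = 𝟏 :- a :* x

  ⌜B̂⌝ ⌜D̂⌝ : ∀ {n} → Polynomial n → Polynomial n → Polynomial n → Polynomial n
  ⌜B̂⌝ x a b = ⌜Î⌝ x a :- b :* x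
  ⌜D̂⌝ x a y = ⌜Î⌝ x a :- x :* y

  -- The local relation of one column is proved by cases on the left labels, on whether the
  -- bottom label v vanishes, and on the offset of the top label u from the horizontal label
  -- a + v, which decides the surviving terms.
  evaluate-both : ∀ {lhs rhs lhs′ rhs′} → lhs ≈ₛ lhs′ → rhs ≈ₛ rhs′ → lhs′ ≈ₛ rhs′ → lhs ≈ₛ rhs
  evaluate-both lhs≈ rhs≈ lhs′≈rhs′ = ℙ.trans lhs≈ (ℙ.trans lhs′≈rhs′ (ℙ.sym rhs≈))

  local-relation-00 : ∀ v u G → column wt Wst v u (ℛ G) 0 0 ≈ₛ ℛ (column Wst wt v u G) 0 0
  local-relation-00 zero zero G = evaluate-both
      (column-tT*-0 0 0 (ℛ G) 0 ≡.refl ≡.refl ℙ.refl ℙ.refl)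
      (⊠-congˡ Î (column-T*t-0-zero 0 G 0 ≡.refl ℙ.refl))
      (solve 3 (λ x a g →
          x :* (𝟏 :* (⌜Î⌝ x a :* g)) :+ x :* (𝟏 :* 𝟎)
        := ⌜Î⌝ x a :* (x :* (𝟏 :* g)))
        ℙ.refl ξ α̂ (G 0 0))
  local-relation-00 zero (suc u) G = evaluate-both
      (column-tT*-0 0 (suc u) (ℛ G) 0 ≡.refl ≡.refl ℙ.refl ℙ.refl)
      (⊠-congˡ Î (column-T*t-0-zero (suc u) G 0 ≡.refl ℙ.refl))
      (solve 2 (λ x a →
          x :* (𝟏 :* 𝟎) :+ x :* (𝟏 :* 𝟎)
        := ⌜Î⌝ x a :* (x :* (𝟏 :* 𝟎)))
        ℙ.refl ξ α̂)
  local-relation-00 (suc v) u G with offset v u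
  ... | ≥by zero e = evaluate-both
      (column-tT*-0 (suc v) u (ℛ G) 0
          (at-minus-+ (λ c → ℛ G c 0) u 1 (m≡u+k⇒1+m≡u+1+k e)) (at-minus-+ (λ c → ℛ G c 1) u 0 e) ℙ.refl
          ℙ.refl)
      (⊠-congˡ Î
          (column-T*t-0-suc v u G 0 (at-minus-+ (G 1) u 0 e)
              (at-minus-+ (G 0) u 1 (m≡u+k⇒1+m≡u+1+k e)) ℙ.refl))
      (solve 6 (λ x a b y g1 g0 →
          x :* (𝟏 :* (x :* y :* g1 :+ b :* x :* g0)) :+ x :* (𝟏 :* (⌜D̂⌝ x a y :* g1 :+ ⌜B̂⌝ x a b :* g0))
        := ⌜Î⌝ x a :* (x :* (𝟏 :* g1) :+ x :* (𝟏 :* g0)))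
        ℙ.refl ξ α̂ β̂ Y (G 1 0) (G 0 1))
  ... | ≥by (suc k) e = evaluate-both
      (column-tT*-0 (suc v) u (ℛ G) 0
          (at-minus-+ (λ c → ℛ G c 0) u (suc (suc k)) (m≡u+k⇒1+m≡u+1+k e))
          (at-minus-+ (λ c → ℛ G c 1) u (suc k) e) ℙ.refl ℙ.refl)
      (⊠-congˡ Î
          (column-T*t-0-suc v u G 0 (at-minus-+ (G 1) u (suc k) e)
              (at-minus-+ (G 0) u (suc (suc k)) (m≡u+k⇒1+m≡u+1+k e)) ℙ.refl))
      (solve 6 (λ x a b y g1 g0 →
          x :* (𝟏 :* (b :* x :* (g1 :+ g0))) :+ x :* (𝟏 :* (⌜B̂⌝ x a b :* (g1 :+ g0)))
        := ⌜Î⌝ x a :* (x :* (𝟏 :* g1) :+ x :* (𝟏 :* g0)))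
        ℙ.refl ξ α̂ β̂ Y (G 1 (suc k)) (G 0 (suc (suc k))))
  ... | <by zero e = evaluate-both
      (column-tT*-0 (suc v) u (ℛ G) 0
          (at-minus-+ (λ c → ℛ G c 0) u 0 (u≡1+m+0⇒1+m≡u+0 e))
          (at-minus-> (λ c → ℛ G c 1) v u (u≡1+m+k⇒m<u e)) ℙ.refl ℙ.refl)
      (⊠-congˡ Î
          (column-T*t-0-suc v u G 0 (at-minus-> (G 1) v u (u≡1+m+k⇒m<u e))
              (at-minus-+ (G 0) u 0 (u≡1+m+0⇒1+m≡u+0 e)) ℙ.refl))
      (solve 3 (λ x a g →
          x :* (𝟏 :* (⌜Î⌝ x a :* g)) :+ x :* (𝟏 :* 𝟎)
        := ⌜Î⌝ x a :* (x :* (𝟏 :* 𝟎) :+ x :* (𝟏 :* g)))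
        ℙ.refl ξ α̂ (G 0 0))
  ... | <by (suc k) e = evaluate-both
      (column-tT*-0 (suc v) u (ℛ G) 0
          (at-minus-> (λ c → ℛ G c 0) (suc v) u (u≡1+m+1+k⇒1+m<u e))
          (at-minus-> (λ c → ℛ G c 1) v u (u≡1+m+k⇒m<u e)) ℙ.refl ℙ.refl)
      (⊠-congˡ Î
          (column-T*t-0-suc v u G 0 (at-minus-> (G 1) v u (u≡1+m+k⇒m<u e))
              (at-minus-> (G 0) (suc v) u (u≡1+m+1+k⇒1+m<u e)) ℙ.refl))
      (solve 2 (λ x a →
          x :* (𝟏 :* 𝟎) :+ x :* (𝟏 :* 𝟎)
        := ⌜Î⌝ x a :* (x :* (𝟏 :* 𝟎) :+ x :* (𝟏 :* 𝟎)))
        ℙ.refl ξ α̂)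

  local-relation-10 : ∀ v u G → column wt Wst v u (ℛ G) 1 0 ≈ₛ ℛ (column Wst wt v u G) 1 0
  local-relation-10 zero zero G = evaluate-both
      (column-tT*-0 0 0 (ℛ G) 1 ≡.refl ≡.refl τ₊-zero-zero (τ₊-zero-suc 0))
      (ℙ.+-cong
          (⊠-congˡ (ξ ⊠ Y) (column-T*t-1-zero 0 G 0 ≡.refl ≡.refl ℙ.refl))
          (⊠-congˡ (β̂ ⊠ ξ) (column-T*t-0-zero 0 G 1 ≡.refl τ₊-zero-zero)))
      (solve 6 (λ x a b y g10 g01 →
          x :* ((y :+ a) :* (x :* y :* g10 :+ b :* x :* g01)) :+ x :* (y :* (⌜D̂⌝ x a y :* g10 :+ ⌜B̂⌝ x a b :* g01))
        := x :* y :* (𝟏 :* (𝟏 :* g10) :+ ⌜B̂⌝ x a b :* (𝟏 :* g01)) :+ b :* x :* (x :* ((y :+ a) :* g01)))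
        ℙ.refl ξ α̂ β̂ Y (G 1 0) (G 0 1))
  local-relation-10 zero (suc zero) G = evaluate-both
      (column-tT*-0 0 1 (ℛ G) 1 ≡.refl ≡.refl (τ₊-zero-suc 0) (τ₊-zero-suc 1))
      (ℙ.+-cong
          (⊠-congˡ (ξ ⊠ Y) (column-T*t-1-zero 1 G 0 ≡.refl ≡.refl ℙ.refl))
          (⊠-congˡ (β̂ ⊠ ξ) (column-T*t-0-zero 1 G 1 ≡.refl (τ₊-zero-suc 0))))
      (solve 5 (λ x a b y g00 →
          x :* (y :* (⌜Î⌝ x a :* g00)) :+ x :* (y :* 𝟎)
        := x :* y :* (𝟏 :* (𝟏 :* 𝟎) :+ ⌜B̂⌝ x a b :* (𝟏 :* g00)) :+ b :* x :* (x :* (y :* g00)))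
        ℙ.refl ξ α̂ β̂ Y (G 0 0))
  local-relation-10 zero (suc (suc u)) G = evaluate-both
      (column-tT*-0 0 (suc (suc u)) (ℛ G) 1 ≡.refl ≡.refl ℙ.refl (τ₊-zero-suc (suc (suc u))))
      (ℙ.+-cong
          (⊠-congˡ (ξ ⊠ Y) (column-T*t-1-zero (suc (suc u)) G 0 ≡.refl ≡.refl ℙ.refl))
          (⊠-congˡ (β̂ ⊠ ξ) (column-T*t-0-zero (suc (suc u)) G 1 ≡.refl ℙ.refl)))
      (solve 5 (λ x a b y t →
          x :* (t :* 𝟎) :+ x :* (y :* 𝟎)
        := x :* y :* (𝟏 :* (𝟏 :* 𝟎) :+ ⌜B̂⌝ x a b :* (𝟏 :* 𝟎)) :+ b :* x :* (x :* (t :* 𝟎)))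
        ℙ.refl ξ α̂ β̂ Y (τ₊ 0 (suc (suc u))))
  local-relation-10 (suc v) u G with offset (suc v) u
  ... | ≥by zero e = evaluate-both
      (column-tT*-0 (suc v) u (ℛ G) 1
          (at-minus-+ (λ c → ℛ G c 0) u 1 (m≡u+k⇒1+m≡u+1+k e)) (at-minus-+ (λ c → ℛ G c 1) u 0 e)
          (τ₊-zero-> u (1+m≡u+0⇒0<u e)) (τ₊-zero-suc u))
      (ℙ.+-cong
          (⊠-congˡ (ξ ⊠ Y)
              (column-T*t-1-suc v u G 0 (at-minus-+ (G 1) u 0 e)
                  (at-minus-+ (G 0) u 1 (m≡u+k⇒1+m≡u+1+k e)) ℙ.refl))
          (⊠-congˡ (β̂ ⊠ ξ)
              (column-T*t-0-suc v u G 1 (at-minus-+ (G 1) u 0 e)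
                  (at-minus-+ (G 0) u 1 (m≡u+k⇒1+m≡u+1+k e)) (τ₊-zero-> u (1+m≡u+0⇒0<u e)))))
      (solve 6 (λ x a b y g10 g01 →
          x :* (y :* (x :* y :* g10 :+ b :* x :* g01)) :+ x :* (y :* (⌜D̂⌝ x a y :* g10 :+ ⌜B̂⌝ x a b :* g01))
        := x :* y :* (⌜B̂⌝ x a b :* (𝟏 :* g10) :+ ⌜B̂⌝ x a b :* (𝟏 :* g01)) :+ b :* x :* (x :* (y :* g10) :+ x :* (y :* g01)))
        ℙ.refl ξ α̂ β̂ Y (G 1 0) (G 0 1))
  ... | ≥by (suc k) e = evaluate-both
      (column-tT*-0 (suc v) u (ℛ G) 1
          (at-minus-+ (λ c → ℛ G c 0) u (suc (suc k)) (m≡u+k⇒1+m≡u+1+k e))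
          (at-minus-+ (λ c → ℛ G c 1) u (suc k) e) ℙ.refl (τ₊-zero-suc u))
      (ℙ.+-cong
          (⊠-congˡ (ξ ⊠ Y)
              (column-T*t-1-suc v u G 0 (at-minus-+ (G 1) u (suc k) e)
                  (at-minus-+ (G 0) u (suc (suc k)) (m≡u+k⇒1+m≡u+1+k e)) ℙ.refl))
          (⊠-congˡ (β̂ ⊠ ξ)
              (column-T*t-0-suc v u G 1 (at-minus-+ (G 1) u (suc k) e)
                  (at-minus-+ (G 0) u (suc (suc k)) (m≡u+k⇒1+m≡u+1+k e)) ℙ.refl)))
      (solve 7 (λ x a b y t g1 g0 →
          x :* (t :* (b :* x :* (g1 :+ g0))) :+ x :* (y :* (⌜B̂⌝ x a b :* (g1 :+ g0)))
        := x :* y :* (⌜B̂⌝ x a b :* (𝟏 :* g1) :+ ⌜B̂⌝ x a b :* (𝟏 :* g0)) :+ b :* x :* (x :* (t :* g1) :+ x :* (t :* g0)))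
        ℙ.refl ξ α̂ β̂ Y (τ₊ 0 u) (G 1 (suc k)) (G 0 (suc (suc k))))
  ... | <by zero e = evaluate-both
      (column-tT*-0 (suc v) u (ℛ G) 1
          (at-minus-+ (λ c → ℛ G c 0) u 0 (u≡1+m+0⇒1+m≡u+0 e))
          (at-minus-> (λ c → ℛ G c 1) (suc v) u (u≡1+m+k⇒m<u e)) (τ₊-zero-> u (u≡1+m+k⇒0<u {suc v} {u} {0} e))
          (τ₊-zero-suc u))
      (ℙ.+-cong
          (⊠-congˡ (ξ ⊠ Y)
              (column-T*t-1-suc v u G 0
                  (at-minus-> (G 1) (suc v) u (u≡1+m+k⇒m<u e)) (at-minus-+ (G 0) u 0 (u≡1+m+0⇒1+m≡u+0 e))
                  ℙ.refl))
          (⊠-congˡ (β̂ ⊠ ξ)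
              (column-T*t-0-suc v u G 1
                  (at-minus-> (G 1) (suc v) u (u≡1+m+k⇒m<u e)) (at-minus-+ (G 0) u 0 (u≡1+m+0⇒1+m≡u+0 e))
                  (τ₊-zero-> u (u≡1+m+k⇒0<u {suc v} {u} {0} e)))))
      (solve 5 (λ x a b y g00 →
          x :* (y :* (⌜Î⌝ x a :* g00)) :+ x :* (y :* 𝟎)
        := x :* y :* (⌜B̂⌝ x a b :* (𝟏 :* 𝟎) :+ ⌜B̂⌝ x a b :* (𝟏 :* g00)) :+ b :* x :* (x :* (y :* 𝟎) :+ x :* (y :* g00)))
        ℙ.refl ξ α̂ β̂ Y (G 0 0))
  ... | <by (suc k) e = evaluate-both
      (column-tT*-0 (suc v) u (ℛ G) 1
          (at-minus-> (λ c → ℛ G c 0) (suc (suc v)) u (u≡1+m+1+k⇒1+m<u e))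
          (at-minus-> (λ c → ℛ G c 1) (suc v) u (u≡1+m+k⇒m<u e)) ℙ.refl (τ₊-zero-suc u))
      (ℙ.+-cong
          (⊠-congˡ (ξ ⊠ Y)
              (column-T*t-1-suc v u G 0
                  (at-minus-> (G 1) (suc v) u (u≡1+m+k⇒m<u e))
                  (at-minus-> (G 0) (suc (suc v)) u (u≡1+m+1+k⇒1+m<u e)) ℙ.refl))
          (⊠-congˡ (β̂ ⊠ ξ)
              (column-T*t-0-suc v u G 1
                  (at-minus-> (G 1) (suc v) u (u≡1+m+k⇒m<u e))
                  (at-minus-> (G 0) (suc (suc v)) u (u≡1+m+1+k⇒1+m<u e)) ℙ.refl)))
      (solve 5 (λ x a b y t →
          x :* (t :* 𝟎) :+ x :* (y :* 𝟎)
        := x :* y :* (⌜B̂⌝ x a b :* (𝟏 :* 𝟎) :+ ⌜B̂⌝ x a b :* (𝟏 :* 𝟎)) :+ b :* x :* (x :* (t :* 𝟎) :+ x :* (t :* 𝟎)))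
        ℙ.refl ξ α̂ β̂ Y (τ₊ 0 u))

  local-relation-20 : ∀ v u G a → column wt Wst v u (ℛ G) (suc (suc a)) 0 ≈ₛ ℛ (column Wst wt v u G) (suc (suc a)) 0
  local-relation-20 zero u G a with offset (suc (a + 0)) u
  ... | ≥by zero e = evaluate-both
      (column-tT*-0 0 u (ℛ G) (suc (suc a))
          (at-minus-+ (λ c → ℛ G c 0) u 1 (m≡u+k⇒1+m≡u+1+k e)) (at-minus-+ (λ c → ℛ G c 1) u 0 e)
          (τ₊-suc-diag a u (1+a+0≡u+0⇒u≡1+a e))
          (ℙ.trans (τ₊-suc-suc a u) (⊠-congˡ β̂ (τ₊-≡suc a u (1+a+0≡u+0⇒u≡1+a e)))))
      (⊠-congˡ (β̂ ⊠ ξ)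
          (ℙ.+-cong
              (column-T*t-1-zero u G (suc a) (at-minus-+ (G 1) u 0 e)
                  (at-minus-+ (G 0) u 1 (≡.trans (≡.cong suc (+-suc a 0)) (m≡u+k⇒1+m≡u+1+k e)))
                  (τ₊-≡suc a u (1+a+0≡u+0⇒u≡1+a e)))
              (column-T*t-0-zero u G (suc (suc a))
                  (at-minus-+ (G 0) u 1 (m≡u+k⇒1+m≡u+1+k e)) (τ₊-suc-diag a u (1+a+0≡u+0⇒u≡1+a e)))))
      (solve 7 (λ x a b y p g10 g01 →
          x :* (b :* p :* (y :+ a) :* (x :* y :* g10 :+ b :* x :* g01)) :+ x :* (b :* (p :* y) :* (⌜D̂⌝ x a y :* g10 :+ ⌜B̂⌝ x a b :* g01))
        := b :* x :* (𝟏 :* (p :* y :* g10) :+ ⌜B̂⌝ x a b :* (p :* y :* g01) :+ x :* (b :* p :* (y :+ a) :* g01)))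
        ℙ.refl ξ α̂ β̂ Y (Pβ a) (G 1 0) (G 0 1))
  ... | ≥by (suc k) e = evaluate-both
      (column-tT*-0 0 u (ℛ G) (suc (suc a))
          (at-minus-+ (λ c → ℛ G c 0) u (suc (suc k)) (m≡u+k⇒1+m≡u+1+k e))
          (at-minus-+ (λ c → ℛ G c 1) u (suc k) e) (τ₊-suc-≤ a u (1+a+0≡u+1+k⇒u≤a e)) (τ₊-suc-suc a u))
      (⊠-congˡ (β̂ ⊠ ξ)
          (ℙ.+-cong
              (column-T*t-1-zero u G (suc a) (at-minus-+ (G 1) u (suc k) e)
                  (at-minus-+ (G 0) u (suc (suc k)) (≡.trans (≡.cong suc (+-suc a 0)) (m≡u+k⇒1+m≡u+1+k e)))
                  ℙ.refl)
              (column-T*t-0-zero u G (suc (suc a))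
                  (at-minus-+ (G 0) u (suc (suc k)) (m≡u+k⇒1+m≡u+1+k e)) (τ₊-suc-≤ a u (1+a+0≡u+1+k⇒u≤a e)))))
      (solve 7 (λ x a b y t g1 g0 →
          x :* ((a :+ b) :* t :* (b :* x :* (g1 :+ g0))) :+ x :* (b :* t :* (⌜B̂⌝ x a b :* (g1 :+ g0)))
        := b :* x :* (𝟏 :* (t :* g1) :+ ⌜B̂⌝ x a b :* (t :* g0) :+ x :* ((a :+ b) :* t :* g0)))
        ℙ.refl ξ α̂ β̂ Y (τ₊ a u) (G 1 (suc k)) (G 0 (suc (suc k))))
  ... | <by zero e = evaluate-both
      (column-tT*-0 0 u (ℛ G) (suc (suc a))
          (at-minus-+ (λ c → ℛ G c 0) u 0 (u≡1+m+0⇒1+m≡u+0 e))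
          (at-minus-> (λ c → ℛ G c 1) (suc (a + 0)) u (u≡1+m+k⇒m<u e)) (τ₊-suc-> a u (u≡2+a+0+0⇒1+a<u e))
          (ℙ.trans (τ₊-suc-suc a u) (⊠-congˡ β̂ (τ₊-> a u (1+a<u⇒a<u (u≡2+a+0+0⇒1+a<u e))))))
      (⊠-congˡ (β̂ ⊠ ξ)
          (ℙ.+-cong
              (column-T*t-1-zero u G (suc a)
                  (at-minus-> (G 1) (suc (a + 0)) u (u≡1+m+k⇒m<u e))
                  (at-minus-+ (G 0) u 0 (≡.trans (≡.cong suc (+-suc a 0)) (u≡1+m+0⇒1+m≡u+0 e)))
                  (τ₊-> a u (1+a<u⇒a<u (u≡2+a+0+0⇒1+a<u e))))
              (column-T*t-0-zero u G (suc (suc a))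
                  (at-minus-+ (G 0) u 0 (u≡1+m+0⇒1+m≡u+0 e)) (τ₊-suc-> a u (u≡2+a+0+0⇒1+a<u e)))))
      (solve 6 (λ x a b y p g00 →
          x :* (b :* p :* y :* (⌜Î⌝ x a :* g00)) :+ x :* (b :* (p :* y) :* 𝟎)
        := b :* x :* (𝟏 :* (p :* y :* 𝟎) :+ ⌜B̂⌝ x a b :* (p :* y :* g00) :+ x :* (b :* p :* y :* g00)))
        ℙ.refl ξ α̂ β̂ Y (Pβ a) (G 0 0))
  ... | <by (suc k) e = evaluate-both
      (column-tT*-0 0 u (ℛ G) (suc (suc a))
          (at-minus-> (λ c → ℛ G c 0) (suc (suc (a + 0))) u (u≡1+m+1+k⇒1+m<u e))
          (at-minus-> (λ c → ℛ G c 1) (suc (a + 0)) u (u≡1+m+k⇒m<u e)) ℙ.refl (τ₊-suc-suc a u))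
      (⊠-congˡ (β̂ ⊠ ξ)
          (ℙ.+-cong
              (column-T*t-1-zero u G (suc a)
                  (at-minus-> (G 1) (suc (a + 0)) u (u≡1+m+k⇒m<u e))
                  (≡.trans
                      (≡.cong (λ z → at-minus (G 0) z u) (≡.cong suc (+-suc a 0)))
                      (at-minus-> (G 0) (suc (suc (a + 0))) u (u≡1+m+1+k⇒1+m<u e)))
                  ℙ.refl)
              (column-T*t-0-zero u G (suc (suc a))
                  (at-minus-> (G 0) (suc (suc (a + 0))) u (u≡1+m+1+k⇒1+m<u e)) ℙ.refl)))
      (solve 6 (λ x a b y s t →
          x :* (s :* 𝟎) :+ x :* (b :* t :* 𝟎)
        := b :* x :* (𝟏 :* (t :* 𝟎) :+ ⌜B̂⌝ x a b :* (t :* 𝟎) :+ x :* (s :* 𝟎)))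
        ℙ.refl ξ α̂ β̂ Y (τ₊ (suc a) u) (τ₊ a u))
  local-relation-20 (suc v) u G a with offset (suc (a + suc v)) u
  ... | ≥by zero e = evaluate-both
      (column-tT*-0 (suc v) u (ℛ G) (suc (suc a))
          (at-minus-+ (λ c → ℛ G c 0) u 1 (m≡u+k⇒1+m≡u+1+k e)) (at-minus-+ (λ c → ℛ G c 1) u 0 e)
          (τ₊-suc-> a u (1+a+1+v≡u+0⇒1+a<u e))
          (ℙ.trans (τ₊-suc-suc a u) (⊠-congˡ β̂ (τ₊-> a u (1+a<u⇒a<u (1+a+1+v≡u+0⇒1+a<u e))))))
      (⊠-congˡ (β̂ ⊠ ξ)
          (ℙ.+-cong
              (column-T*t-1-suc v u G (suc a) (at-minus-+ (G 1) u 0 e)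
                  (at-minus-+ (G 0) u 1 (≡.trans (≡.cong suc (+-suc a (suc v))) (m≡u+k⇒1+m≡u+1+k e)))
                  (τ₊-> a u (1+a<u⇒a<u (1+a+1+v≡u+0⇒1+a<u e))))
              (column-T*t-0-suc v u G (suc (suc a))
                  (at-minus-+ (G 1) u 0 (≡.trans (≡.cong suc (≡.sym (+-suc a v))) e))
                  (at-minus-+ (G 0) u 1 (m≡u+k⇒1+m≡u+1+k e)) (τ₊-suc-> a u (1+a+1+v≡u+0⇒1+a<u e)))))
      (solve 7 (λ x a b y p g10 g01 →
          x :* (b :* p :* y :* (x :* y :* g10 :+ b :* x :* g01)) :+ x :* (b :* (p :* y) :* (⌜D̂⌝ x a y :* g10 :+ ⌜B̂⌝ x a b :* g01))
        := b :* x :* (⌜B̂⌝ x a b :* (p :* y :* g10) :+ ⌜B̂⌝ x a b :* (p :* y :* g01) :+ (x :* (b :* p :* y :* g10) :+ x :* (b :* p :* y :* g01))))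
        ℙ.refl ξ α̂ β̂ Y (Pβ a) (G 1 0) (G 0 1))
  ... | ≥by (suc k) e = evaluate-both
      (column-tT*-0 (suc v) u (ℛ G) (suc (suc a))
          (at-minus-+ (λ c → ℛ G c 0) u (suc (suc k)) (m≡u+k⇒1+m≡u+1+k e))
          (at-minus-+ (λ c → ℛ G c 1) u (suc k) e) ℙ.refl (τ₊-suc-suc a u))
      (⊠-congˡ (β̂ ⊠ ξ)
          (ℙ.+-cong
              (column-T*t-1-suc v u G (suc a) (at-minus-+ (G 1) u (suc k) e)
                  (at-minus-+ (G 0) u (suc (suc k))
                      (≡.trans (≡.cong suc (+-suc a (suc v))) (m≡u+k⇒1+m≡u+1+k e)))
                  ℙ.refl)
              (column-T*t-0-suc v u G (suc (suc a))
                  (at-minus-+ (G 1) u (suc k) (≡.trans (≡.cong suc (≡.sym (+-suc a v))) e))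
                  (at-minus-+ (G 0) u (suc (suc k)) (m≡u+k⇒1+m≡u+1+k e)) ℙ.refl)))
      (solve 8 (λ x a b y s t g1 g0 →
          x :* (s :* (b :* x :* (g1 :+ g0))) :+ x :* (b :* t :* (⌜B̂⌝ x a b :* (g1 :+ g0)))
        := b :* x :* (⌜B̂⌝ x a b :* (t :* g1) :+ ⌜B̂⌝ x a b :* (t :* g0) :+ (x :* (s :* g1) :+ x :* (s :* g0))))
        ℙ.refl ξ α̂ β̂ Y (τ₊ (suc a) u) (τ₊ a u) (G 1 (suc k)) (G 0 (suc (suc k))))
  ... | <by zero e = evaluate-both
      (column-tT*-0 (suc v) u (ℛ G) (suc (suc a))
          (at-minus-+ (λ c → ℛ G c 0) u 0 (u≡1+m+0⇒1+m≡u+0 e))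
          (at-minus-> (λ c → ℛ G c 1) (suc (a + suc v)) u (u≡1+m+k⇒m<u e))
          (τ₊-suc-> a u (u≡2+a+1+v+0⇒1+a<u e))
          (ℙ.trans (τ₊-suc-suc a u) (⊠-congˡ β̂ (τ₊-> a u (1+a<u⇒a<u (u≡2+a+1+v+0⇒1+a<u e))))))
      (⊠-congˡ (β̂ ⊠ ξ)
          (ℙ.+-cong
              (column-T*t-1-suc v u G (suc a)
                  (at-minus-> (G 1) (suc (a + suc v)) u (u≡1+m+k⇒m<u e))
                  (at-minus-+ (G 0) u 0 (≡.trans (≡.cong suc (+-suc a (suc v))) (u≡1+m+0⇒1+m≡u+0 e)))
                  (τ₊-> a u (1+a<u⇒a<u (u≡2+a+1+v+0⇒1+a<u e))))
              (column-T*t-0-suc v u G (suc (suc a))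
                  (≡.trans
                      (≡.cong (λ z → at-minus (G 1) z u) (≡.cong suc (≡.sym (+-suc a v))))
                      (at-minus-> (G 1) (suc (a + suc v)) u (u≡1+m+k⇒m<u e)))
                  (at-minus-+ (G 0) u 0 (u≡1+m+0⇒1+m≡u+0 e)) (τ₊-suc-> a u (u≡2+a+1+v+0⇒1+a<u e)))))
      (solve 6 (λ x a b y p g00 →
          x :* (b :* p :* y :* (⌜Î⌝ x a :* g00)) :+ x :* (b :* (p :* y) :* 𝟎)
        := b :* x :* (⌜B̂⌝ x a b :* (p :* y :* 𝟎) :+ ⌜B̂⌝ x a b :* (p :* y :* g00) :+ (x :* (b :* p :* y :* 𝟎) :+ x :* (b :* p :* y :* g00))))
        ℙ.refl ξ α̂ β̂ Y (Pβ a) (G 0 0))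
  ... | <by (suc k) e = evaluate-both
      (column-tT*-0 (suc v) u (ℛ G) (suc (suc a))
          (at-minus-> (λ c → ℛ G c 0) (suc (suc (a + suc v))) u (u≡1+m+1+k⇒1+m<u e))
          (at-minus-> (λ c → ℛ G c 1) (suc (a + suc v)) u (u≡1+m+k⇒m<u e)) ℙ.refl (τ₊-suc-suc a u))
      (⊠-congˡ (β̂ ⊠ ξ)
          (ℙ.+-cong
              (column-T*t-1-suc v u G (suc a)
                  (at-minus-> (G 1) (suc (a + suc v)) u (u≡1+m+k⇒m<u e))
                  (≡.trans
                      (≡.cong (λ z → at-minus (G 0) z u) (≡.cong suc (+-suc a (suc v))))
                      (at-minus-> (G 0) (suc (suc (a + suc v))) u (u≡1+m+1+k⇒1+m<u e)))
                  ℙ.refl)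
              (column-T*t-0-suc v u G (suc (suc a))
                  (≡.trans
                      (≡.cong (λ z → at-minus (G 1) z u) (≡.cong suc (≡.sym (+-suc a v))))
                      (at-minus-> (G 1) (suc (a + suc v)) u (u≡1+m+k⇒m<u e)))
                  (at-minus-> (G 0) (suc (suc (a + suc v))) u (u≡1+m+1+k⇒1+m<u e)) ℙ.refl)))
      (solve 6 (λ x a b y s t →
          x :* (s :* 𝟎) :+ x :* (b :* t :* 𝟎)
        := b :* x :* (⌜B̂⌝ x a b :* (t :* 𝟎) :+ ⌜B̂⌝ x a b :* (t :* 𝟎) :+ (x :* (s :* 𝟎) :+ x :* (s :* 𝟎))))
        ℙ.refl ξ α̂ β̂ Y (τ₊ (suc a) u) (τ₊ a u))

  local-relation-01 : ∀ v u G → column wt Wst v u (ℛ G) 0 1 ≈ₛ ℛ (column Wst wt v u G) 0 1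
  local-relation-01 zero zero G = evaluate-both
      (column-tT*-1-zero 0 (ℛ G) 0 ≡.refl ℙ.refl)
      (ℙ.+-cong
          (⊠-congˡ D̂ (column-T*t-1-zero 0 G 0 ≡.refl ≡.refl ℙ.refl))
          (⊠-congˡ B̂ (column-T*t-0-zero 0 G 1 ≡.refl τ₊-zero-zero)))
      (solve 6 (λ x a b y g10 g01 →
          𝟏 :* (⌜D̂⌝ x a y :* g10 :+ ⌜B̂⌝ x a b :* g01)
        := ⌜D̂⌝ x a y :* (𝟏 :* (𝟏 :* g10) :+ ⌜B̂⌝ x a b :* (𝟏 :* g01)) :+ ⌜B̂⌝ x a b :* (x :* ((y :+ a) :* g01)))
        ℙ.refl ξ α̂ β̂ Y (G 1 0) (G 0 1))
  local-relation-01 zero (suc zero) G = evaluate-both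
      (column-tT*-1-suc 0 0 (ℛ G) 0 ≡.refl ≡.refl ℙ.refl ℙ.refl)
      (ℙ.+-cong
          (⊠-congˡ D̂ (column-T*t-1-zero 1 G 0 ≡.refl ≡.refl ℙ.refl))
          (⊠-congˡ B̂ (column-T*t-0-zero 1 G 1 ≡.refl (τ₊-zero-suc 0))))
      (solve 5 (λ x a b y g00 →
          ⌜B̂⌝ x a b :* (𝟏 :* (⌜Î⌝ x a :* g00)) :+ ⌜B̂⌝ x a b :* (𝟏 :* 𝟎)
        := ⌜D̂⌝ x a y :* (𝟏 :* (𝟏 :* 𝟎) :+ ⌜B̂⌝ x a b :* (𝟏 :* g00)) :+ ⌜B̂⌝ x a b :* (x :* (y :* g00)))
        ℙ.refl ξ α̂ β̂ Y (G 0 0))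
  local-relation-01 zero (suc (suc u)) G = evaluate-both
      (column-tT*-1-suc 0 (suc u) (ℛ G) 0 ≡.refl ≡.refl ℙ.refl ℙ.refl)
      (ℙ.+-cong
          (⊠-congˡ D̂ (column-T*t-1-zero (suc (suc u)) G 0 ≡.refl ≡.refl ℙ.refl))
          (⊠-congˡ B̂ (column-T*t-0-zero (suc (suc u)) G 1 ≡.refl ℙ.refl)))
      (solve 5 (λ x a b y t →
          ⌜B̂⌝ x a b :* (𝟏 :* 𝟎) :+ ⌜B̂⌝ x a b :* (𝟏 :* 𝟎)
        := ⌜D̂⌝ x a y :* (𝟏 :* (𝟏 :* 𝟎) :+ ⌜B̂⌝ x a b :* (𝟏 :* 𝟎)) :+ ⌜B̂⌝ x a b :* (x :* (t :* 𝟎)))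
        ℙ.refl ξ α̂ β̂ Y (τ₊ 0 (suc (suc u))))
  local-relation-01 (suc v) zero G = evaluate-both
      (column-tT*-1-zero (suc v) (ℛ G) 0 ≡.refl ℙ.refl)
      (ℙ.+-cong
          (⊠-congˡ D̂ (column-T*t-1-suc v 0 G 0 ≡.refl ≡.refl ℙ.refl))
          (⊠-congˡ B̂ (column-T*t-0-suc v 0 G 1 ≡.refl ≡.refl τ₊-zero-zero)))
      (solve 6 (λ x a b y g1 g0 →
          𝟏 :* (⌜B̂⌝ x a b :* (g1 :+ g0))
        := ⌜D̂⌝ x a y :* (⌜B̂⌝ x a b :* (𝟏 :* g1) :+ ⌜B̂⌝ x a b :* (𝟏 :* g0)) :+ ⌜B̂⌝ x a b :* (x :* ((y :+ a) :* g1) :+ x :* ((y :+ a) :* g0)))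
        ℙ.refl ξ α̂ β̂ Y (G 1 (suc v)) (G 0 (suc (suc v))))
  local-relation-01 (suc v) (suc u) G with offset v u
  ... | ≥by zero e = evaluate-both
      (column-tT*-1-suc (suc v) u (ℛ G) 0
          (at-minus-+ (λ c → ℛ G c 0) u 1 (m≡u+k⇒1+m≡u+1+k e)) (at-minus-+ (λ c → ℛ G c 1) u 0 e) ℙ.refl
          ℙ.refl)
      (ℙ.+-cong
          (⊠-congˡ D̂
              (column-T*t-1-suc v (suc u) G 0 (at-minus-+ (G 1) u 0 e)
                  (at-minus-+ (G 0) u 1 (m≡u+k⇒1+m≡u+1+k e)) ℙ.refl))
          (⊠-congˡ B̂
              (column-T*t-0-suc v (suc u) G 1 (at-minus-+ (G 1) u 0 e)
                  (at-minus-+ (G 0) u 1 (m≡u+k⇒1+m≡u+1+k e)) (τ₊-zero-suc u))))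
      (solve 6 (λ x a b y g10 g01 →
          ⌜B̂⌝ x a b :* (𝟏 :* (x :* y :* g10 :+ b :* x :* g01)) :+ ⌜B̂⌝ x a b :* (𝟏 :* (⌜D̂⌝ x a y :* g10 :+ ⌜B̂⌝ x a b :* g01))
        := ⌜D̂⌝ x a y :* (⌜B̂⌝ x a b :* (𝟏 :* g10) :+ ⌜B̂⌝ x a b :* (𝟏 :* g01)) :+ ⌜B̂⌝ x a b :* (x :* (y :* g10) :+ x :* (y :* g01)))
        ℙ.refl ξ α̂ β̂ Y (G 1 0) (G 0 1))
  ... | ≥by (suc k) e = evaluate-both
      (column-tT*-1-suc (suc v) u (ℛ G) 0
          (at-minus-+ (λ c → ℛ G c 0) u (suc (suc k)) (m≡u+k⇒1+m≡u+1+k e))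
          (at-minus-+ (λ c → ℛ G c 1) u (suc k) e) ℙ.refl ℙ.refl)
      (ℙ.+-cong
          (⊠-congˡ D̂
              (column-T*t-1-suc v (suc u) G 0 (at-minus-+ (G 1) u (suc k) e)
                  (at-minus-+ (G 0) u (suc (suc k)) (m≡u+k⇒1+m≡u+1+k e)) ℙ.refl))
          (⊠-congˡ B̂
              (column-T*t-0-suc v (suc u) G 1 (at-minus-+ (G 1) u (suc k) e)
                  (at-minus-+ (G 0) u (suc (suc k)) (m≡u+k⇒1+m≡u+1+k e)) (τ₊-zero-suc u))))
      (solve 6 (λ x a b y g1 g0 →
          ⌜B̂⌝ x a b :* (𝟏 :* (b :* x :* (g1 :+ g0))) :+ ⌜B̂⌝ x a b :* (𝟏 :* (⌜B̂⌝ x a b :* (g1 :+ g0)))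
        := ⌜D̂⌝ x a y :* (⌜B̂⌝ x a b :* (𝟏 :* g1) :+ ⌜B̂⌝ x a b :* (𝟏 :* g0)) :+ ⌜B̂⌝ x a b :* (x :* (y :* g1) :+ x :* (y :* g0)))
        ℙ.refl ξ α̂ β̂ Y (G 1 (suc k)) (G 0 (suc (suc k))))
  ... | <by zero e = evaluate-both
      (column-tT*-1-suc (suc v) u (ℛ G) 0
          (at-minus-+ (λ c → ℛ G c 0) u 0 (u≡1+m+0⇒1+m≡u+0 e))
          (at-minus-> (λ c → ℛ G c 1) v u (u≡1+m+k⇒m<u e)) ℙ.refl ℙ.refl)
      (ℙ.+-cong
          (⊠-congˡ D̂
              (column-T*t-1-suc v (suc u) G 0 (at-minus-> (G 1) v u (u≡1+m+k⇒m<u e))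
                  (at-minus-+ (G 0) u 0 (u≡1+m+0⇒1+m≡u+0 e)) ℙ.refl))
          (⊠-congˡ B̂
              (column-T*t-0-suc v (suc u) G 1 (at-minus-> (G 1) v u (u≡1+m+k⇒m<u e))
                  (at-minus-+ (G 0) u 0 (u≡1+m+0⇒1+m≡u+0 e)) (τ₊-zero-suc u))))
      (solve 5 (λ x a b y g00 →
          ⌜B̂⌝ x a b :* (𝟏 :* (⌜Î⌝ x a :* g00)) :+ ⌜B̂⌝ x a b :* (𝟏 :* 𝟎)
        := ⌜D̂⌝ x a y :* (⌜B̂⌝ x a b :* (𝟏 :* 𝟎) :+ ⌜B̂⌝ x a b :* (𝟏 :* g00)) :+ ⌜B̂⌝ x a b :* (x :* (y :* 𝟎) :+ x :* (y :* g00)))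
        ℙ.refl ξ α̂ β̂ Y (G 0 0))
  ... | <by (suc k) e = evaluate-both
      (column-tT*-1-suc (suc v) u (ℛ G) 0
          (at-minus-> (λ c → ℛ G c 0) (suc v) u (u≡1+m+1+k⇒1+m<u e))
          (at-minus-> (λ c → ℛ G c 1) v u (u≡1+m+k⇒m<u e)) ℙ.refl ℙ.refl)
      (ℙ.+-cong
          (⊠-congˡ D̂
              (column-T*t-1-suc v (suc u) G 0 (at-minus-> (G 1) v u (u≡1+m+k⇒m<u e))
                  (at-minus-> (G 0) (suc v) u (u≡1+m+1+k⇒1+m<u e)) ℙ.refl))
          (⊠-congˡ B̂
              (column-T*t-0-suc v (suc u) G 1 (at-minus-> (G 1) v u (u≡1+m+k⇒m<u e))
                  (at-minus-> (G 0) (suc v) u (u≡1+m+1+k⇒1+m<u e)) (τ₊-zero-suc u))))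
      (solve 4 (λ x a b y →
          ⌜B̂⌝ x a b :* (𝟏 :* 𝟎) :+ ⌜B̂⌝ x a b :* (𝟏 :* 𝟎)
        := ⌜D̂⌝ x a y :* (⌜B̂⌝ x a b :* (𝟏 :* 𝟎) :+ ⌜B̂⌝ x a b :* (𝟏 :* 𝟎)) :+ ⌜B̂⌝ x a b :* (x :* (y :* 𝟎) :+ x :* (y :* 𝟎)))
        ℙ.refl ξ α̂ β̂ Y)

  local-relation-11-below : ∀ u G a k → a + 0 ≡ u + suc k → column wt Wst 0 (suc u) (ℛ G) (suc a) 1 ≈ₛ ℛ (column Wst wt 0 (suc u) G) (suc a) 1
  local-relation-11-below u G zero k e = ⊥-elim (0+0≢u+1+k e)
  local-relation-11-below u G (suc a) k e = evaluate-both
      (column-tT*-1-suc 0 u (ℛ G) (suc (suc a))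
          (at-minus-+ (λ c → ℛ G c 0) u (suc (suc k)) (m≡u+k⇒1+m≡u+1+k e))
          (at-minus-+ (λ c → ℛ G c 1) u (suc k) e) (τ₊-suc-≤ a u (1+a+0≡u+1+k⇒u≤a e)) (τ₊-suc-suc a u))
      (⊠-congˡ B̂
          (ℙ.+-cong
              (column-T*t-1-zero (suc u) G (suc (suc a)) (at-minus-+ (G 1) u (suc k) e)
                  (at-minus-+ (G 0) u (suc (suc k)) (≡.trans (+-suc (suc a) 0) (m≡u+k⇒1+m≡u+1+k e)))
                  (τ₊-suc-suc a u))
              (column-T*t-0-zero (suc u) G (suc (suc (suc a)))
                  (at-minus-+ (G 0) u (suc (suc k)) (m≡u+k⇒1+m≡u+1+k e))
                  (ℙ.trans (τ₊-suc-suc (suc a) u) (⊠-congˡ β̂ (τ₊-suc-≤ a u (1+a+0≡u+1+k⇒u≤a e)))))))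
      (solve 7 (λ x a b y w g1 g0 →
          ⌜B̂⌝ x a b :* ((a :+ b) :* w :* (b :* x :* (g1 :+ g0))) :+ ⌜B̂⌝ x a b :* (b :* w :* (⌜B̂⌝ x a b :* (g1 :+ g0)))
        := ⌜B̂⌝ x a b :* (𝟏 :* (b :* w :* g1) :+ ⌜B̂⌝ x a b :* (b :* w :* g0) :+ x :* (b :* ((a :+ b) :* w) :* g0)))
        ℙ.refl ξ α̂ β̂ Y (τ₊ a u) (G 1 (suc k)) (G 0 (suc (suc k))))

  local-relation-11 : ∀ v u G a → column wt Wst v u (ℛ G) (suc a) 1 ≈ₛ ℛ (column Wst wt v u G) (suc a) 1
  local-relation-11 zero zero G a = evaluate-both
      (column-tT*-1-zero 0 (ℛ G) (suc a) ≡.refl ℙ.refl)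
      (⊠-congˡ B̂
          (ℙ.+-cong
              (column-T*t-1-zero 0 G (suc a) ≡.refl (≡.cong (G 0) (≡.cong suc (+-suc a 0))) ℙ.refl)
              (column-T*t-0-zero 0 G (suc (suc a)) ≡.refl (τ₊-suc-≤ a 0 z≤n))))
      (solve 7 (λ x a b y t g1 g0 →
          t :* (⌜B̂⌝ x a b :* (g1 :+ g0))
        := ⌜B̂⌝ x a b :* (𝟏 :* (t :* g1) :+ ⌜B̂⌝ x a b :* (t :* g0) :+ x :* ((a :+ b) :* t :* g0)))
        ℙ.refl ξ α̂ β̂ Y (τ₊ a 0) (G 1 (suc (a + 0))) (G 0 (suc (suc (a + 0)))))
  local-relation-11 zero (suc u) G a with offset (a + 0) u
  ... | ≥by zero e = evaluate-both
      (column-tT*-1-suc 0 u (ℛ G) (suc a)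
          (at-minus-+ (λ c → ℛ G c 0) u 1 (m≡u+k⇒1+m≡u+1+k e)) (at-minus-+ (λ c → ℛ G c 1) u 0 e)
          (τ₊-≡ a u (a+0≡u+0⇒u≡a e)) (τ₊-> a (suc u) (u≡a⇒a<1+u (a+0≡u+0⇒u≡a e))))
      (⊠-congˡ B̂
          (ℙ.+-cong
              (column-T*t-1-zero (suc u) G (suc a) (at-minus-+ (G 1) u 0 e)
                  (at-minus-+ (G 0) u 1 (≡.trans (+-suc a 0) (m≡u+k⇒1+m≡u+1+k e)))
                  (τ₊-> a (suc u) (u≡a⇒a<1+u (a+0≡u+0⇒u≡a e))))
              (column-T*t-0-zero (suc u) G (suc (suc a))
                  (at-minus-+ (G 0) u 1 (m≡u+k⇒1+m≡u+1+k e))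
                  (ℙ.trans (τ₊-suc-suc a u) (⊠-congˡ β̂ (τ₊-≡ a u (a+0≡u+0⇒u≡a e)))))))
      (solve 7 (λ x a b y p g10 g01 →
          ⌜B̂⌝ x a b :* (p :* (y :+ a) :* (x :* y :* g10 :+ b :* x :* g01)) :+ ⌜B̂⌝ x a b :* (p :* y :* (⌜D̂⌝ x a y :* g10 :+ ⌜B̂⌝ x a b :* g01))
        := ⌜B̂⌝ x a b :* (𝟏 :* (p :* y :* g10) :+ ⌜B̂⌝ x a b :* (p :* y :* g01) :+ x :* (b :* (p :* (y :+ a)) :* g01)))
        ℙ.refl ξ α̂ β̂ Y (Pβ a) (G 1 0) (G 0 1))
  ... | ≥by (suc k) e = local-relation-11-below u G a k e
  ... | <by zero e = evaluate-both
      (column-tT*-1-suc 0 u (ℛ G) (suc a)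
          (at-minus-+ (λ c → ℛ G c 0) u 0 (u≡1+m+0⇒1+m≡u+0 e))
          (at-minus-> (λ c → ℛ G c 1) (a + 0) u (u≡1+m+k⇒m<u e)) (τ₊-> a u (u≡1+a+w+k⇒a<u e))
          (τ₊-> a (suc u) (m<n⇒m<1+n (u≡1+a+w+k⇒a<u e))))
      (⊠-congˡ B̂
          (ℙ.+-cong
              (column-T*t-1-zero (suc u) G (suc a)
                  (at-minus-> (G 1) (a + 0) u (u≡1+m+k⇒m<u e))
                  (at-minus-+ (G 0) u 0 (≡.trans (+-suc a 0) (u≡1+m+0⇒1+m≡u+0 e)))
                  (τ₊-> a (suc u) (m<n⇒m<1+n (u≡1+a+w+k⇒a<u e))))
              (column-T*t-0-zero (suc u) G (suc (suc a))
                  (at-minus-+ (G 0) u 0 (u≡1+m+0⇒1+m≡u+0 e))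
                  (ℙ.trans (τ₊-suc-suc a u) (⊠-congˡ β̂ (τ₊-> a u (u≡1+a+w+k⇒a<u e)))))))
      (solve 6 (λ x a b y p g00 →
          ⌜B̂⌝ x a b :* (p :* y :* (⌜Î⌝ x a :* g00)) :+ ⌜B̂⌝ x a b :* (p :* y :* 𝟎)
        := ⌜B̂⌝ x a b :* (𝟏 :* (p :* y :* 𝟎) :+ ⌜B̂⌝ x a b :* (p :* y :* g00) :+ x :* (b :* (p :* y) :* g00)))
        ℙ.refl ξ α̂ β̂ Y (Pβ a) (G 0 0))
  ... | <by (suc k) e = evaluate-both
      (column-tT*-1-suc 0 u (ℛ G) (suc a)
          (at-minus-> (λ c → ℛ G c 0) (suc (a + 0)) u (u≡1+m+1+k⇒1+m<u e))
          (at-minus-> (λ c → ℛ G c 1) (a + 0) u (u≡1+m+k⇒m<u e)) ℙ.refl ℙ.refl)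
      (⊠-congˡ B̂
          (ℙ.+-cong
              (column-T*t-1-zero (suc u) G (suc a)
                  (at-minus-> (G 1) (a + 0) u (u≡1+m+k⇒m<u e))
                  (≡.trans
                      (≡.cong (λ z → at-minus (G 0) z u) (+-suc a 0))
                      (at-minus-> (G 0) (suc (a + 0)) u (u≡1+m+1+k⇒1+m<u e)))
                  ℙ.refl)
              (column-T*t-0-zero (suc u) G (suc (suc a))
                  (at-minus-> (G 0) (suc (a + 0)) u (u≡1+m+1+k⇒1+m<u e)) (τ₊-suc-suc a u))))
      (solve 6 (λ x a b y t0 t1 →
          ⌜B̂⌝ x a b :* (t0 :* 𝟎) :+ ⌜B̂⌝ x a b :* (t1 :* 𝟎)
        := ⌜B̂⌝ x a b :* (𝟏 :* (t1 :* 𝟎) :+ ⌜B̂⌝ x a b :* (t1 :* 𝟎) :+ x :* (b :* t0 :* 𝟎)))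
        ℙ.refl ξ α̂ β̂ Y (τ₊ a u) (τ₊ a (suc u)))
  local-relation-11 (suc v) zero G a = evaluate-both
      (column-tT*-1-zero (suc v) (ℛ G) (suc a) ≡.refl ℙ.refl)
      (⊠-congˡ B̂
          (ℙ.+-cong
              (column-T*t-1-suc v 0 G (suc a) ≡.refl (≡.cong (G 0) (≡.cong suc (+-suc a (suc v)))) ℙ.refl)
              (column-T*t-0-suc v 0 G (suc (suc a))
                  (≡.cong (G 1) (≡.cong suc (≡.sym (+-suc a v)))) ≡.refl (τ₊-suc-≤ a 0 z≤n))))
      (solve 7 (λ x a b y t g1 g0 →
          t :* (⌜B̂⌝ x a b :* (g1 :+ g0))
        := ⌜B̂⌝ x a b :* (⌜B̂⌝ x a b :* (t :* g1) :+ ⌜B̂⌝ x a b :* (t :* g0) :+ (x :* ((a :+ b) :* t :* g1) :+ x :* ((a :+ b) :* t :* g0))))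
        ℙ.refl ξ α̂ β̂ Y (τ₊ a 0) (G 1 (suc (a + suc v))) (G 0 (suc (suc (a + suc v)))))
  local-relation-11 (suc v) (suc u) G a with offset (a + suc v) u
  ... | ≥by zero e = evaluate-both
      (column-tT*-1-suc (suc v) u (ℛ G) (suc a)
          (at-minus-+ (λ c → ℛ G c 0) u 1 (m≡u+k⇒1+m≡u+1+k e)) (at-minus-+ (λ c → ℛ G c 1) u 0 e)
          (τ₊-> a u (a+1+v≡u+0⇒a<u e)) (τ₊-> a (suc u) (m<n⇒m<1+n (a+1+v≡u+0⇒a<u e))))
      (⊠-congˡ B̂
          (ℙ.+-cong
              (column-T*t-1-suc v (suc u) G (suc a) (at-minus-+ (G 1) u 0 e)
                  (at-minus-+ (G 0) u 1 (≡.trans (+-suc a (suc v)) (m≡u+k⇒1+m≡u+1+k e)))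
                  (τ₊-> a (suc u) (m<n⇒m<1+n (a+1+v≡u+0⇒a<u e))))
              (column-T*t-0-suc v (suc u) G (suc (suc a))
                  (at-minus-+ (G 1) u 0 (≡.trans (≡.sym (+-suc a v)) e))
                  (at-minus-+ (G 0) u 1 (m≡u+k⇒1+m≡u+1+k e))
                  (ℙ.trans (τ₊-suc-suc a u) (⊠-congˡ β̂ (τ₊-> a u (a+1+v≡u+0⇒a<u e)))))))
      (solve 7 (λ x a b y p g10 g01 →
          ⌜B̂⌝ x a b :* (p :* y :* (x :* y :* g10 :+ b :* x :* g01)) :+ ⌜B̂⌝ x a b :* (p :* y :* (⌜D̂⌝ x a y :* g10 :+ ⌜B̂⌝ x a b :* g01))
        := ⌜B̂⌝ x a b :* (⌜B̂⌝ x a b :* (p :* y :* g10) :+ ⌜B̂⌝ x a b :* (p :* y :* g01) :+ (x :* (b :* (p :* y) :* g10) :+ x :* (b :* (p :* y) :* g01))))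
        ℙ.refl ξ α̂ β̂ Y (Pβ a) (G 1 0) (G 0 1))
  ... | ≥by (suc k) e = evaluate-both
      (column-tT*-1-suc (suc v) u (ℛ G) (suc a)
          (at-minus-+ (λ c → ℛ G c 0) u (suc (suc k)) (m≡u+k⇒1+m≡u+1+k e))
          (at-minus-+ (λ c → ℛ G c 1) u (suc k) e) ℙ.refl ℙ.refl)
      (⊠-congˡ B̂
          (ℙ.+-cong
              (column-T*t-1-suc v (suc u) G (suc a) (at-minus-+ (G 1) u (suc k) e)
                  (at-minus-+ (G 0) u (suc (suc k)) (≡.trans (+-suc a (suc v)) (m≡u+k⇒1+m≡u+1+k e))) ℙ.refl)
              (column-T*t-0-suc v (suc u) G (suc (suc a))
                  (at-minus-+ (G 1) u (suc k) (≡.trans (≡.sym (+-suc a v)) e))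
                  (at-minus-+ (G 0) u (suc (suc k)) (m≡u+k⇒1+m≡u+1+k e)) (τ₊-suc-suc a u))))
      (solve 8 (λ x a b y t0 t1 g1 g0 →
          ⌜B̂⌝ x a b :* (t0 :* (b :* x :* (g1 :+ g0))) :+ ⌜B̂⌝ x a b :* (t1 :* (⌜B̂⌝ x a b :* (g1 :+ g0)))
        := ⌜B̂⌝ x a b :* (⌜B̂⌝ x a b :* (t1 :* g1) :+ ⌜B̂⌝ x a b :* (t1 :* g0) :+ (x :* (b :* t0 :* g1) :+ x :* (b :* t0 :* g0))))
        ℙ.refl ξ α̂ β̂ Y (τ₊ a u) (τ₊ a (suc u)) (G 1 (suc k)) (G 0 (suc (suc k))))
  ... | <by zero e = evaluate-both
      (column-tT*-1-suc (suc v) u (ℛ G) (suc a)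
          (at-minus-+ (λ c → ℛ G c 0) u 0 (u≡1+m+0⇒1+m≡u+0 e))
          (at-minus-> (λ c → ℛ G c 1) (a + suc v) u (u≡1+m+k⇒m<u e)) (τ₊-> a u (u≡1+a+w+k⇒a<u e))
          (τ₊-> a (suc u) (m<n⇒m<1+n (u≡1+a+w+k⇒a<u e))))
      (⊠-congˡ B̂
          (ℙ.+-cong
              (column-T*t-1-suc v (suc u) G (suc a)
                  (at-minus-> (G 1) (a + suc v) u (u≡1+m+k⇒m<u e))
                  (at-minus-+ (G 0) u 0 (≡.trans (+-suc a (suc v)) (u≡1+m+0⇒1+m≡u+0 e)))
                  (τ₊-> a (suc u) (m<n⇒m<1+n (u≡1+a+w+k⇒a<u e))))
              (column-T*t-0-suc v (suc u) G (suc (suc a))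
                  (≡.trans
                      (≡.cong (λ z → at-minus (G 1) z u) (≡.sym (+-suc a v)))
                      (at-minus-> (G 1) (a + suc v) u (u≡1+m+k⇒m<u e)))
                  (at-minus-+ (G 0) u 0 (u≡1+m+0⇒1+m≡u+0 e))
                  (ℙ.trans (τ₊-suc-suc a u) (⊠-congˡ β̂ (τ₊-> a u (u≡1+a+w+k⇒a<u e)))))))
      (solve 6 (λ x a b y p g00 →
          ⌜B̂⌝ x a b :* (p :* y :* (⌜Î⌝ x a :* g00)) :+ ⌜B̂⌝ x a b :* (p :* y :* 𝟎)
        := ⌜B̂⌝ x a b :* (⌜B̂⌝ x a b :* (p :* y :* 𝟎) :+ ⌜B̂⌝ x a b :* (p :* y :* g00) :+ (x :* (b :* (p :* y) :* 𝟎) :+ x :* (b :* (p :* y) :* g00))))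
        ℙ.refl ξ α̂ β̂ Y (Pβ a) (G 0 0))
  ... | <by (suc k) e = evaluate-both
      (column-tT*-1-suc (suc v) u (ℛ G) (suc a)
          (at-minus-> (λ c → ℛ G c 0) (suc (a + suc v)) u (u≡1+m+1+k⇒1+m<u e))
          (at-minus-> (λ c → ℛ G c 1) (a + suc v) u (u≡1+m+k⇒m<u e)) ℙ.refl ℙ.refl)
      (⊠-congˡ B̂
          (ℙ.+-cong
              (column-T*t-1-suc v (suc u) G (suc a)
                  (at-minus-> (G 1) (a + suc v) u (u≡1+m+k⇒m<u e))
                  (≡.trans
                      (≡.cong (λ z → at-minus (G 0) z u) (+-suc a (suc v)))
                      (at-minus-> (G 0) (suc (a + suc v)) u (u≡1+m+1+k⇒1+m<u e)))
                  ℙ.refl)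
              (column-T*t-0-suc v (suc u) G (suc (suc a))
                  (≡.trans
                      (≡.cong (λ z → at-minus (G 1) z u) (≡.sym (+-suc a v)))
                      (at-minus-> (G 1) (a + suc v) u (u≡1+m+k⇒m<u e)))
                  (at-minus-> (G 0) (suc (a + suc v)) u (u≡1+m+1+k⇒1+m<u e)) (τ₊-suc-suc a u))))
      (solve 6 (λ x a b y t0 t1 →
          ⌜B̂⌝ x a b :* (t0 :* 𝟎) :+ ⌜B̂⌝ x a b :* (t1 :* 𝟎)
        := ⌜B̂⌝ x a b :* (⌜B̂⌝ x a b :* (t1 :* 𝟎) :+ ⌜B̂⌝ x a b :* (t1 :* 𝟎) :+ (x :* (b :* t0 :* 𝟎) :+ x :* (b :* t0 :* 𝟎))))
        ℙ.refl ξ α̂ β̂ Y (τ₊ a u) (τ₊ a (suc u)))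

  local-relation : ∀ v u G a b → column wt Wst v u (ℛ G) a b ≈ₛ ℛ (column Wst wt v u G) a b
  local-relation v u G 0 0 = local-relation-00 v u G
  local-relation v u G 1 0 = local-relation-10 v u G
  local-relation v u G (suc (suc a)) 0 = local-relation-20 v u G a
  local-relation v u G 0 1 = local-relation-01 v u G
  local-relation v u G (suc a) 1 = local-relation-11 v u G a
  local-relation v u G a (suc (suc b)) = column-tT*-≥2 v u (ℛ G) a b


  -- Boundaries

  -- The free left boundary: summing over the left labels, ℛ acts as multiplication by Î.

  Σ-ℛ-over-T*-label : ∀ n (G : ℕ → ℕ → PS) a → Σₛ (suc n) (ℛ G a) ≈ₛ ℛ₀ G a ⊞ ℛ₁ G a
  Σ-ℛ-over-T*-label n G a = Σₛ-pair (suc n) 0 (ℛ G a) off-pair beyond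
    where
    off-pair : ∀ b → b ≢ 0 → b ≢ 1 → ℛ G a b ≈ₛ 0ₛ
    off-pair zero          b≢0 _   = ⊥-elim (b≢0 ≡.refl)
    off-pair (suc zero)    _   b≢1 = ⊥-elim (b≢1 ≡.refl)
    off-pair (suc (suc b)) _   _   = ℙ.refl
    beyond : ∀ b → suc n < b → ℛ G a b ≈ₛ 0ₛ
    beyond (suc (suc b)) _ = ℙ.refl
    beyond 1 (s≤s ())

  Σ-over-T*-label : ∀ n (G : ℕ → ℕ → PS) → (∀ e a → G (suc (suc e)) a ≈ₛ 0ₛ) →
                    Σₛ (suc n) (λ e → Σₛ (suc n) (G e)) ≈ₛ Σₛ (suc n) (G 0) ⊞ Σₛ (suc n) (G 1)
  Σ-over-T*-label n G G≥2≈0 = Σₛ-pair (suc n) 0 (λ e → Σₛ (suc n) (G e)) off-pair beyond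
    where
    off-pair : ∀ e → e ≢ 0 → e ≢ 1 → Σₛ (suc n) (G e) ≈ₛ 0ₛ
    off-pair zero          e≢0 _   = ⊥-elim (e≢0 ≡.refl)
    off-pair (suc zero)    _   e≢1 = ⊥-elim (e≢1 ≡.refl)
    off-pair (suc (suc e)) _   _   = Σₛ-zero (suc n) _ (λ a _ → G≥2≈0 e a)
    beyond : ∀ e → suc n < e → Σₛ (suc n) (G e) ≈ₛ 0ₛ
    beyond (suc (suc e)) _ = Σₛ-zero (suc n) _ (λ a _ → G≥2≈0 e a)
    beyond 1 (s≤s ())

  Σ-ℛ-telescopes : ∀ m (G : ℕ → ℕ → PS) →
                   Σₛ (suc m) (λ a → ℛ₀ G a ⊞ ℛ₁ G a) ≈ₛ
                   Î ⊠ (Σₛ (suc m) (λ a → G 0 a ⊞ G 1 a) ⊞ ⊟ G 1 (suc m)) ⊞ B̂ ⊠ (G 1 (suc m) ⊞ G 0 (suc (suc m)))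
  Σ-ℛ-telescopes zero G =
    solve 9 (λ x a b y g00 g10 g01 g11 g02 →
        ⌜Î⌝ x a :* g00 :+ (⌜D̂⌝ x a y :* g10 :+ ⌜B̂⌝ x a b :* g01) :+ (x :* y :* g10 :+ b :* x :* g01 :+ ⌜B̂⌝ x a b :* (g11 :+ g02))
      := ⌜Î⌝ x a :* (g00 :+ g10 :+ (g01 :+ g11) :+ :- g11) :+ ⌜B̂⌝ x a b :* (g11 :+ g02))
      ℙ.refl ξ α̂ β̂ Y (G 0 0) (G 1 0) (G 0 1) (G 1 1) (G 0 2)
  Σ-ℛ-telescopes (suc m) G = ℙ.trans (⊞-congʳ (ℛ₀ G (suc (suc m)) ⊞ ℛ₁ G (suc (suc m))) (Σ-ℛ-telescopes m G))
    (solve 9 (λ x a b y q g1 g0 g1′ g0′ →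
        ⌜Î⌝ x a :* (q :+ :- g1) :+ ⌜B̂⌝ x a b :* (g1 :+ g0) :+ (b :* x :* (g1 :+ g0) :+ ⌜B̂⌝ x a b :* (g1′ :+ g0′))
      := ⌜Î⌝ x a :* (q :+ (g0 :+ g1′) :+ :- g1′) :+ ⌜B̂⌝ x a b :* (g1′ :+ g0′))
      ℙ.refl ξ α̂ β̂ Y (Σₛ (suc m) (λ a → G 0 a ⊞ G 1 a)) (G 1 (suc m)) (G 0 (suc (suc m))) (G 1 (suc (suc m))) (G 0 (suc (suc (suc m)))))

  left-boundary : ∀ n (G : ℕ → ℕ → PS) → (∀ e a → G (suc (suc e)) a ≈ₛ 0ₛ) → G 1 (suc n) ≈ₛ 0ₛ → G 0 (suc (suc n)) ≈ₛ 0ₛ →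
                  Σₛ (suc n) (λ a → Σₛ (suc n) (ℛ G a)) ≈ₛ Î ⊠ Σₛ (suc n) (λ e → Σₛ (suc n) (G e))
  left-boundary n G G≥2≈0 G₁≈0 G₀≈0 = begin
    Σₛ (suc n) (λ a → Σₛ (suc n) (ℛ G a))
      ≈⟨ Σₛ-cong (suc n) (λ a _ → Σ-ℛ-over-T*-label n G a) ⟩
    Σₛ (suc n) (λ a → ℛ₀ G a ⊞ ℛ₁ G a)
      ≈⟨ Σ-ℛ-telescopes n G ⟩
    Î ⊠ (Q ⊞ ⊟ G 1 (suc n)) ⊞ B̂ ⊠ (G 1 (suc n) ⊞ G 0 (suc (suc n)))
      ≈⟨ ℙ.+-cong (⊠-congˡ Î (⊞-congˡ Q (ℙ.-‿cong G₁≈0))) (⊠-congˡ B̂ (ℙ.+-cong G₁≈0 G₀≈0)) ⟩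
    Î ⊠ (Q ⊞ ⊟ 0ₛ) ⊞ B̂ ⊠ (0ₛ ⊞ 0ₛ)
      ≈⟨ solve 5 (λ x a b y q → ⌜Î⌝ x a :* (q :+ :- 𝟎) :+ ⌜B̂⌝ x a b :* (𝟎 :+ 𝟎) := ⌜Î⌝ x a :* q) ℙ.refl ξ α̂ β̂ Y Q ⟩
    Î ⊠ Q
      ≈⟨ ⊠-congˡ Î (ℙ.trans (Σₛ≈Σ (suc n) _) (ℙ.trans (Σℙ.Σ-distrib-+ (suc n) (G 0) (G 1))
                 (ℙ.+-cong (ℙ.sym (Σₛ≈Σ (suc n) (G 0))) (ℙ.sym (Σₛ≈Σ (suc n) (G 1)))))) ⟩
    Î ⊠ (Σₛ (suc n) (G 0) ⊞ Σₛ (suc n) (G 1))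
      ≈⟨ ⊠-congˡ Î (Σ-over-T*-label n G G≥2≈0) ⟨
    Î ⊠ Σₛ (suc n) (λ e → Σₛ (suc n) (G e)) ∎
    where Q = Σₛ (suc n) (λ a → G 0 a ⊞ G 1 a)

  at-beyond-length : ∀ xs j → length xs ≤ j → at xs j ≡ 0
  at-beyond-length []       j       _       = ≡.refl
  at-beyond-length (x ∷ xs) (suc j) (s≤s p) = at-beyond-length xs j p

  sum-drop : ∀ xs j → sum (drop j xs) ≡ at xs j + sum (drop (suc j) xs)
  sum-drop []       zero    = ≡.refl
  sum-drop []       (suc j) = ≡.refl
  sum-drop (x ∷ xs) zero    = ≡.refl
  sum-drop (x ∷ xs) (suc j) = sum-drop xs j

  -- Along the lattice the two horizontal labels together lose only the top labels, so they
  -- cannot come down to the right boundary values if they exceed them by more than the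
  -- remaining top labels.
  go-vanishes-beyond : ∀ WA WB → Conserving WA → Conserving WB → ∀ rA rB v u n j a b →
                       rA + rB + sum (drop j u) < a + b → go WA rA WB rB v u n j a b ≈ₛ 0ₛ
  go-vanishes-beyond WA WB WA-cons WB-cons rA rB v u zero j a b too-large with a ≟ rA | b ≟ rB
  ... | yes ≡.refl | yes ≡.refl = ⊥-elim (<⇒≱ too-large (m≤m+n (a + b) (sum (drop j u))))
  ... | yes _      | no  _      = ℙ.refl
  ... | no  _      | _          = ℙ.refl
  go-vanishes-beyond WA WB WA-cons WB-cons rA rB v u (suc n) j a b too-large =
    Σₛ-zero (a + at v j) _ (λ w _ → Σₛ-zero (a + at v j) _ (λ c _ → Σₛ-zero (b + w) _ (λ c′ _ → term w c c′)))
    where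
    rest = go WA rA WB rB v u n (suc j)
    term : ∀ w c c′ → (WA a (at v j) c w ⊠ WB b w c′ (at u j)) ⊠ rest c c′ ≈ₛ 0ₛ
    term w c c′ with a + at v j ≟ c + w | b + w ≟ c′ + at u j
    ... | no a+v≢c+w | _ = lower-vanishes (WA a (at v j) c w) (WB b w c′ (at u j)) (rest c c′) (WA-cons a (at v j) c w a+v≢c+w)
    ... | yes _ | no b+w≢c′+u = upper-vanishes (WA a (at v j) c w) (WB b w c′ (at u j)) (rest c c′) (WB-cons b w c′ (at u j) b+w≢c′+u)
    ... | yes a+v≡c+w | yes b+w≡c′+u =
      ℙ.trans (⊠-congˡ (WA a (at v j) c w ⊠ WB b w c′ (at u j))
                (go-vanishes-beyond WA WB WA-cons WB-cons rA rB v u n (suc j) c c′ bound))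
              (ℙ.zeroʳ _)
      where
      K = rA + rB + sum (drop (suc j) u)
      K+uⱼ<a+b : K + at u j < a + b
      K+uⱼ<a+b = ≡.subst (_< a + b) (≡.trans (≡.cong (rA + rB +_) (≡.trans (sum-drop u j) (+-comm (at u j) _)))
                                              (≡.sym (+-assoc (rA + rB) _ (at u j)))) too-large
      bound : K < c + c′
      bound = bound-through-column K (at u j) (at v j) a b c c′ w K+uⱼ<a+b a+v≡c+w b+w≡c′+u

  -- Divisibility by powers of x

  infix 4 x^_∣_
  x^_∣_ : ℕ → PS → Set ℓ
  x^ k ∣ f = ∀ i j → i < k → f i j ≈ 0#

  ∣-respects : ∀ {k f g} → f ≈ₛ g → x^ k ∣ f → x^ k ∣ g
  ∣-respects f≈g k∣f i j i<k = R.trans (R.sym (unbox f≈g i j)) (k∣f i j i<k)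

  ∣-zero : ∀ {k f} → f ≈ₛ 0ₛ → x^ k ∣ f
  ∣-zero f≈0 i j _ = unbox f≈0 i j

  ∣-neg : ∀ {k f} → x^ k ∣ f → x^ k ∣ ⊟ f
  ∣-neg k∣f i j i<k = R.trans (R.-‿cong (k∣f i j i<k)) -0#≈0#

  ∣-Σ : ∀ {k} n (F : ℕ → PS) → (∀ m → m ≤ n → x^ k ∣ F m) → x^ k ∣ Σₛ n F
  ∣-Σ n F k∣F i j i<k = R.trans (R.reflexive (Σ≤≡ n _)) (ΣR.Σ-zero n _ (λ m m≤n → k∣F m m≤n i j i<k))

  private
    coefficient-⊠-zero : ∀ f g i j → (∀ p l → p ≤ i → f p l *ᴿ g (i ∸ p) (j ∸ l) ≈ 0#) → (f ⊠ g) i j ≈ 0#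
    coefficient-⊠-zero f g i j term≈0 = R.trans (R.reflexive (Σ≤≡ i _)) (ΣR.Σ-zero i _ (λ p p≤i →
      R.trans (R.reflexive (Σ≤≡ j _)) (ΣR.Σ-zero j _ (λ l _ → term≈0 p l p≤i))))

  ∣-⊠ˡ : ∀ {k} f g → x^ k ∣ g → x^ k ∣ f ⊠ g
  ∣-⊠ˡ f g k∣g i j i<k = coefficient-⊠-zero f g i j (λ p l _ →
    R.trans (R.*-congˡ (k∣g (i ∸ p) (j ∸ l) (≤-<-trans (m∸n≤m i p) i<k))) (R.zeroʳ _))

  ∣-⊠ : ∀ {k} f g → x^ 1 ∣ f → x^ k ∣ g → x^ suc k ∣ f ⊠ g
  ∣-⊠ {k} f g x∣f k∣g i j i<1+k = coefficient-⊠-zero f g i j term≈0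
    where
    term≈0 : ∀ p l → p ≤ i → f p l *ᴿ g (i ∸ p) (j ∸ l) ≈ 0#
    term≈0 zero    l _   = R.trans (R.*-congʳ (x∣f 0 l (s≤s z≤n))) (R.zeroˡ _)
    term≈0 (suc p) l p<i = R.trans (R.*-congˡ (k∣g (i ∸ suc p) (j ∸ l) (∸-<-pred p<i i<1+k))) (R.zeroʳ _)

  ∣-column : ∀ {k} WA WB v u (F : ℕ → ℕ → PS) a b → (∀ c c′ → x^ k ∣ F c c′) → x^ k ∣ column WA WB v u F a b
  ∣-column WA WB v u F a b k∣F = ∣-Σ (a + v) _ (λ w _ → ∣-Σ (a + v) _ (λ c _ → ∣-Σ (b + w) _ (λ c′ _ →
    ∣-⊠ˡ (WA a v c w ⊠ WB b w c′ u) (F c c′) (k∣F c c′))))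

  x∣ξ : x^ 1 ∣ ξ
  x∣ξ zero    j _         = ⊠-supported-below X-supported inv1+αx 0 j (s≤s z≤n)
  x∣ξ (suc i) j (s≤s ())

  x∣Wst-0-w-w-0 : ∀ w → x^ 1 ∣ Wst 0 w w 0
  x∣Wst-0-w-w-0 w = ∣-respects (ℙ.sym (Wst≈W* 0 w w 0 (≡.sym (+-identityʳ w)))) (x∣W* w)
    where
    x∣W* : ∀ w → x^ 1 ∣ W* 0 w w 0
    x∣W* zero          = x∣ξ
    x∣W* (suc zero)    = x∣ξ
    x∣W* (suc (suc w)) = ∣-zero ℙ.refl

  inv1-xy-diagonal : ∀ i j → i ≡ j → inv1-xy i j ≈ 1#
  inv1-xy-diagonal i j i≡j with i ≟ j
  ... | yes _   = R.refl
  ... | no  i≢j = ⊥-elim (i≢j i≡j)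

  inv1-xy-off-diagonal : ∀ i j → i ≢ j → inv1-xy i j ≈ 0#
  inv1-xy-off-diagonal i j i≢j with i ≟ j
  ... | yes i≡j = ⊥-elim (i≢j i≡j)
  ... | no  _   = R.refl

  inv1-xy-inverse : inv1-xy ⊠ (1ₛ ⊞ ⊟ (X ⊠ Y)) ≈ₛ 1ₛ
  inv1-xy-inverse = begin
    inv1-xy ⊠ (1ₛ ⊞ ⊟ (X ⊠ Y))          ≈⟨ solve 3 (λ s x y → s :* (𝟏 :- x :* y) := s :- x :* (y :* s)) ℙ.refl inv1-xy X Y ⟩
    inv1-xy ⊞ ⊟ (X ⊠ (Y ⊠ inv1-xy))     ≈⟨ box coefficient ⟩
    1ₛ                                   ∎
    where
    xy-shift : ∀ i j → (X ⊠ (Y ⊠ inv1-xy)) (suc i) (suc j) ≈ inv1-xy i j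
    xy-shift i j = R.trans (⊠-supported X-supported (Y ⊠ inv1-xy) i (suc j))
                   (R.trans (R.*-identityˡ _) (R.trans (⊠-supported Y-supported inv1-xy i j) (R.*-identityˡ _)))
    coefficient : ∀ i j → inv1-xy i j +ᴿ -ᴿ (X ⊠ (Y ⊠ inv1-xy)) i j ≈ 1ₛ i j
    coefficient zero j = R.trans (R.+-congˡ (R.trans (R.-‿cong (⊠-supported-below X-supported (Y ⊠ inv1-xy) 0 j (s≤s z≤n))) -0#≈0#))
                                 (R.trans (R.+-identityʳ _) (row-0 j))
      where
      row-0 : ∀ j → inv1-xy 0 j ≈ 1ₛ 0 j
      row-0 zero    = R.refl
      row-0 (suc j) = R.refl
    coefficient (suc i) zero = R.trans (R.+-congˡ (R.trans (R.-‿cong xy-column-0) -0#≈0#)) (R.+-identityʳ _)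
      where
      xy-column-0 : (X ⊠ (Y ⊠ inv1-xy)) (suc i) 0 ≈ 0#
      xy-column-0 = R.trans (⊠-supported X-supported (Y ⊠ inv1-xy) i 0)
                            (R.trans (R.*-congˡ (⊠-supported-left Y-supported inv1-xy i 0 (s≤s z≤n))) (R.zeroʳ _))
    coefficient (suc i) (suc j) = R.trans (R.+-congˡ (R.-‿cong (xy-shift i j))) (by-cases (i ≟ j))
      where
      by-cases : Dec (i ≡ j) → inv1-xy (suc i) (suc j) +ᴿ -ᴿ inv1-xy i j ≈ 0#
      by-cases (yes i≡j) = R.trans (R.+-cong (inv1-xy-diagonal (suc i) (suc j) (≡.cong suc i≡j)) (R.-‿cong (inv1-xy-diagonal i j i≡j)))
                                   (R.-‿inverseʳ _)
      by-cases (no i≢j)  = R.trans (R.+-cong (inv1-xy-off-diagonal (suc i) (suc j) (i≢j ∘ suc-injective))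
                                             (R.trans (R.-‿cong (inv1-xy-off-diagonal i j i≢j)) -0#≈0#))
                                   (R.+-identityʳ _)

  1+αx-inverts-Î : (1ₛ ⊞ α̂ ⊠ X) ⊠ Î ≈ₛ 1ₛ
  1+αx-inverts-Î = ℙ.trans (⊠-congˡ (1ₛ ⊞ α̂ ⊠ X) (ℙ.sym inv1+αx≈Î)) inv1+αx-inverse

  1+αx-times-ξ : (1ₛ ⊞ α̂ ⊠ X) ⊠ ξ ≈ₛ X
  1+αx-times-ξ = ℙ.trans (solve 3 (λ j x i → j :* (x :* i) := x :* (j :* i)) ℙ.refl (1ₛ ⊞ α̂ ⊠ X) X inv1+αx)
                         (ℙ.trans (⊠-congˡ X inv1+αx-inverse) (ℙ.*-identityʳ X))

  -- The train argument and convergence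

  module Lattice (v u : List ℕ) where

    -- Partition functions of the columns at sites j, …, j + n - 1 as functions of the left
    -- labels: t(y) below T*(x), the same with the right boundary values exchanged, and
    -- T*(x) below t(y).
    Zᵗᵀ Zᵗᵀ′ Zᵀᵗ : ℕ → ℕ → ℕ → ℕ → PS
    Zᵗᵀ  n j a b = go wt 0 Wst 1 v u n j a b
    Zᵗᵀ′ n j a b = go wt 1 Wst 0 v u n j a b
    Zᵀᵗ  n j e a = go Wst 1 wt 0 v u n j e a

    both-sides-vanish : D̂ ⊠ 0ₛ ⊞ (ξ ⊠ Y) ⊠ 0ₛ ≈ₛ 0ₛ
    both-sides-vanish = solve 3 (λ d x y → d :* 𝟎 :+ x :* y :* 𝟎 := 𝟎) ℙ.refl D̂ ξ Y

    -- With no columns the partition functions are the indicators of the right boundary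
    -- values, and ℛ maps the state (1, 0) to D̂ (0, 1) + ξ y (1, 0).
    right-boundary : ∀ j a b → D̂ ⊠ Zᵗᵀ 0 j a b ⊞ (ξ ⊠ Y) ⊠ Zᵗᵀ′ 0 j a b ≈ₛ ℛ (Zᵀᵗ 0 j) a b
    right-boundary j 0             0             = solve 3 (λ x a y → ⌜D̂⌝ x a y :* 𝟎 :+ x :* y :* 𝟎 := ⌜Î⌝ x a :* 𝟎) ℙ.refl ξ α̂ Y
    right-boundary j 1             0             = solve 4 (λ x a b y → ⌜D̂⌝ x a y :* 𝟎 :+ x :* y :* 𝟏 := x :* y :* 𝟏 :+ b :* x :* 𝟎) ℙ.refl ξ α̂ β̂ Y
    right-boundary j (suc (suc a)) 0             = solve 4 (λ x a b y → ⌜D̂⌝ x a y :* 𝟎 :+ x :* y :* 𝟎 := b :* x :* (𝟎 :+ 𝟎)) ℙ.refl ξ α̂ β̂ Y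
    right-boundary j 0             1             = solve 4 (λ x a b y → ⌜D̂⌝ x a y :* 𝟏 :+ x :* y :* 𝟎 := ⌜D̂⌝ x a y :* 𝟏 :+ ⌜B̂⌝ x a b :* 𝟎) ℙ.refl ξ α̂ β̂ Y
    right-boundary j 1             1             = solve 4 (λ x a b y → ⌜D̂⌝ x a y :* 𝟎 :+ x :* y :* 𝟎 := ⌜B̂⌝ x a b :* (𝟎 :+ 𝟎)) ℙ.refl ξ α̂ β̂ Y
    right-boundary j (suc (suc a)) 1             = solve 4 (λ x a b y → ⌜D̂⌝ x a y :* 𝟎 :+ x :* y :* 𝟎 := ⌜B̂⌝ x a b :* (𝟎 :+ 𝟎)) ℙ.refl ξ α̂ β̂ Y
    right-boundary j 0             (suc (suc b)) = both-sides-vanish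
    right-boundary j 1             (suc (suc b)) = both-sides-vanish
    right-boundary j (suc (suc a)) (suc (suc b)) = both-sides-vanish

    train : ∀ n j a b → D̂ ⊠ Zᵗᵀ n j a b ⊞ (ξ ⊠ Y) ⊠ Zᵗᵀ′ n j a b ≈ₛ ℛ (Zᵀᵗ n j) a b
    train zero    j a b = right-boundary j a b
    train (suc n) j a b = begin
      D̂ ⊠ Zᵗᵀ (suc n) j a b ⊞ (ξ ⊠ Y) ⊠ Zᵗᵀ′ (suc n) j a b
        ≈⟨ column-linear wt Wst (at v j) (at u j) D̂ (ξ ⊠ Y) (Zᵗᵀ n (suc j)) (Zᵗᵀ′ n (suc j)) a b ⟨
      column wt Wst (at v j) (at u j) (λ c c′ → D̂ ⊠ Zᵗᵀ n (suc j) c c′ ⊞ (ξ ⊠ Y) ⊠ Zᵗᵀ′ n (suc j) c c′) a b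
        ≈⟨ column-cong wt Wst (at v j) (at u j) (train n (suc j)) a b ⟩
      column wt Wst (at v j) (at u j) (ℛ (Zᵀᵗ n (suc j))) a b
        ≈⟨ local-relation (at v j) (at u j) (Zᵀᵗ n (suc j)) a b ⟩
      ℛ (Zᵀᵗ (suc n) j) a b ∎

    empty-column-T*t : ∀ j′ j e a → column Wst wt 0 0 (Zᵀᵗ 0 j′) e a ≈ₛ Zᵀᵗ 0 j e a
    empty-column-T*t j′ j 0 a = ℙ.trans (column-T*t-0-zero 0 (Zᵀᵗ 0 j′) a ≡.refl ℙ.refl)
                                        (ℙ.trans (⊠-congˡ ξ (ℙ.zeroʳ (τ a 0))) (ℙ.zeroʳ ξ))
    empty-column-T*t j′ j 1 0 = ℙ.trans (column-T*t-1-zero 0 (Zᵀᵗ 0 j′) 0 ≡.refl ≡.refl ℙ.refl)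
                                        (solve 3 (λ x a b → 𝟏 :* (𝟏 :* 𝟏) :+ ⌜B̂⌝ x a b :* (𝟏 :* 𝟎) := 𝟏) ℙ.refl ξ α̂ β̂)
    empty-column-T*t j′ j 1 (suc a) = ℙ.trans (column-T*t-1-zero 0 (Zᵀᵗ 0 j′) (suc a) ≡.refl ≡.refl ℙ.refl)
                                              (solve 4 (λ x a b t → 𝟏 :* (t :* 𝟎) :+ ⌜B̂⌝ x a b :* (t :* 𝟎) := 𝟎) ℙ.refl ξ α̂ β̂ (τ₊ a 0))
    empty-column-T*t j′ j (suc (suc e)) a = column-T*t-≥2 0 0 (Zᵀᵗ 0 j′) e a

    Zᵀᵗ-beyond-support : ∀ n j → length v ≤ j → length u ≤ j → ∀ e a → Zᵀᵗ n j e a ≈ₛ Zᵀᵗ 0 j e a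
    Zᵀᵗ-beyond-support zero    j _   _   e a = ℙ.refl
    Zᵀᵗ-beyond-support (suc n) j v≤j u≤j e a rewrite at-beyond-length v j v≤j | at-beyond-length u j u≤j =
      ℙ.trans (column-cong Wst wt 0 0 (Zᵀᵗ-beyond-support n (suc j) (m≤n⇒m≤1+n v≤j) (m≤n⇒m≤1+n u≤j)) e a)
              (empty-column-T*t (suc j) j e a)

    Zᵀᵗ-stable : ∀ m j → (∀ n e a → Zᵀᵗ n (m + j) e a ≈ₛ Zᵀᵗ 0 (m + j) e a) → ∀ n e a → Zᵀᵗ (m + n) j e a ≈ₛ Zᵀᵗ m j e a
    Zᵀᵗ-stable zero    j tail-trivial n e a = tail-trivial n e a
    Zᵀᵗ-stable (suc m) j tail-trivial n e a =
      column-cong Wst wt (at v j) (at u j) (Zᵀᵗ-stable m (suc j) tail-trivial′ n) e a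
      where
      tail-trivial′ : ∀ n e a → Zᵀᵗ n (m + suc j) e a ≈ₛ Zᵀᵗ 0 (m + suc j) e a
      tail-trivial′ n e a = ≡.subst (λ k → Zᵀᵗ n k e a ≈ₛ Zᵀᵗ 0 k e a) (≡.sym (+-suc m j)) (tail-trivial n e a)

    -- Beyond the support of u the T*(x) row has top labels 0 and right boundary value 0, so
    -- its horizontal labels vanish and each of its vertices carries a factor ξ, divisible by x.
    Zᵗᵀ′-beyond-support : ∀ n j → length u ≤ j → ∀ a b → x^ n ∣ Zᵗᵀ′ n j a b × (0 < b → Zᵗᵀ′ n j a b ≈ₛ 0ₛ)
    Zᵗᵀ′-beyond-support zero j _ a b = (λ _ _ ()) , T*-label-0 a b
      where
      T*-label-0 : ∀ a b → 0 < b → Zᵗᵀ′ 0 j a b ≈ₛ 0ₛ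
      T*-label-0 a (suc b) _ with a ≟ 1
      ... | yes _ = ℙ.refl
      ... | no  _ = ℙ.refl
    Zᵗᵀ′-beyond-support (suc n) j u≤j a b rewrite at-beyond-length u j u≤j = divisible b , T*-label-0 b
      where
      F = Zᵗᵀ′ n (suc j)
      IH = Zᵗᵀ′-beyond-support n (suc j) (m≤n⇒m≤1+n u≤j)
      T*-label-0 : ∀ b → 0 < b → column wt Wst (at v j) 0 F a b ≈ₛ 0ₛ
      T*-label-0 b 0<b = ℙ.trans (column-conserving wt Wst wt-conserving Wst-conserving (at v j) 0 F a b)
        (Σₛ-zero (a + at v j) _ (λ w _ → ℙ.trans (⊠-congˡ (wt a (at v j) (a + at v j ∸ w) w ⊠ Wst b w (b + w ∸ 0) 0)
                                                           (proj₂ (IH (a + at v j ∸ w) (b + w)) (≤-trans 0<b (m≤m+n b w))))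
                                                 (ℙ.zeroʳ _)))
      divisible : ∀ b → x^ suc n ∣ column wt Wst (at v j) 0 F a b
      divisible (suc b) = ∣-zero (T*-label-0 (suc b) (s≤s z≤n))
      divisible zero    = ∣-respects (ℙ.sym (column-conserving wt Wst wt-conserving Wst-conserving (at v j) 0 F a 0))
        (∣-Σ (a + at v j) _ (λ w _ → ∣-respects (ℙ.sym (xy∙z≈y∙xz lower (Wst 0 w w 0) (F (a + at v j ∸ w) w)))
          (∣-⊠ (Wst 0 w w 0) _ (x∣Wst-0-w-w-0 w) (∣-⊠ˡ lower _ (proj₁ (IH (a + at v j ∸ w) w))))))
        where lower = λ {w} → wt a (at v j) (a + at v j ∸ w) w

    Zᵗᵀ′-divisible : ∀ m j k n → (∀ c c′ → x^ k ∣ Zᵗᵀ′ n (m + j) c c′) → ∀ a b → x^ k ∣ Zᵗᵀ′ (m + n) j a b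
    Zᵗᵀ′-divisible zero    j k n tail-divisible a b = tail-divisible a b
    Zᵗᵀ′-divisible (suc m) j k n tail-divisible a b =
      ∣-column wt Wst (at v j) (at u j) (Zᵗᵀ′ (m + n) (suc j)) a b (Zᵗᵀ′-divisible m (suc j) k n tail-divisible′)
      where
      tail-divisible′ : ∀ c c′ → x^ k ∣ Zᵗᵀ′ n (m + suc j) c c′
      tail-divisible′ c c′ = ≡.subst (λ i → x^ k ∣ Zᵗᵀ′ n i c c′) (≡.sym (+-suc m j)) (tail-divisible c c′)

    ZtT* ZtT*′ ZT*t : ℕ → PS
    ZtT*  N = Ztrunc N wt 0 Wst 1 v u
    ZtT*′ N = Ztrunc N wt 1 Wst 0 v u
    ZT*t  N = Ztrunc N Wst 1 wt 0 v u

    private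
      S = sum v + sum u

      sum-u≤S : sum u ≤ S
      sum-u≤S = m≤n+m (sum u) (sum v)

      Zᵀᵗ-label≥2 : ∀ N e a → Zᵀᵗ N 0 (suc (suc e)) a ≈ₛ 0ₛ
      Zᵀᵗ-label≥2 zero    e a = ℙ.refl
      Zᵀᵗ-label≥2 (suc N) e a = column-T*t-≥2 (at v 0) (at u 0) (Zᵀᵗ N 1) e a

    train-truncated : ∀ N → D̂ ⊠ ZtT* N ⊞ (ξ ⊠ Y) ⊠ ZtT*′ N ≈ₛ Î ⊠ ZT*t N
    train-truncated N = begin
      D̂ ⊠ ZtT* N ⊞ (ξ ⊠ Y) ⊠ ZtT*′ N
        ≈⟨ Σₛ-linear (suc S) D̂ (ξ ⊠ Y) (λ a → Σₛ (suc S) (Zᵗᵀ N 0 a)) (λ a → Σₛ (suc S) (Zᵗᵀ′ N 0 a)) ⟨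
      Σₛ (suc S) (λ a → D̂ ⊠ Σₛ (suc S) (Zᵗᵀ N 0 a) ⊞ (ξ ⊠ Y) ⊠ Σₛ (suc S) (Zᵗᵀ′ N 0 a))
        ≈⟨ Σₛ-cong (suc S) (λ a _ → ℙ.trans (ℙ.sym (Σₛ-linear (suc S) D̂ (ξ ⊠ Y) (Zᵗᵀ N 0 a) (Zᵗᵀ′ N 0 a)))
                                             (Σₛ-cong (suc S) (λ b _ → train N 0 a b))) ⟩
      Σₛ (suc S) (λ a → Σₛ (suc S) (ℛ (Zᵀᵗ N 0) a))
        ≈⟨ left-boundary S (Zᵀᵗ N 0) (Zᵀᵗ-label≥2 N)
             (go-vanishes-beyond Wst wt Wst-conserving wt-conserving 1 0 v u N 0 1 (suc S) (s≤s (s≤s sum-u≤S)))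
             (go-vanishes-beyond Wst wt Wst-conserving wt-conserving 1 0 v u N 0 0 (suc (suc S)) (s≤s (s≤s sum-u≤S))) ⟩
      Î ⊠ ZT*t N ∎

    intertwined : ∀ N → (1ₛ ⊞ ⊟ (X ⊠ Y)) ⊠ ZtT* N ⊞ (X ⊠ Y) ⊠ ZtT*′ N ≈ₛ ZT*t N
    intertwined N = begin
      (1ₛ ⊞ ⊟ (X ⊠ Y)) ⊠ L ⊞ (X ⊠ Y) ⊠ L′
        ≈⟨ solve 4 (λ x y l l′ → (𝟏 :- x :* y) :* l :+ x :* y :* l′ := 𝟏 :* l :+ :- (x :* y :* l) :+ x :* y :* l′) ℙ.refl X Y L L′ ⟩
      1ₛ ⊠ L ⊞ ⊟ ((X ⊠ Y) ⊠ L) ⊞ (X ⊠ Y) ⊠ L′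
        ≈⟨ ℙ.+-cong (ℙ.+-cong (⊠-congʳ L 1+αx-inverts-Î) (ℙ.-‿cong (⊠-congʳ L (⊠-congʳ Y 1+αx-times-ξ))))
                    (⊠-congʳ L′ (⊠-congʳ Y 1+αx-times-ξ)) ⟨
      (J ⊠ Î) ⊠ L ⊞ ⊟ (((J ⊠ ξ) ⊠ Y) ⊠ L) ⊞ ((J ⊠ ξ) ⊠ Y) ⊠ L′
        ≈⟨ solve 6 (λ j i x y l l′ → j :* i :* l :+ :- (j :* x :* y :* l) :+ j :* x :* y :* l′ := j :* ((i :- x :* y) :* l :+ x :* y :* l′)) ℙ.refl J Î ξ Y L L′ ⟩
      J ⊠ (D̂ ⊠ L ⊞ (ξ ⊠ Y) ⊠ L′)  ≈⟨ ⊠-congˡ J (train-truncated N) ⟩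
      J ⊠ (Î ⊠ ZT*t N)            ≈⟨ ℙ.*-assoc J Î (ZT*t N) ⟨
      (J ⊠ Î) ⊠ ZT*t N            ≈⟨ ⊠-congʳ (ZT*t N) 1+αx-inverts-Î ⟩
      1ₛ ⊠ ZT*t N                 ≈⟨ ℙ.*-identityˡ (ZT*t N) ⟩
      ZT*t N                      ∎
      where
      J = 1ₛ ⊞ α̂ ⊠ X
      L = ZtT* N
      L′ = ZtT*′ N

    ZtT*-solved : ∀ N → ZtT* N ≈ₛ inv1-xy ⊠ ZT*t N ⊞ ⊟ (inv1-xy ⊠ ((X ⊠ Y) ⊠ ZtT*′ N))
    ZtT*-solved N = begin
      ZtT* N                             ≈⟨ ℙ.*-identityˡ (ZtT* N) ⟨
      1ₛ ⊠ ZtT* N                        ≈⟨ ⊠-congʳ (ZtT* N) inv1-xy-inverse ⟨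
      (inv1-xy ⊠ W) ⊠ ZtT* N
        ≈⟨ solve 5 (λ s x y l l′ → s :* (𝟏 :- x :* y) :* l := s :* ((𝟏 :- x :* y) :* l :+ x :* y :* l′ :+ :- (x :* y :* l′)))
                   ℙ.refl inv1-xy X Y (ZtT* N) (ZtT*′ N) ⟩
      inv1-xy ⊠ ((W ⊠ ZtT* N ⊞ (X ⊠ Y) ⊠ ZtT*′ N) ⊞ ⊟ ((X ⊠ Y) ⊠ ZtT*′ N))
        ≈⟨ ⊠-congˡ inv1-xy (⊞-congʳ (⊟ ((X ⊠ Y) ⊠ ZtT*′ N)) (intertwined N)) ⟩
      inv1-xy ⊠ (ZT*t N ⊞ ⊟ ((X ⊠ Y) ⊠ ZtT*′ N))
        ≈⟨ solve 3 (λ s r e → s :* (r :+ :- e) := s :* r :+ :- (s :* e)) ℙ.refl inv1-xy (ZT*t N) ((X ⊠ Y) ⊠ ZtT*′ N) ⟩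
      inv1-xy ⊠ ZT*t N ⊞ ⊟ (inv1-xy ⊠ ((X ⊠ Y) ⊠ ZtT*′ N)) ∎
      where W = 1ₛ ⊞ ⊟ (X ⊠ Y)

    -- Beyond M sites the vertical labels vanish.
    M : ℕ
    M = length v + length u

    private
      length-v≤M : length v ≤ M + 0
      length-v≤M = ≡.subst (length v ≤_) (≡.sym (+-identityʳ M)) (m≤m+n (length v) (length u))

      length-u≤M : length u ≤ M + 0
      length-u≤M = ≡.subst (length u ≤_) (≡.sym (+-identityʳ M)) (m≤n+m (length u) (length v))

    ZT*t-stabilises : ∀ n → ZT*t (M + n) ≈ₛ ZT*t M
    ZT*t-stabilises n = Σₛ-cong (suc S) (λ e _ → Σₛ-cong (suc S) (λ a _ →
      Zᵀᵗ-stable M 0 (λ n′ e′ a′ → Zᵀᵗ-beyond-support n′ (M + 0) length-v≤M length-u≤M e′ a′) n e a))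

    ZtT*′-divisible : ∀ n → x^ n ∣ ZtT*′ (M + n)
    ZtT*′-divisible n = ∣-Σ (suc S) _ (λ a _ → ∣-Σ (suc S) _ (λ b _ →
      Zᵗᵀ′-divisible M 0 n n (λ c c′ → proj₁ (Zᵗᵀ′-beyond-support n (M + 0) length-u≤M c c′)) a b))

    T*t-converges : Converges ZT*t (ZT*t M)
    T*t-converges i j = M , λ N M≤N →
      ≡.subst (λ K → ZT*t K i j ≈ ZT*t M i j) (m+[n∸m]≡n M≤N) (unbox (ZT*t-stabilises (N ∸ M)) i j)

    tT*-converges : Converges ZtT* (inv1-xy ⊠ ZT*t M)
    tT*-converges i j = M + suc i , λ N M+1+i≤N →
      ≡.subst (λ K → ZtT* K i j ≈ (inv1-xy ⊠ ZT*t M) i j) (m+[n∸m]≡n (≤-trans (m≤m+n M (suc i)) M+1+i≤N))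
              (coefficient (N ∸ M) (≡.subst (_≤ N ∸ M) (m+n∸m≡n M (suc i)) (∸-monoˡ-≤ M M+1+i≤N)))
      where
      coefficient : ∀ n → i < n → ZtT* (M + n) i j ≈ (inv1-xy ⊠ ZT*t M) i j
      coefficient n i<n = R.trans (unbox (ZtT*-solved (M + n)) i j)
        (R.trans (R.+-cong (unbox (⊠-congˡ inv1-xy (ZT*t-stabilises n)) i j)
                           (∣-neg (∣-⊠ˡ inv1-xy _ (∣-⊠ˡ (X ⊠ Y) _ (ZtT*′-divisible n))) i j i<n))
                 (R.+-identityʳ _))

proposition6p1 : ∀ {c ℓ : Level} (R : CommutativeRing c ℓ)
    (α β : CommutativeRing.Carrier R) (v u : List ℕ) →
    Model.PropStatement R α β v u
proposition6p1 R α β v u =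
  inv1-xy *ₛ ZT*t M , ZT*t M , tT*-converges , T*t-converges , λ i j → CommutativeRing.refl R
  where
  open Model R α β using (inv1-xy; _*ₛ_)
  open Intertwining R α β using (module Lattice)
  open Lattice v u using (M; ZT*t; tT*-converges; T*t-converges)
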